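{- Let $0<\epsilon<1$ be a fixed constant and let $f:\{0,1\}^n\to\{0,1\}$ be unate. Then \[ \widetilde{\deg}(f) \le O(M_\epsilon(f)^4). \]
   Context: For $0<\epsilon<1$ and a Boolean function $f$, $\mathsf{N}_\epsilon(f)$ is the minimum degree of a real polynomial $p$ with $|p(x)|\le\epsilon$ whenever $f(x)=0$ and $|p(x)|\ge 1$ whenever $f(x)=1$ ($x\in\{0,1\}^n$), and $M_\epsilon(f):=\max\{\mathsf{N}_\epsilon(f),\mathsf{N}_\epsilon(\overline f)\}$ where $\overline f=1-f$. $\widetilde{\deg}(f)$ is the minimum degree of a real polynomial $p$ with $|f(x)-p(x)|\le 1/3$ for all $x\in\{0,1\}^n$. $f$ is unate if there exist $a\in\{0,1\}^n$ and a monotone (non-decreasing or non-increasing) Boolean function $g$ with $f(x)=g(x\oplus a)$ for all $x$. The $O(\cdot)$ hides a constant that may depend on $\epsilon$ only.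
   Formalization: The constant ε ranges over the rationals, and the polynomials in the definitions of $\mathsf{N}_\epsilon(f)$ and $\widetilde{\deg}(f)$ have rational coefficients rather than real ones. -}

module Defs where

open import Data.Bool using (Bool; true; false; not; _∧_)
open import Data.Nat using (ℕ; zero; suc) renaming (_≤_ to _≤ℕ_; _+_ to _+ℕ_)
open import Data.Integer using (+_)
open import Data.Rational using (ℚ; 0ℚ; 1ℚ; _+_; _*_; _-_; _≤_; _<_; ∣_∣; _/_)
open import Data.Vec using (Vec; []; _∷_; zipWith; lookup)
open import Data.Fin using (Fin)
open import Data.List using (List; map; foldr)
open import Data.List.Relation.Unary.All using (All)
open import Data.Product using (Σ; _×_; _,_)
open import Data.Sum using (_⊎_)
open import Relation.Binary.PropositionalEquality using (_≡_)

Cube : ℕ → Set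
Cube n = Vec Bool n

BoolFn : ℕ → Set
BoolFn n = Cube n → Bool

⟦_⟧ : Bool → ℚ
⟦ true ⟧  = 1ℚ
⟦ false ⟧ = 0ℚ

compl : ∀ {n} → BoolFn n → BoolFn n
compl f x = not (f x)

data _≤B_ : Bool → Bool → Set where
  f≤b : ∀ {b} → false ≤B b
  t≤t : true ≤B true

data _≼_ : ∀ {n} → Cube n → Cube n → Set where
  []≼  : [] ≼ []
  _∷≼_ : ∀ {n a b} {x y : Cube n} → a ≤B b → x ≼ y → (a ∷ x) ≼ (b ∷ y)

NonDecreasing : ∀ {n} → BoolFn n → Set
NonDecreasing g = ∀ x y → x ≼ y → g x ≤B g y

NonIncreasing : ∀ {n} → BoolFn n → Set
NonIncreasing g = ∀ x y → x ≼ y → g y ≤B g x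

Monotone : ∀ {n} → BoolFn n → Set
Monotone g = NonDecreasing g ⊎ NonIncreasing g

xorB : Bool → Bool → Bool
xorB true b = not b
xorB false b = b

_⊕_ : ∀ {n} → Cube n → Cube n → Cube n
_⊕_ = zipWith xorB

Unate : ∀ {n} → BoolFn n → Set
Unate {n} f = Σ (Cube n) λ a → Σ (BoolFn n) λ g → Monotone g × (∀ x → f x ≡ g (x ⊕ a))

-- A monomial is an exponent vector; a polynomial is a finite list of
-- (coefficient, exponent vector) terms.
Monomial : ℕ → Set
Monomial n = Vec ℕ n

Poly : ℕ → Set
Poly n = List (ℚ × Monomial n)

sumℕ : ∀ {n} → Vec ℕ n → ℕ
sumℕ [] = 0
sumℕ (e ∷ es) = e +ℕ sumℕ es

_^q_ : ℚ → ℕ → ℚ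
q ^q zero = 1ℚ
q ^q suc k = q * (q ^q k)

evalMono : ∀ {n} → Monomial n → Cube n → ℚ
evalMono [] [] = 1ℚ
evalMono (e ∷ es) (b ∷ x) = (⟦ b ⟧ ^q e) * evalMono es x

eval : ∀ {n} → Poly n → Cube n → ℚ
eval p x = foldr (λ t acc → Data.Product.proj₁ t * evalMono (Data.Product.proj₂ t) x + acc) 0ℚ p

DegLe : ∀ {n} → Poly n → ℕ → Set
DegLe p d = All (λ t → sumℕ (Data.Product.proj₂ t) ≤ℕ d) p

NDegLe : ∀ {n} → ℚ → BoolFn n → ℕ → Set
NDegLe {n} ε f d = Σ (Poly n) λ p → DegLe p d ×
  (∀ x → (f x ≡ false → ∣ eval p x ∣ ≤ ε) × (f x ≡ true → 1ℚ ≤ ∣ eval p x ∣))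

MDegLe : ∀ {n} → ℚ → BoolFn n → ℕ → Set
MDegLe ε f d = NDegLe ε f d × NDegLe ε (compl f) d

ApproxDegLe : ∀ {n} → BoolFn n → ℕ → Set
ApproxDegLe {n} f d = Σ (Poly n) λ p → DegLe p d ×
  (∀ x → ∣ ⟦ f x ⟧ - eval p x ∣ ≤ (+ 1) / 3)

{-# OPTIONS --safe #-}
-- Shifting the inputs by an xor turns a unate function into a nondecreasing one h, and such shifts
-- preserve every degree measure involved. For monotone h, a minimal 1-input y has the ones of y as a
-- 1-certificate and a maximal 0-input has its zeros as a 0-certificate. On such a certificate S a
-- polynomial witnessing N_ε(h) (with complemented inputs) or N_ε(1 - h) is ≥ 1 at one point x and
-- ≤ ε on every x ∪ y with ∅ ≠ y ⊆ S. Averaging it over the layers |y| = k gives a univariate polynomial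
-- of the same degree m with this jump between k = 0 and k = 1, ..., |S|; a divided difference on the
-- nodes 0, 1 and c j² (j ≤ m) shows that this forces |S| ≤ c m². Hence C₀(h), C₁(h) ≤ c m², and
-- deg h ≤ C₀(h) C₁(h) gives an exact, so in particular approximating, polynomial of degree c² m⁴.
module Submission where

module Combinatorics where

  open import Data.Nat
  open import Data.Nat.Properties
  open import Data.Nat.Combinatorics using (_C_; nCk+nC[k+1]≡[n+1]C[k+1]; nC1≡n)
  open import Data.Nat.Solver
  open import Data.List using (List; []; _∷_; map; applyDownFrom)
  open import Data.Nat.ListAction using (product)
  open import Relation.Binary.PropositionalEquality
  open +-*-Solver

  pascal : ∀ n k → suc n C suc k ≡ n C k + n C suc k
  pascal n k = sym (nCk+nC[k+1]≡[n+1]C[k+1] n k)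

  nCk-pos : ∀ {n k} → k ≤ n → 0 < n C k
  nCk-pos {n} {zero} _ = s≤s z≤n
  nCk-pos {suc n} {suc k} (s≤s k≤n) = <-≤-trans (nCk-pos k≤n) (≤-trans (m≤m+n _ _) (≤-reflexive (sym (pascal n k))))

  absorption : ∀ n k → suc k * (suc n C suc k) ≡ suc n * (n C k)
  absorption zero zero = refl
  absorption zero (suc k) = *-zeroʳ (suc (suc k))
  absorption (suc n) zero = trans (*-identityˡ _) (trans (nC1≡n (suc (suc n))) (sym (*-identityʳ (suc (suc n)))))
  absorption (suc n) (suc k) = begin
    suc (suc k) * (suc (suc n) C suc (suc k))
      ≡⟨ cong (suc (suc k) *_) (pascal (suc n) (suc k)) ⟩
    suc (suc k) * (a + b)
      ≡⟨ solve 3 (λ k a b → (con 1 :+ k) :* (a :+ b) := k :* a :+ a :+ (con 1 :+ k) :* b) refl (suc k) a b ⟩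
    suc k * a + a + suc (suc k) * b
      ≡⟨ cong₂ (λ x y → x + a + y) (absorption n k) (absorption n (suc k)) ⟩
    suc n * (n C k) + a + suc n * (n C suc k)
      ≡⟨ solve 4 (λ n x y a → n :* x :+ a :+ n :* y := a :+ n :* (x :+ y)) refl (suc n) (n C k) (n C suc k) a ⟩
    a + suc n * (n C k + n C suc k)
      ≡⟨ cong (λ x → a + suc n * x) (sym (pascal n k)) ⟩
    suc (suc n) * a ∎
    where
    open ≡-Reasoning
    a = suc n C suc k
    b = suc n C suc (suc k)

  0<m*n : ∀ {m n} → 0 < m → 0 < n → 0 < m * n
  0<m*n {suc m} {suc n} _ _ = s≤s z≤n

  0<m*n⇒0<m : ∀ m {n} → 0 < m * n → 0 < m
  0<m*n⇒0<m (suc m) _ = s≤s z≤n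

  falling : ℕ → ℕ → ℕ
  falling s zero = 1
  falling s (suc t) = s * falling (s ∸ 1) t

  falling-pos : ∀ {s t} → t ≤ s → 0 < falling s t
  falling-pos {s} {zero} _ = s≤s z≤n
  falling-pos {suc s} {suc t} (s≤s t≤s) = 0<m*n {suc s} (s≤s z≤n) (falling-pos t≤s)

  -- supersets t u k counts the k-subsets of a (t + u)-set containing a fixed t-subset.
  supersets : ℕ → ℕ → ℕ → ℕ
  supersets zero u k = u C k
  supersets (suc t) u zero = 0
  supersets (suc t) u (suc k) = supersets t u k

  supersets-pascal : ∀ t u k → supersets t (suc u) k ≡ supersets t u k + supersets (suc t) u k
  supersets-pascal zero u zero = refl
  supersets-pascal zero u (suc k) = trans (pascal u k) (+-comm (u C k) (u C suc k))
  supersets-pascal (suc t) u zero = refl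
  supersets-pascal (suc t) u (suc k) = supersets-pascal t u k

  supersets-falling : ∀ t u k → supersets t u k * falling (t + u) t ≡ ((t + u) C k) * falling k t
  supersets-falling zero u k = refl
  supersets-falling (suc t) u zero = sym (*-zeroʳ ((suc t + u) C 0))
  supersets-falling (suc t) u (suc k) = begin
    supersets t u k * (suc (t + u) * falling (t + u) t)
      ≡⟨ solve 3 (λ a b c → a :* (b :* c) := b :* (a :* c)) refl (supersets t u k) (suc (t + u)) (falling (t + u) t) ⟩
    suc (t + u) * (supersets t u k * falling (t + u) t)
      ≡⟨ cong (suc (t + u) *_) (supersets-falling t u k) ⟩
    suc (t + u) * (((t + u) C k) * falling k t)
      ≡⟨ sym (*-assoc (suc (t + u)) ((t + u) C k) (falling k t)) ⟩
    suc (t + u) * ((t + u) C k) * falling k t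
      ≡⟨ cong (_* falling k t) (sym (absorption (t + u) k)) ⟩
    suc k * (suc (t + u) C suc k) * falling k t
      ≡⟨ solve 3 (λ a b c → a :* b :* c := b :* (a :* c)) refl (suc k) (suc (t + u) C suc k) (falling k t) ⟩
    (suc (t + u) C suc k) * (suc k * falling k t) ∎
    where open ≡-Reasoning

  downFrom1 : ℕ → List ℕ
  downFrom1 = applyDownFrom suc

  ∏ℕ : List ℕ → (ℕ → ℕ) → ℕ
  ∏ℕ xs f = product (map f xs)

  ∏ℕ-cong : ∀ xs {f g : ℕ → ℕ} → (∀ j → f j ≡ g j) → ∏ℕ xs f ≡ ∏ℕ xs g
  ∏ℕ-cong [] _ = refl
  ∏ℕ-cong (x ∷ xs) f≗g = cong₂ _*_ (f≗g x) (∏ℕ-cong xs f≗g)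

  ∏-shifted-up : ∀ b m → ∏ℕ (downFrom1 m) (b +_) * b ! ≡ (b + m) !
  ∏-shifted-up b zero = trans (+-identityʳ (b !)) (cong _! (sym (+-identityʳ b)))
  ∏-shifted-up b (suc m) = begin
    (b + suc m) * ∏ℕ (downFrom1 m) (b +_) * b !    ≡⟨ *-assoc (b + suc m) _ _ ⟩
    (b + suc m) * (∏ℕ (downFrom1 m) (b +_) * b !)  ≡⟨ cong ((b + suc m) *_) (∏-shifted-up b m) ⟩
    (b + suc m) * (b + m) !                         ≡⟨ cong (λ x → x * (b + m) !) (+-suc b m) ⟩
    suc (b + m) * (b + m) !                         ≡⟨ cong _! (sym (+-suc b m)) ⟩
    (b + suc m) !                                   ∎
    where open ≡-Reasoning

  ∏-shifted-down : ∀ a m → ∏ℕ (downFrom1 m) (λ j → (a + suc m) ∸ j) * a ! ≡ (a + m) !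
  ∏-shifted-down a zero = trans (+-identityʳ (a !)) (cong _! (sym (+-identityʳ a)))
  ∏-shifted-down a (suc m) = begin
    ((a + suc (suc m)) ∸ suc m) * ∏ℕ (downFrom1 m) (λ j → (a + suc (suc m)) ∸ j) * a !
      ≡⟨ cong₂ (λ x y → x * y * a !) top (∏ℕ-cong (downFrom1 m) (λ j → cong (_∸ j) (+-suc a (suc m)))) ⟩
    suc a * ∏ℕ (downFrom1 m) (λ j → (suc a + suc m) ∸ j) * a !
      ≡⟨ solve 3 (λ x y z → x :* y :* z := y :* (x :* z)) refl (suc a) (∏ℕ (downFrom1 m) (λ j → (suc a + suc m) ∸ j)) (a !) ⟩
    ∏ℕ (downFrom1 m) (λ j → (suc a + suc m) ∸ j) * (suc a) !
      ≡⟨ ∏-shifted-down (suc a) m ⟩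
    (suc a + m) !
      ≡⟨ cong _! (sym (+-suc a m)) ⟩
    (a + suc m) ! ∎
    where
    open ≡-Reasoning
    top : (a + suc (suc m)) ∸ suc m ≡ suc a
    top = trans (cong (_∸ suc m) (+-suc a (suc m))) (m+n∸n≡m (suc a) (suc m))

  ∏-squares : ∀ m → ∏ℕ (downFrom1 m) (λ j → j * j) ≡ m ! * m !
  ∏-squares zero = refl
  ∏-squares (suc m) = trans (cong (suc m * suc m *_) (∏-squares m))
    (solve 2 (λ a b → a :* a :* (b :* b) := a :* b :* (a :* b)) refl (suc m) (m !))

  factorials-top : ∀ m X → X * suc m ! ≡ (suc m + m) ! →
    m ! * m ! * ((suc m ∸ suc m) ! * (suc m + suc m) !) ≡ 2 * (suc m ! * suc m !) * (m ! * X)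
  factorials-top m X X*M!≡[M+m]! = begin
    m ! * m ! * ((M ∸ M) ! * (M + M) !)        ≡⟨ cong (λ z → m ! * m ! * (z ! * (M + M) !)) (n∸n≡0 M) ⟩
    m ! * m ! * (1 * (M + M) !)                ≡⟨ cong (λ z → m ! * m ! * (1 * ((M + M) * z))) (trans (cong _! (+-suc m m)) (sym X*M!≡[M+m]!)) ⟩
    m ! * m ! * (1 * ((M + M) * (X * M !)))    ≡⟨ solve 3 (λ a x M → a :* a :* (con 1 :* ((M :+ M) :* (x :* (M :* a))))
                                                     := con 2 :* ((M :* a) :* (M :* a)) :* (a :* x)) refl (m !) X M ⟩
    2 * (M ! * M !) * (m ! * X)                ∎
    where
    open ≡-Reasoning
    M = suc m

  factorials-step : ∀ m i → i ≤ m →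
    suc m * suc m * (2 * (m ! * m !)) * ((suc m ∸ i) ! * (suc m + i) !)
      ≡ 2 * (suc m ! * suc m !) * ((suc m ∸ i) * (suc m + i) * ((m ∸ i) ! * (m + i) !))
  factorials-step m i i≤m = begin
    M * M * (2 * (m ! * m !)) * ((M ∸ i) ! * (M + i) !)
      ≡⟨ cong (λ z → M * M * (2 * (m ! * m !)) * (z ! * (M + i) !)) M∸i≡1+d ⟩
    M * M * (2 * (m ! * m !)) * ((suc d * d !) * (suc (m + i) * (m + i) !))
      ≡⟨ solve 6 (λ M a sd dd B bb → M :* M :* (con 2 :* (a :* a)) :* ((sd :* dd) :* (B :* bb))
                     := con 2 :* ((M :* a) :* (M :* a)) :* (sd :* B :* (dd :* bb))) refl
           M (m !) (suc d) (d !) (suc (m + i)) ((m + i) !) ⟩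
    2 * (M ! * M !) * (suc d * (M + i) * ((m ∸ i) ! * (m + i) !))
      ≡⟨ cong (λ z → 2 * (M ! * M !) * (z * (M + i) * ((m ∸ i) ! * (m + i) !))) (sym M∸i≡1+d) ⟩
    2 * (M ! * M !) * ((M ∸ i) * (M + i) * ((m ∸ i) ! * (m + i) !)) ∎
    where
    open ≡-Reasoning
    M = suc m
    d = m ∸ i
    M∸i≡1+d : M ∸ i ≡ suc d
    M∸i≡1+d = +-∸-assoc 1 i≤m

  m!²≤[m∸i]![m+i]! : ∀ m i → i ≤ m → m ! * m ! ≤ (m ∸ i) ! * (m + i) !
  m!²≤[m∸i]![m+i]! m zero _ = ≤-reflexive (cong (λ b → m ! * b !) (sym (+-identityʳ m)))
  m!²≤[m∸i]![m+i]! m (suc i) i<m = ≤-trans (m!²≤[m∸i]![m+i]! m i (<⇒≤ i<m)) step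
    where
    d = m ∸ suc i
    ∸-suc : ∀ {m i} → i < m → m ∸ i ≡ suc (m ∸ suc i)
    ∸-suc {suc m} {zero} _ = refl
    ∸-suc {suc m} {suc i} (s≤s i<m) = ∸-suc i<m
    step : (m ∸ i) ! * (m + i) ! ≤ d ! * (m + suc i) !
    step = begin
      (m ∸ i) ! * (m + i) !         ≡⟨ cong (λ x → x ! * (m + i) !) (∸-suc i<m) ⟩
      suc d * d ! * (m + i) !       ≡⟨ solve 3 (λ a b c → a :* b :* c := b :* (a :* c)) refl (suc d) (d !) ((m + i) !) ⟩
      d ! * (suc d * (m + i) !)     ≤⟨ *-monoʳ-≤ (d !) (*-monoˡ-≤ ((m + i) !) (s≤s (≤-trans (m∸n≤m m (suc i)) (m≤m+n m i)))) ⟩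
      d ! * (suc (m + i) * (m + i) !) ≡⟨ cong (λ x → d ! * x !) (sym (+-suc m i)) ⟩
      d ! * (m + suc i) !           ∎
      where open ≤-Reasoning

  scaledSq : ℕ → ℕ → ℕ
  scaledSq c j = c * (j * j)

  scaledSq≥2 : ∀ c j → 2 ≤ c → 1 ≤ j → 2 ≤ scaledSq c j
  scaledSq≥2 c j 2≤c 1≤j = *-mono-≤ 2≤c (*-mono-≤ 1≤j 1≤j)

  scaledSq-gap : ∀ c j → 2 ≤ c → 1 ≤ j → c * (j * suc j) ≤ 4 * (scaledSq c j ∸ 1)
  scaledSq-gap c j 2≤c 1≤j = begin
    c * (j * suc j)     ≡⟨ cong (c *_) (*-suc j j) ⟩
    c * (j + j * j)     ≡⟨ *-distribˡ-+ c j (j * j) ⟩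
    c * j + s           ≤⟨ +-monoˡ-≤ s (*-monoʳ-≤ c (m≤m*n j j {{>-nonZero 1≤j}})) ⟩
    s + s               ≡⟨ cong (λ z → z + z) s≡2+r ⟩
    (2 + r) + (2 + r)   ≡⟨ solve 1 (λ r → (con 2 :+ r) :+ (con 2 :+ r) := con 4 :+ con 2 :* r) refl r ⟩
    4 + 2 * r           ≤⟨ +-monoʳ-≤ 4 (*-monoˡ-≤ r {2} {4} (s≤s (s≤s z≤n))) ⟩
    4 + 4 * r           ≡⟨ sym (*-distribˡ-+ 4 1 r) ⟩
    4 * (1 + r)         ≡⟨ cong (λ z → 4 * (z ∸ 1)) (sym s≡2+r) ⟩
    4 * (s ∸ 1)         ∎
    where
    open ≤-Reasoning
    s = scaledSq c j
    r = s ∸ 2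
    s≡2+r : s ≡ 2 + r
    s≡2+r = sym (m+[n∸m]≡n (scaledSq≥2 c j 2≤c 1≤j))

  scaledSq-mono-< : ∀ c {j k} → 1 ≤ c → j < k → scaledSq c j < scaledSq c k
  scaledSq-mono-< (suc c) _ j<k = *-monoʳ-< (suc c) (*-mono-< j<k j<k)

  scaledSq-mono-≤ : ∀ c {j k} → j ≤ k → scaledSq c j ≤ scaledSq c k
  scaledSq-mono-≤ c j≤k = *-monoʳ-≤ c (*-mono-≤ j≤k j≤k)

  scaledSq² : ∀ c m → scaledSq c m * scaledSq c m ≡ c * c * m ^ 4
  scaledSq² c m = solve 2 (λ c m → (c :* (m :* m)) :* (c :* (m :* m)) := c :* c :* (m :* (m :* (m :* (m :* con 1))))) refl c m

open Combinatorics

open import Defs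
open import Data.Nat as ℕ using (ℕ; zero; suc; _!)
import Data.Nat.Properties as ℕₚ
open import Data.Nat.Combinatorics using (_C_)
import Data.Integer as ℤ
import Data.Integer.Properties as ℤₚ
open import Data.Rational
open import Data.Rational.Properties
import Data.Rational.Unnormalised as ℚᵘ
import Data.Rational.Unnormalised.Properties as ℚᵘₚ
import Data.Rational.Solver as ℚ-Solver
open ℚ-Solver.+-*-Solver using (solve; _:=_; _:+_; _:*_; :-_; _:-_; con)
open import Data.Bool using (Bool; true; false; not; _∨_)
open import Data.Bool.Properties using (∨-identityʳ; ∨-zeroʳ; not-involutive; ¬-not)
open import Data.Empty using (⊥; ⊥-elim)
open import Data.Fin using (Fin; zero; suc)
import Data.Fin.Properties as Finₚ
open import Data.List using (List; []; _∷_; _++_; map; length; filter)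
open import Data.List.Properties using (map-∘; length-map; length-applyDownFrom; filter-notAll)
open import Data.List.Relation.Unary.All as All using (All; []; _∷_; all?)
open import Data.List.Relation.Unary.All.Properties using (map⁺; applyDownFrom⁺₁; filter⁺; ¬All⇒Any¬)
open import Data.List.Relation.Unary.Any using (here; there)
import Data.List.Relation.Unary.Any as Any
import Data.List.Relation.Unary.Any.Properties as Anyₚ
open import Data.List.Relation.Unary.Unique.Propositional using (Unique; []; _∷_)
open import Data.List.Membership.Propositional using (_∈_; _∉_)
open import Data.List.Membership.Propositional.Properties using (∈-filter⁺)
import Data.List.Membership.DecPropositional as DecMembership
open import Data.Product using (Σ; _×_; _,_; proj₁; proj₂)
open import Data.Sum using (_⊎_; inj₁; inj₂)
open import Data.Unit using (⊤; tt)
open import Data.Vec using (Vec; []; _∷_; lookup; replicate; zipWith; _[_]≔_)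
import Data.Vec as Vec
open import Data.Vec.Properties using ([]≔-lookup; lookup∘update; lookup∘update′; tabulate∘lookup; tabulate-cong; lookup-zipWith; lookup-map; lookup-replicate)
open import Relation.Binary.PropositionalEquality
open import Relation.Nullary using (Dec; yes; no; ¬?; _×-dec_)

⟨_⟩ : ℕ → ℚ
⟨ zero ⟩ = 0ℚ
⟨ suc n ⟩ = 1ℚ + ⟨ n ⟩

⟨⟩-homo-+ : ∀ m n → ⟨ m ℕ.+ n ⟩ ≡ ⟨ m ⟩ + ⟨ n ⟩
⟨⟩-homo-+ zero n = sym (+-identityˡ _)
⟨⟩-homo-+ (suc m) n = trans (cong (1ℚ +_) (⟨⟩-homo-+ m n)) (sym (+-assoc 1ℚ ⟨ m ⟩ ⟨ n ⟩))

⟨⟩-homo-* : ∀ m n → ⟨ m ℕ.* n ⟩ ≡ ⟨ m ⟩ * ⟨ n ⟩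
⟨⟩-homo-* zero n = sym (*-zeroˡ ⟨ n ⟩)
⟨⟩-homo-* (suc m) n = begin
  ⟨ n ℕ.+ m ℕ.* n ⟩      ≡⟨ ⟨⟩-homo-+ n (m ℕ.* n) ⟩
  ⟨ n ⟩ + ⟨ m ℕ.* n ⟩    ≡⟨ cong (⟨ n ⟩ +_) (⟨⟩-homo-* m n) ⟩
  ⟨ n ⟩ + ⟨ m ⟩ * ⟨ n ⟩  ≡⟨ solve 2 (λ a b → b :+ a :* b := (con 1ℚ :+ a) :* b) refl ⟨ m ⟩ ⟨ n ⟩ ⟩
  (1ℚ + ⟨ m ⟩) * ⟨ n ⟩   ∎
  where open ≡-Reasoning

⟨⟩-homo-∸ : ∀ m n → n ℕ.≤ m → ⟨ m ℕ.∸ n ⟩ ≡ ⟨ m ⟩ - ⟨ n ⟩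
⟨⟩-homo-∸ m zero _ = solve 1 (λ a → a := a :- con 0ℚ) refl ⟨ m ⟩
⟨⟩-homo-∸ (suc m) (suc n) (ℕ.s≤s n≤m) =
  trans (⟨⟩-homo-∸ m n n≤m) (solve 2 (λ a b → a :- b := (con 1ℚ :+ a) :- (con 1ℚ :+ b)) refl ⟨ m ⟩ ⟨ n ⟩)

0≤p+q : ∀ {p q} → 0ℚ ≤ p → 0ℚ ≤ q → 0ℚ ≤ p + q
0≤p+q {p} {q} 0≤p 0≤q = subst (_≤ p + q) (+-identityˡ 0ℚ) (+-mono-≤ 0≤p 0≤q)

0≤p*q : ∀ {p q} → 0ℚ ≤ p → 0ℚ ≤ q → 0ℚ ≤ p * q
0≤p*q {p} {q} 0≤p 0≤q = subst (_≤ p * q) (*-zeroˡ q) (*-monoʳ-≤-nonNeg q {{nonNegative 0≤q}} 0≤p)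

*-monoˡ-≤-0≤ : ∀ {p q} r → 0ℚ ≤ r → p ≤ q → r * p ≤ r * q
*-monoˡ-≤-0≤ r 0≤r = *-monoˡ-≤-nonNeg r {{nonNegative 0≤r}}

*-monoʳ-≤-0≤ : ∀ {p q} r → 0ℚ ≤ r → p ≤ q → p * r ≤ q * r
*-monoʳ-≤-0≤ r 0≤r = *-monoʳ-≤-nonNeg r {{nonNegative 0≤r}}

0≤1 : 0ℚ ≤ 1ℚ
0≤1 = <⇒≤ (positive⁻¹ 1ℚ)

⟨⟩-nonNeg : ∀ n → 0ℚ ≤ ⟨ n ⟩
⟨⟩-nonNeg zero = ≤-refl
⟨⟩-nonNeg (suc n) = 0≤p+q 0≤1 (⟨⟩-nonNeg n)

⟨⟩-pos : ∀ {n} → 0 ℕ.< n → 0ℚ < ⟨ n ⟩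
⟨⟩-pos {suc n} _ = subst (_< 1ℚ + ⟨ n ⟩) (+-identityʳ 0ℚ) (+-mono-<-≤ (positive⁻¹ 1ℚ) (⟨⟩-nonNeg n))

⟨⟩-nonZero : ∀ {n} → 0 ℕ.< n → ⟨ n ⟩ ≢ 0ℚ
⟨⟩-nonZero 0<n = ≢-sym (<⇒≢ (⟨⟩-pos 0<n))

⟨⟩-injective : ∀ {m n} → ⟨ m ⟩ ≡ ⟨ n ⟩ → m ≡ n
⟨⟩-injective {zero} {zero} _ = refl
⟨⟩-injective {zero} {suc n} e = ⊥-elim (⟨⟩-nonZero {suc n} (ℕ.s≤s ℕ.z≤n) (sym e))
⟨⟩-injective {suc m} {zero} e = ⊥-elim (⟨⟩-nonZero {suc m} (ℕ.s≤s ℕ.z≤n) e)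
⟨⟩-injective {suc m} {suc n} e = cong suc (⟨⟩-injective (+-cancelˡ e))
  where
  +-cancelˡ : ∀ {a b} → 1ℚ + a ≡ 1ℚ + b → a ≡ b
  +-cancelˡ {a} {b} e′ = begin
    a                ≡⟨ solve 1 (λ x → x := (con 1ℚ :+ x) :- con 1ℚ) refl a ⟩
    (1ℚ + a) - 1ℚ    ≡⟨ cong (_- 1ℚ) e′ ⟩
    (1ℚ + b) - 1ℚ    ≡⟨ solve 1 (λ x → (con 1ℚ :+ x) :- con 1ℚ := x) refl b ⟩
    b                ∎
    where open ≡-Reasoning

⟨⟩-mono-≤ : ∀ {m n} → m ℕ.≤ n → ⟨ m ⟩ ≤ ⟨ n ⟩
⟨⟩-mono-≤ {m} {n} m≤n = begin
  ⟨ m ⟩                  ≡⟨ sym (+-identityʳ ⟨ m ⟩) ⟩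
  ⟨ m ⟩ + 0ℚ             ≤⟨ +-monoʳ-≤ ⟨ m ⟩ (⟨⟩-nonNeg (n ℕ.∸ m)) ⟩
  ⟨ m ⟩ + ⟨ n ℕ.∸ m ⟩    ≡⟨ sym (⟨⟩-homo-+ m (n ℕ.∸ m)) ⟩
  ⟨ m ℕ.+ (n ℕ.∸ m) ⟩    ≡⟨ cong ⟨_⟩ (ℕₚ.m+[n∸m]≡n m≤n) ⟩
  ⟨ n ⟩                  ∎
  where open ≤-Reasoning

-- A total reciprocal: recip 0ℚ is the junk value 0ℚ, so expressions such as
-- recip (⟨ k ⟩ - ⟨ a ⟩) can be written without nonzeroness proofs.
recip : ℚ → ℚ
recip q with q ≟ 0ℚ
... | yes _ = 0ℚ
... | no q≢0 = (1/ q) {{≢-nonZero q≢0}}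

recip-cases : ∀ q → q ≡ 0ℚ ⊎ q * recip q ≡ 1ℚ
recip-cases q with q ≟ 0ℚ
... | yes q≡0 = inj₁ q≡0
... | no q≢0 = inj₂ (*-inverseʳ q {{≢-nonZero q≢0}})

*-recipʳ : ∀ q → q ≢ 0ℚ → q * recip q ≡ 1ℚ
*-recipʳ q q≢0 with recip-cases q
... | inj₁ q≡0 = ⊥-elim (q≢0 q≡0)
... | inj₂ q*q⁻¹≡1 = q*q⁻¹≡1

recip-unique : ∀ p q → p * q ≡ 1ℚ → q ≡ recip p
recip-unique p q pq≡1 with recip-cases p
... | inj₁ refl = ⊥-elim (1≢0 (trans (sym pq≡1) (*-zeroˡ q)))
... | inj₂ p*p⁻¹≡1 = begin
  q                    ≡⟨ sym (*-identityˡ q) ⟩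
  1ℚ * q               ≡⟨ cong (_* q) (sym (trans (*-comm (recip p) p) p*p⁻¹≡1)) ⟩
  (recip p * p) * q    ≡⟨ *-assoc (recip p) p q ⟩
  recip p * (p * q)    ≡⟨ cong (recip p *_) pq≡1 ⟩
  recip p * 1ℚ         ≡⟨ *-identityʳ (recip p) ⟩
  recip p              ∎
  where open ≡-Reasoning

recip-* : ∀ p q → recip (p * q) ≡ recip p * recip q
recip-* p q with recip-cases p | recip-cases q
... | inj₁ refl | _ = trans (cong recip (*-zeroˡ q)) (sym (*-zeroˡ (recip q)))
... | inj₂ _ | inj₁ refl = trans (cong recip (*-zeroʳ p)) (sym (*-zeroʳ (recip p)))
... | inj₂ p*p⁻¹≡1 | inj₂ q*q⁻¹≡1 = sym (recip-unique (p * q) (recip p * recip q) (begin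
  (p * q) * (recip p * recip q)    ≡⟨ solve 4 (λ a b c d → (a :* b) :* (c :* d) := (a :* c) :* (b :* d)) refl p q (recip p) (recip q) ⟩
  (p * recip p) * (q * recip q)    ≡⟨ cong₂ _*_ p*p⁻¹≡1 q*q⁻¹≡1 ⟩
  1ℚ                               ∎))
  where open ≡-Reasoning

∣recip∣ : ∀ q → ∣ recip q ∣ ≡ recip ∣ q ∣
∣recip∣ q with recip-cases q
... | inj₁ refl = refl
... | inj₂ q*q⁻¹≡1 = recip-unique ∣ q ∣ ∣ recip q ∣
  (trans (sym (∣p*q∣≡∣p∣*∣q∣ q (recip q))) (cong ∣_∣ q*q⁻¹≡1))

recip-neg : ∀ q → recip (- q) ≡ - recip q
recip-neg q with recip-cases q
... | inj₁ refl = refl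
... | inj₂ q*q⁻¹≡1 = sym (recip-unique (- q) (- recip q)
  (trans (solve 2 (λ a b → (:- a) :* (:- b) := a :* b) refl q (recip q)) q*q⁻¹≡1))

recip-pos : ∀ {q} → 0ℚ < q → 0ℚ < recip q
recip-pos {q} 0<q with q ≟ 0ℚ
... | yes refl = ⊥-elim (<-irrefl refl 0<q)
... | no q≢0 = positive⁻¹ _ {{1/pos⇒pos q {{positive 0<q}}}}

recip-nonNeg : ∀ {q} → 0ℚ ≤ q → 0ℚ ≤ recip q
recip-nonNeg {q} 0≤q with q ≟ 0ℚ
... | yes _ = ≤-refl
... | no q≢0 = <⇒≤ (positive⁻¹ _ {{1/pos⇒pos q {{positive (≤∧≢⇒< 0≤q (≢-sym q≢0))}}}})
  where
  ≤∧≢⇒< : ∀ {p r} → p ≤ r → p ≢ r → p < r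
  ≤∧≢⇒< {p} {r} p≤r p≢r with p <? r
  ... | yes p<r = p<r
  ... | no p≮r = ⊥-elim (p≢r (≤-antisym p≤r (≮⇒≥ p≮r)))

recip-cancelˡ : ∀ p q → p ≢ 0ℚ → p * recip (p * q) ≡ recip q
recip-cancelˡ p q p≢0 = begin
  p * recip (p * q)          ≡⟨ cong (p *_) (recip-* p q) ⟩
  p * (recip p * recip q)    ≡⟨ sym (*-assoc p (recip p) (recip q)) ⟩
  p * recip p * recip q      ≡⟨ cong (_* recip q) (*-recipʳ p p≢0) ⟩
  1ℚ * recip q               ≡⟨ *-identityˡ (recip q) ⟩
  recip q                    ∎
  where open ≡-Reasoning

recip-involutive : ∀ q → recip (recip q) ≡ q
recip-involutive q with recip-cases q
... | inj₁ refl = refl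
... | inj₂ q*q⁻¹≡1 = sym (recip-unique (recip q) q (trans (*-comm (recip q) q) q*q⁻¹≡1))

a*b≡c*d⇒a/c≡d/b : ∀ a b c d → a * b ≡ c * d → b ≢ 0ℚ → c ≢ 0ℚ → a * recip c ≡ d * recip b
a*b≡c*d⇒a/c≡d/b a b c d ab≡cd b≢0 c≢0 = begin
  a * recip c                          ≡⟨ solve 3 (λ a r c → a :* r := a :* r :* con 1ℚ) refl a (recip c) c ⟩
  a * recip c * 1ℚ                     ≡⟨ cong (a * recip c *_) (sym (*-recipʳ b b≢0)) ⟩
  a * recip c * (b * recip b)          ≡⟨ solve 4 (λ a r b s → a :* r :* (b :* s) := a :* b :* r :* s) refl a (recip c) b (recip b) ⟩
  a * b * recip c * recip b            ≡⟨ cong (λ z → z * recip c * recip b) ab≡cd ⟩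
  c * d * recip c * recip b            ≡⟨ solve 4 (λ c d r s → c :* d :* r :* s := d :* s :* (c :* r)) refl c d (recip c) (recip b) ⟩
  d * recip b * (c * recip c)          ≡⟨ cong (d * recip b *_) (*-recipʳ c c≢0) ⟩
  d * recip b * 1ℚ                     ≡⟨ *-identityʳ _ ⟩
  d * recip b                          ∎
  where open ≡-Reasoning

⟨⟩-rescale : ∀ P D Q Z W → P * ⟨ D ⟩ ≡ ⟨ Q ⟩ → 0 ℕ.< D → Q ℕ.* Z ≡ W ℕ.* D → P * ⟨ Z ⟩ ≡ ⟨ W ⟩
⟨⟩-rescale P D Q Z W PD≡Q 0<D QZ≡WD = begin
  P * ⟨ Z ⟩                         ≡⟨ solve 3 (λ p z r → p :* z := p :* z :* con 1ℚ) refl P ⟨ Z ⟩ (recip ⟨ D ⟩) ⟩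
  P * ⟨ Z ⟩ * 1ℚ                    ≡⟨ cong (P * ⟨ Z ⟩ *_) (sym (*-recipʳ ⟨ D ⟩ D≢0)) ⟩
  P * ⟨ Z ⟩ * (⟨ D ⟩ * recip ⟨ D ⟩) ≡⟨ solve 4 (λ p z d r → p :* z :* (d :* r) := p :* d :* z :* r) refl P ⟨ Z ⟩ ⟨ D ⟩ (recip ⟨ D ⟩) ⟩
  P * ⟨ D ⟩ * ⟨ Z ⟩ * recip ⟨ D ⟩   ≡⟨ cong (λ u → u * ⟨ Z ⟩ * recip ⟨ D ⟩) PD≡Q ⟩
  ⟨ Q ⟩ * ⟨ Z ⟩ * recip ⟨ D ⟩       ≡⟨ cong (_* recip ⟨ D ⟩) (trans (sym (⟨⟩-homo-* Q Z)) (trans (cong ⟨_⟩ QZ≡WD) (⟨⟩-homo-* W D))) ⟩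
  ⟨ W ⟩ * ⟨ D ⟩ * recip ⟨ D ⟩       ≡⟨ *-assoc ⟨ W ⟩ ⟨ D ⟩ (recip ⟨ D ⟩) ⟩
  ⟨ W ⟩ * (⟨ D ⟩ * recip ⟨ D ⟩)     ≡⟨ cong (⟨ W ⟩ *_) (*-recipʳ ⟨ D ⟩ D≢0) ⟩
  ⟨ W ⟩ * 1ℚ                        ≡⟨ *-identityʳ ⟨ W ⟩ ⟩
  ⟨ W ⟩                             ∎
  where
  open ≡-Reasoning
  D≢0 = ⟨⟩-nonZero 0<D

recip-antimono-≤ : ∀ {p q} → 0ℚ < p → p ≤ q → recip q ≤ recip p
recip-antimono-≤ {p} {q} 0<p p≤q = begin
  recip q                    ≡⟨ sym (*-identityʳ (recip q)) ⟩
  recip q * 1ℚ               ≡⟨ cong (recip q *_) (sym (*-recipʳ p (≢-sym (<⇒≢ 0<p)))) ⟩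
  recip q * (p * recip p)    ≤⟨ *-monoˡ-≤-0≤ (recip q) (<⇒≤ (recip-pos 0<q)) (*-monoʳ-≤-0≤ (recip p) (<⇒≤ (recip-pos 0<p)) p≤q) ⟩
  recip q * (q * recip p)    ≡⟨ sym (*-assoc (recip q) q (recip p)) ⟩
  recip q * q * recip p      ≡⟨ cong (_* recip p) (trans (*-comm (recip q) q) (*-recipʳ q (≢-sym (<⇒≢ 0<q)))) ⟩
  1ℚ * recip p               ≡⟨ *-identityˡ (recip p) ⟩
  recip p                    ∎
  where
  open ≤-Reasoning
  0<q = <-≤-trans 0<p p≤q

recip-antimono-< : ∀ {p q} → 0ℚ < p → p < q → recip q < recip p
recip-antimono-< {p} {q} 0<p p<q = begin-strict
  recip q                        ≡⟨ sym (*-identityʳ (recip q)) ⟩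
  recip q * 1ℚ                   ≡⟨ cong (recip q *_) (sym (*-recipʳ p (≢-sym (<⇒≢ 0<p)))) ⟩
  recip q * (p * recip p)        ≡⟨ solve 3 (λ a b c → a :* (b :* c) := (a :* c) :* b) refl (recip q) p (recip p) ⟩
  (recip q * recip p) * p        <⟨ *-monoʳ-<-pos (recip q * recip p) {{positive 0<q⁻¹p⁻¹}} p<q ⟩
  (recip q * recip p) * q        ≡⟨ solve 3 (λ a b c → (a :* b) :* c := (c :* a) :* b) refl (recip q) (recip p) q ⟩
  (q * recip q) * recip p        ≡⟨ cong (_* recip p) (*-recipʳ q (≢-sym (<⇒≢ 0<q))) ⟩
  1ℚ * recip p                   ≡⟨ *-identityˡ (recip p) ⟩
  recip p                        ∎
  where
  open ≤-Reasoning
  0<q = <-trans 0<p p<q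
  0<q⁻¹p⁻¹ : 0ℚ < recip q * recip p
  0<q⁻¹p⁻¹ = subst (_< recip q * recip p) (*-zeroˡ (recip p)) (*-monoˡ-<-pos (recip p) {{positive (recip-pos 0<p)}} (recip-pos 0<q))

∑ : {A : Set} → List A → (A → ℚ) → ℚ
∑ [] f = 0ℚ
∑ (x ∷ xs) f = f x + ∑ xs f

∏ : {A : Set} → List A → (A → ℚ) → ℚ
∏ [] f = 1ℚ
∏ (x ∷ xs) f = f x * ∏ xs f

∑-map : {A B : Set} (g : A → B) (xs : List A) (f : B → ℚ) → ∑ (map g xs) f ≡ ∑ xs (λ x → f (g x))
∑-map g [] f = refl
∑-map g (x ∷ xs) f = cong (f (g x) +_) (∑-map g xs f)

∏-map : {A B : Set} (g : A → B) (xs : List A) (f : B → ℚ) → ∏ (map g xs) f ≡ ∏ xs (λ x → f (g x))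
∏-map g [] f = refl
∏-map g (x ∷ xs) f = cong (f (g x) *_) (∏-map g xs f)

∑-cong-local : {A : Set} {xs : List A} {f g : A → ℚ} → All (λ x → f x ≡ g x) xs → ∑ xs f ≡ ∑ xs g
∑-cong-local [] = refl
∑-cong-local (e ∷ es) = cong₂ _+_ e (∑-cong-local es)

∑-cong : {A : Set} (xs : List A) {f g : A → ℚ} → (∀ x → f x ≡ g x) → ∑ xs f ≡ ∑ xs g
∑-cong xs f≗g = ∑-cong-local {xs = xs} (All.tabulate (λ {x} _ → f≗g x))

∏-cong-local : {A : Set} {xs : List A} {f g : A → ℚ} → All (λ x → f x ≡ g x) xs → ∏ xs f ≡ ∏ xs g
∏-cong-local [] = refl
∏-cong-local (e ∷ es) = cong₂ _*_ e (∏-cong-local es)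

∑-mono-≤ : {A : Set} {xs : List A} {f g : A → ℚ} → All (λ x → f x ≤ g x) xs → ∑ xs f ≤ ∑ xs g
∑-mono-≤ [] = ≤-refl
∑-mono-≤ (e ∷ es) = +-mono-≤ e (∑-mono-≤ es)

∑-distribˡ : {A : Set} (xs : List A) (c : ℚ) (f : A → ℚ) → ∑ xs (λ x → c * f x) ≡ c * ∑ xs f
∑-distribˡ [] c f = sym (*-zeroʳ c)
∑-distribˡ (x ∷ xs) c f = trans (cong (c * f x +_) (∑-distribˡ xs c f)) (sym (*-distribˡ-+ c (f x) (∑ xs f)))

∏-nonNeg : {A : Set} (xs : List A) {f : A → ℚ} → (∀ x → 0ℚ ≤ f x) → 0ℚ ≤ ∏ xs f
∏-nonNeg [] _ = 0≤1
∏-nonNeg (x ∷ xs) 0≤f = 0≤p*q (0≤f x) (∏-nonNeg xs 0≤f)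

∏-pos : {A : Set} (xs : List A) {f : A → ℚ} → All (λ x → 0ℚ < f x) xs → 0ℚ < ∏ xs f
∏-pos [] [] = positive⁻¹ 1ℚ
∏-pos (x ∷ xs) {f} (p ∷ ps) = subst (_< f x * ∏ xs f) (*-zeroˡ (∏ xs f)) (*-monoˡ-<-pos (∏ xs f) {{positive (∏-pos xs ps)}} p)

∏-* : {A : Set} (xs : List A) (f g : A → ℚ) → ∏ xs (λ x → f x * g x) ≡ ∏ xs f * ∏ xs g
∏-* [] f g = refl
∏-* (x ∷ xs) f g = trans (cong (f x * g x *_) (∏-* xs f g))
  (solve 4 (λ a b c d → a :* b :* (c :* d) := a :* c :* (b :* d)) refl (f x) (g x) (∏ xs f) (∏ xs g))

-- Divided differences

selections : {A : Set} → List A → List (A × List A)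
selections [] = []
selections (a ∷ R) = (a , R) ∷ map (λ (τ , O) → τ , a ∷ O) (selections R)

selections-map : {A B : Set} (f : A → B) (L : List A) →
  selections (map f L) ≡ map (λ (τ , O) → f τ , map f O) (selections L)
selections-map f [] = refl
selections-map f (a ∷ L) = cong ((f a , map f L) ∷_) (begin
  map (λ (τ , O) → τ , f a ∷ O) (selections (map f L))
    ≡⟨ cong (map _) (selections-map f L) ⟩
  map (λ (τ , O) → τ , f a ∷ O) (map (λ (τ , O) → f τ , map f O) (selections L))
    ≡⟨ sym (map-∘ (selections L)) ⟩
  map (λ (τ , O) → f τ , f a ∷ map f O) (selections L)
    ≡⟨ map-∘ (selections L) ⟩
  map (λ (τ , O) → f τ , map f O) (map (λ (τ , O) → τ , a ∷ O) (selections L)) ∎)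
  where open ≡-Reasoning

All-selections : {A : Set} {P : A → Set} {L : List A} → All P L → All (λ (τ , O) → P τ × All P O) (selections L)
All-selections [] = []
All-selections (pa ∷ ps) = (pa , ps) ∷ map⁺ (All.map (λ (pτ , pO) → pτ , pa ∷ pO) (All-selections ps))

∏-selection : {A : Set} (F : A → ℚ) (L : List A) → All (λ (τ , O) → ∏ L F ≡ F τ * ∏ O F) (selections L)
∏-selection F [] = []
∏-selection F (a ∷ L) = refl ∷ map⁺ (All.map (λ {(τ , O)} e → trans (cong (F a *_) e)
  (solve 3 (λ x y z → x :* (y :* z) := y :* (x :* z)) refl (F a) (F τ) (∏ O F))) (∏-selection F L))

∑-selections : {A : Set} (L : List A) (f : A → ℚ) → ∑ (selections L) (λ (τ , _) → f τ) ≡ ∑ L f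
∑-selections [] f = refl
∑-selections (a ∷ L) f = cong (f a +_) (trans (∑-map _ (selections L) (λ (τ , _) → f τ)) (∑-selections L f))

downFrom1-bounds : ∀ m → All (λ j → 1 ℕ.≤ j × j ℕ.≤ m) (downFrom1 m)
downFrom1-bounds m = applyDownFrom⁺₁ suc m (λ i<m → ℕ.s≤s ℕ.z≤n , i<m)

nodeWeight : ℕ → List ℕ → ℚ
nodeWeight a R = ∏ R (λ u → recip (⟨ a ⟩ - ⟨ u ⟩))

-- The divided difference ∑_{a ∈ R} g a / ∏_{u ∈ R, u ≠ a} (a - u), unfolded one node at a time.
divDiff : List ℕ → (ℕ → ℚ) → ℚ
divDiff [] g = 0ℚ
divDiff (a ∷ R) g = g a * nodeWeight a R + divDiff R (λ k → g k * recip (⟨ k ⟩ - ⟨ a ⟩))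

p-q≡0⇒p≡q : ∀ p q → p - q ≡ 0ℚ → p ≡ q
p-q≡0⇒p≡q p q p-q≡0 = begin
  p             ≡⟨ solve 2 (λ x y → x := (x :- y) :+ y) refl p q ⟩
  (p - q) + q   ≡⟨ cong (_+ q) p-q≡0 ⟩
  0ℚ + q        ≡⟨ +-identityˡ q ⟩
  q             ∎
  where open ≡-Reasoning

⟨⟩-sub-nonZero : ∀ {m n} → m ≢ n → ⟨ m ⟩ - ⟨ n ⟩ ≢ 0ℚ
⟨⟩-sub-nonZero m≢n e = m≢n (⟨⟩-injective (p-q≡0⇒p≡q _ _ e))

recip-swap : ∀ p q → recip (q - p) ≡ - recip (p - q)
recip-swap p q = trans (cong recip (solve 2 (λ x y → y :- x := :- (x :- y)) refl p q)) (recip-neg (p - q))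

partialFractions : ∀ x y → x ≢ 0ℚ → y ≢ 0ℚ → y - x ≢ 0ℚ → recip x * recip y ≡ (recip x - recip y) * recip (y - x)
partialFractions x y x≢0 y≢0 y-x≢0 = begin
  recip x * recip y
    ≡⟨ solve 2 (λ a b → a :* b := a :* b :* con 1ℚ) refl (recip x) (recip y) ⟩
  recip x * recip y * 1ℚ
    ≡⟨ cong (recip x * recip y *_) (sym (*-recipʳ (y - x) y-x≢0)) ⟩
  recip x * recip y * ((y - x) * recip (y - x))
    ≡⟨ solve 5 (λ a b c d e → a :* b :* ((c :- d) :* e) := (a :* (c :* b) :- b :* (d :* a)) :* e) refl (recip x) (recip y) y x (recip (y - x)) ⟩
  (recip x * (y * recip y) - recip y * (x * recip x)) * recip (y - x)
    ≡⟨ cong₂ (λ u v → (recip x * u - recip y * v) * recip (y - x)) (*-recipʳ y y≢0) (*-recipʳ x x≢0) ⟩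
  (recip x * 1ℚ - recip y * 1ℚ) * recip (y - x)
    ≡⟨ cong₂ (λ u v → (u - v) * recip (y - x)) (*-identityʳ (recip x)) (*-identityʳ (recip y)) ⟩
  (recip x - recip y) * recip (y - x) ∎
  where open ≡-Reasoning

divDiff-cong-local : ∀ R {g h} → All (λ k → g k ≡ h k) R → divDiff R g ≡ divDiff R h
divDiff-cong-local [] _ = refl
divDiff-cong-local (a ∷ R) (e ∷ es) =
  cong₂ _+_ (cong (_* nodeWeight a R) e) (divDiff-cong-local R (All.map (cong (_* _)) es))

divDiff-cong : ∀ R {g h} → (∀ k → g k ≡ h k) → divDiff R g ≡ divDiff R h
divDiff-cong R g≗h = divDiff-cong-local R (All.tabulate (λ {k} _ → g≗h k))

divDiff-+ : ∀ R g h → divDiff R (λ k → g k + h k) ≡ divDiff R g + divDiff R h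
divDiff-+ [] g h = refl
divDiff-+ (a ∷ R) g h = begin
  (g a + h a) * w + divDiff R (λ k → (g k + h k) * recip (⟨ k ⟩ - ⟨ a ⟩))
    ≡⟨ cong ((g a + h a) * w +_) (trans (divDiff-cong R (λ k → *-distribʳ-+ (recip (⟨ k ⟩ - ⟨ a ⟩)) (g k) (h k))) (divDiff-+ R g′ h′)) ⟩
  (g a + h a) * w + (divDiff R g′ + divDiff R h′)
    ≡⟨ solve 5 (λ x y z u v → (x :+ y) :* z :+ (u :+ v) := (x :* z :+ u) :+ (y :* z :+ v)) refl (g a) (h a) w (divDiff R g′) (divDiff R h′) ⟩
  (g a * w + divDiff R g′) + (h a * w + divDiff R h′) ∎
  where
  open ≡-Reasoning
  w = nodeWeight a R
  g′ = λ k → g k * recip (⟨ k ⟩ - ⟨ a ⟩)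
  h′ = λ k → h k * recip (⟨ k ⟩ - ⟨ a ⟩)

divDiff-* : ∀ R c g → divDiff R (λ k → c * g k) ≡ c * divDiff R g
divDiff-* [] c g = sym (*-zeroʳ c)
divDiff-* (a ∷ R) c g = begin
  c * g a * w + divDiff R (λ k → c * g k * recip (⟨ k ⟩ - ⟨ a ⟩))
    ≡⟨ cong (c * g a * w +_) (trans (divDiff-cong R (λ k → *-assoc c (g k) _)) (divDiff-* R c g′)) ⟩
  c * g a * w + c * divDiff R g′
    ≡⟨ solve 4 (λ x y z u → x :* y :* z :+ x :* u := x :* (y :* z :+ u)) refl c (g a) w (divDiff R g′) ⟩
  c * (g a * w + divDiff R g′) ∎
  where
  open ≡-Reasoning
  w = nodeWeight a R
  g′ = λ k → g k * recip (⟨ k ⟩ - ⟨ a ⟩)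

divDiff-recip : ∀ a b R → All (a ≢_) (b ∷ R) → Unique (b ∷ R) →
  divDiff (b ∷ R) (λ k → recip (⟨ k ⟩ - ⟨ a ⟩)) ≡ - nodeWeight a (b ∷ R)
divDiff-recip a b [] _ _ = trans (cong (λ x → x * 1ℚ + 0ℚ) (recip-swap ⟨ a ⟩ ⟨ b ⟩))
  (solve 1 (λ x → (:- x) :* con 1ℚ :+ con 0ℚ := :- (x :* con 1ℚ)) refl (recip (⟨ a ⟩ - ⟨ b ⟩)))
divDiff-recip a b (c ∷ R) (a≢b ∷ a∉R) (b∉R ∷ uR) = begin
  rba * wb + divDiff (c ∷ R) (λ k → ra k * rb k)
    ≡⟨ cong₂ _+_ (cong (_* wb) (recip-swap ⟨ a ⟩ ⟨ b ⟩)) (divDiff-cong-local (c ∷ R) (All.zipWith split (a∉R , b∉R))) ⟩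
  - rab * wb + divDiff (c ∷ R) (λ k → rab * ra k + (- rab) * rb k)
    ≡⟨ cong (- rab * wb +_) (trans (divDiff-+ (c ∷ R) (λ k → rab * ra k) (λ k → (- rab) * rb k))
         (cong₂ _+_ (divDiff-* (c ∷ R) rab ra) (divDiff-* (c ∷ R) (- rab) rb))) ⟩
  - rab * wb + (rab * divDiff (c ∷ R) ra + (- rab) * divDiff (c ∷ R) rb)
    ≡⟨ cong (λ x → - rab * wb + x) (cong₂ _+_ (cong (rab *_) (divDiff-recip a c R a∉R uR)) (cong ((- rab) *_) (divDiff-recip b c R b∉R uR))) ⟩
  - rab * wb + (rab * (- wa) + (- rab) * (- wb))
    ≡⟨ solve 3 (λ x y z → (:- x) :* z :+ (x :* (:- y) :+ (:- x) :* (:- z)) := :- (x :* y)) refl rab wa wb ⟩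
  - (rab * wa) ∎
  where
  open ≡-Reasoning
  rab = recip (⟨ a ⟩ - ⟨ b ⟩)
  rba = recip (⟨ b ⟩ - ⟨ a ⟩)
  ra = λ k → recip (⟨ k ⟩ - ⟨ a ⟩)
  rb = λ k → recip (⟨ k ⟩ - ⟨ b ⟩)
  wa = nodeWeight a (c ∷ R)
  wb = nodeWeight b (c ∷ R)
  split : ∀ {k} → a ≢ k × b ≢ k → ra k * rb k ≡ rab * ra k + (- rab) * rb k
  split {k} (a≢k , b≢k) = begin
    ra k * rb k
      ≡⟨ partialFractions _ _ (⟨⟩-sub-nonZero (≢-sym a≢k)) (⟨⟩-sub-nonZero (≢-sym b≢k)) (λ e → a≢b (⟨⟩-injective (p-q≡0⇒p≡q _ _
           (trans (solve 3 (λ x y z → y :- z := (x :- z) :- (x :- y)) refl ⟨ k ⟩ ⟨ a ⟩ ⟨ b ⟩) e)))) ⟩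
    (ra k - rb k) * recip ((⟨ k ⟩ - ⟨ b ⟩) - (⟨ k ⟩ - ⟨ a ⟩))
      ≡⟨ cong (λ x → (ra k - rb k) * recip x) (solve 3 (λ x y z → (x :- z) :- (x :- y) := y :- z) refl ⟨ k ⟩ ⟨ a ⟩ ⟨ b ⟩) ⟩
    (ra k - rb k) * rab
      ≡⟨ solve 3 (λ x y z → (x :- y) :* z := z :* x :+ (:- z) :* y) refl (ra k) (rb k) rab ⟩
    rab * ra k + (- rab) * rb k ∎

divDiff-const : ∀ a b R c → Unique (a ∷ b ∷ R) → divDiff (a ∷ b ∷ R) (λ _ → c) ≡ 0ℚ
divDiff-const a b R c (a∉ ∷ u) = begin
  c * nodeWeight a (b ∷ R) + divDiff (b ∷ R) (λ k → c * recip (⟨ k ⟩ - ⟨ a ⟩))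
    ≡⟨ cong (c * nodeWeight a (b ∷ R) +_) (trans (divDiff-* (b ∷ R) c _) (cong (c *_) (divDiff-recip a b R a∉ u))) ⟩
  c * nodeWeight a (b ∷ R) + c * (- nodeWeight a (b ∷ R))
    ≡⟨ solve 2 (λ x y → x :* y :+ x :* (:- y) := con 0ℚ) refl c (nodeWeight a (b ∷ R)) ⟩
  0ℚ ∎
  where open ≡-Reasoning

data Polynomial : ℕ → (ℕ → ℚ) → Set where
  const : ∀ c → Polynomial 0 (λ _ → c)
  raise : ∀ {r g} → Polynomial r g → Polynomial (suc r) g
  _⊞_ : ∀ {r g h} → Polynomial r g → Polynomial r h → Polynomial r (λ k → g k + h k)
  scale : ∀ {r g} c → Polynomial r g → Polynomial r (λ k → c * g k)
  mulX : ∀ {r g} → Polynomial r g → Polynomial (suc r) (λ k → ⟨ k ⟩ * g k)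
  ext : ∀ {r g h} → Polynomial r g → (∀ k → g k ≡ h k) → Polynomial r h

-- Dividing out the first node a lowers the degree: k g(k) / (k - a) = g(k) + a g(k) / (k - a).
divDiff-mulX : ∀ {g} a R → All (a ≢_) R →
  divDiff (a ∷ R) (λ k → ⟨ k ⟩ * g k) ≡ divDiff R g + ⟨ a ⟩ * divDiff (a ∷ R) g
divDiff-mulX {g} a R a∉R = begin
  ⟨ a ⟩ * g a * w + divDiff R (λ k → ⟨ k ⟩ * g k * recip (⟨ k ⟩ - ⟨ a ⟩))
    ≡⟨ cong (⟨ a ⟩ * g a * w +_) (divDiff-cong-local R (All.map split a∉R)) ⟩
  ⟨ a ⟩ * g a * w + divDiff R (λ k → g k + ⟨ a ⟩ * g′ k)
    ≡⟨ cong (⟨ a ⟩ * g a * w +_) (trans (divDiff-+ R g (λ k → ⟨ a ⟩ * g′ k)) (cong (divDiff R g +_) (divDiff-* R ⟨ a ⟩ g′))) ⟩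
  ⟨ a ⟩ * g a * w + (divDiff R g + ⟨ a ⟩ * divDiff R g′)
    ≡⟨ solve 5 (λ x y z u v → x :* y :* z :+ (u :+ x :* v) := u :+ x :* (y :* z :+ v)) refl ⟨ a ⟩ (g a) w (divDiff R g) (divDiff R g′) ⟩
  divDiff R g + ⟨ a ⟩ * (g a * w + divDiff R g′) ∎
  where
  open ≡-Reasoning
  w = nodeWeight a R
  g′ = λ k → g k * recip (⟨ k ⟩ - ⟨ a ⟩)
  split : ∀ {k} → a ≢ k → ⟨ k ⟩ * g k * recip (⟨ k ⟩ - ⟨ a ⟩) ≡ g k + ⟨ a ⟩ * g′ k
  split {k} a≢k = begin
    ⟨ k ⟩ * g k * recip (⟨ k ⟩ - ⟨ a ⟩)
      ≡⟨ solve 4 (λ x y z r → x :* y :* r := y :* ((x :- z) :* r) :+ z :* (y :* r)) refl ⟨ k ⟩ (g k) ⟨ a ⟩ (recip (⟨ k ⟩ - ⟨ a ⟩)) ⟩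
    g k * ((⟨ k ⟩ - ⟨ a ⟩) * recip (⟨ k ⟩ - ⟨ a ⟩)) + ⟨ a ⟩ * g′ k
      ≡⟨ cong (λ x → g k * x + ⟨ a ⟩ * g′ k) (*-recipʳ _ (⟨⟩-sub-nonZero (≢-sym a≢k))) ⟩
    g k * 1ℚ + ⟨ a ⟩ * g′ k
      ≡⟨ cong (_+ ⟨ a ⟩ * g′ k) (*-identityʳ (g k)) ⟩
    g k + ⟨ a ⟩ * g′ k ∎

divDiff-polynomial : ∀ {r g} → Polynomial r g → ∀ R → Unique R → suc (suc r) ℕ.≤ length R → divDiff R g ≡ 0ℚ
divDiff-polynomial (const c) (a ∷ b ∷ R) u _ = divDiff-const a b R c u
divDiff-polynomial (const c) (a ∷ []) u (ℕ.s≤s ())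
divDiff-polynomial (raise P) R u r+3≤ = divDiff-polynomial P R u (ℕₚ.≤-trans (ℕₚ.n≤1+n _) r+3≤)
divDiff-polynomial (_⊞_ {g = g} {h = h} P Q) R u r+2≤ = begin
  divDiff R (λ k → g k + h k)     ≡⟨ divDiff-+ R g h ⟩
  divDiff R g + divDiff R h       ≡⟨ cong₂ _+_ (divDiff-polynomial P R u r+2≤) (divDiff-polynomial Q R u r+2≤) ⟩
  0ℚ                              ∎
  where open ≡-Reasoning
divDiff-polynomial (scale {g = g} c P) R u r+2≤ =
  trans (divDiff-* R c g) (trans (cong (c *_) (divDiff-polynomial P R u r+2≤)) (*-zeroʳ c))
divDiff-polynomial (ext {g = g} P g≗h) R u r+2≤ = trans (sym (divDiff-cong R g≗h)) (divDiff-polynomial P R u r+2≤)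
divDiff-polynomial (mulX {g = g} P) (a ∷ R) (a∉R ∷ u) (ℕ.s≤s r+2≤) = begin
  divDiff (a ∷ R) (λ k → ⟨ k ⟩ * g k)        ≡⟨ divDiff-mulX a R a∉R ⟩
  divDiff R g + ⟨ a ⟩ * divDiff (a ∷ R) g    ≡⟨ cong₂ (λ x y → x + ⟨ a ⟩ * y) (divDiff-polynomial P R u r+2≤)
                                                  (divDiff-polynomial P (a ∷ R) (a∉R ∷ u) (ℕₚ.m≤n⇒m≤1+n r+2≤)) ⟩
  0ℚ + ⟨ a ⟩ * 0ℚ                            ≡⟨ solve 1 (λ x → con 0ℚ :+ x :* con 0ℚ := con 0ℚ) refl ⟨ a ⟩ ⟩
  0ℚ                                         ∎
  where open ≡-Reasoning

fallingℚ : ℚ → ℕ → ℚ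
fallingℚ x zero = 1ℚ
fallingℚ x (suc t) = fallingℚ x t * (x - ⟨ t ⟩)

fallingℚ-polynomial : ∀ t → Polynomial t (λ k → fallingℚ ⟨ k ⟩ t)
fallingℚ-polynomial zero = const 1ℚ
fallingℚ-polynomial (suc t) = ext (mulX P ⊞ raise (scale (- ⟨ t ⟩) P))
  (λ k → solve 3 (λ x h u → x :* h :+ (:- u) :* h := h :* (x :- u)) refl ⟨ k ⟩ (fallingℚ ⟨ k ⟩ t) ⟨ t ⟩)
  where P = fallingℚ-polynomial t

fallingℚ-suc : ∀ x t → fallingℚ x (suc t) ≡ x * fallingℚ (x - 1ℚ) t
fallingℚ-suc x zero = solve 1 (λ x → con 1ℚ :* (x :- con 0ℚ) := x :* con 1ℚ) refl x
fallingℚ-suc x (suc t) = begin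
  fallingℚ x (suc t) * (x - ⟨ suc t ⟩)             ≡⟨ cong (_* (x - ⟨ suc t ⟩)) (fallingℚ-suc x t) ⟩
  x * fallingℚ (x - 1ℚ) t * (x - (1ℚ + ⟨ t ⟩))    ≡⟨ solve 3 (λ x h u → x :* h :* (x :- (con 1ℚ :+ u)) := x :* (h :* ((x :- con 1ℚ) :- u))) refl x (fallingℚ (x - 1ℚ) t) ⟨ t ⟩ ⟩
  x * (fallingℚ (x - 1ℚ) t * ((x - 1ℚ) - ⟨ t ⟩)) ∎
  where open ≡-Reasoning

⟨falling⟩ : ∀ k t → ⟨ falling k t ⟩ ≡ fallingℚ ⟨ k ⟩ t
⟨falling⟩ k zero = refl
⟨falling⟩ zero (suc t) = begin
  ⟨ 0 ℕ.* falling 0 t ⟩              ≡⟨ ⟨⟩-homo-* 0 (falling 0 t) ⟩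
  0ℚ * ⟨ falling 0 t ⟩                ≡⟨ *-zeroˡ ⟨ falling 0 t ⟩ ⟩
  0ℚ                                  ≡⟨ sym (*-zeroˡ (fallingℚ (0ℚ - 1ℚ) t)) ⟩
  0ℚ * fallingℚ (0ℚ - 1ℚ) t          ≡⟨ sym (fallingℚ-suc 0ℚ t) ⟩
  fallingℚ 0ℚ (suc t)                 ∎
  where open ≡-Reasoning
⟨falling⟩ (suc k) (suc t) = begin
  ⟨ suc k ℕ.* falling k t ⟩                  ≡⟨ ⟨⟩-homo-* (suc k) (falling k t) ⟩
  ⟨ suc k ⟩ * ⟨ falling k t ⟩                 ≡⟨ cong (⟨ suc k ⟩ *_) (⟨falling⟩ k t) ⟩
  ⟨ suc k ⟩ * fallingℚ ⟨ k ⟩ t                ≡⟨ cong (λ z → ⟨ suc k ⟩ * fallingℚ z t) (solve 1 (λ a → a := (con 1ℚ :+ a) :- con 1ℚ) refl ⟨ k ⟩) ⟩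
  ⟨ suc k ⟩ * fallingℚ (⟨ suc k ⟩ - 1ℚ) t     ≡⟨ sym (fallingℚ-suc ⟨ suc k ⟩ t) ⟩
  fallingℚ ⟨ suc k ⟩ (suc t)                  ∎
  where open ≡-Reasoning

absWeight : ℕ → List ℕ → ℚ
absWeight τ O = ∏ O (λ u → recip ∣ ⟨ τ ⟩ - ⟨ u ⟩ ∣)

-- The triangle-inequality majorant of divDiff R h.
divDiffAbs : List ℕ → (ℕ → ℚ) → ℚ
divDiffAbs R h = ∑ (selections R) (λ (τ , O) → ∣ h τ ∣ * absWeight τ O)

0≤recip∣∣ : ∀ q → 0ℚ ≤ recip ∣ q ∣
0≤recip∣∣ q = recip-nonNeg (0≤∣p∣ q)

absWeight-nonNeg : ∀ τ O → 0ℚ ≤ absWeight τ O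
absWeight-nonNeg τ O = ∏-nonNeg O (λ u → 0≤recip∣∣ (⟨ τ ⟩ - ⟨ u ⟩))

∣p∣*recip∣q∣-nonNeg : ∀ p q → ∣ ∣ p ∣ * recip ∣ q ∣ ∣ ≡ ∣ p ∣ * recip ∣ q ∣
∣p∣*recip∣q∣-nonNeg p q = 0≤p⇒∣p∣≡p (0≤p*q (0≤∣p∣ p) (0≤recip∣∣ q))

divDiffAbs-∷ : ∀ a R h →
  divDiffAbs (a ∷ R) h ≡ ∣ h a ∣ * absWeight a R + divDiffAbs R (λ k → ∣ h k ∣ * recip ∣ ⟨ k ⟩ - ⟨ a ⟩ ∣)
divDiffAbs-∷ a R h = cong (∣ h a ∣ * absWeight a R +_)
  (trans (∑-map _ (selections R) (λ (τ , O) → ∣ h τ ∣ * absWeight τ O)) (∑-cong (selections R) step))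
  where
  step : ∀ ((τ , O) : ℕ × List ℕ) →
    ∣ h τ ∣ * (recip ∣ ⟨ τ ⟩ - ⟨ a ⟩ ∣ * absWeight τ O) ≡ ∣ ∣ h τ ∣ * recip ∣ ⟨ τ ⟩ - ⟨ a ⟩ ∣ ∣ * absWeight τ O
  step (τ , O) = trans (sym (*-assoc ∣ h τ ∣ _ (absWeight τ O)))
    (cong (_* absWeight τ O) (sym (∣p∣*recip∣q∣-nonNeg (h τ) (⟨ τ ⟩ - ⟨ a ⟩))))

∣nodeWeight∣ : ∀ a R → ∣ nodeWeight a R ∣ ≡ absWeight a R
∣nodeWeight∣ a [] = refl
∣nodeWeight∣ a (u ∷ R) = trans (∣p*q∣≡∣p∣*∣q∣ (recip (⟨ a ⟩ - ⟨ u ⟩)) (nodeWeight a R))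
  (cong₂ _*_ (∣recip∣ (⟨ a ⟩ - ⟨ u ⟩)) (∣nodeWeight∣ a R))

divDiffAbs-cong-∣∣ : ∀ R {h h′ : ℕ → ℚ} → (∀ k → ∣ h k ∣ ≡ ∣ h′ k ∣) → divDiffAbs R h ≡ divDiffAbs R h′
divDiffAbs-cong-∣∣ R e = ∑-cong (selections R) (λ (τ , O) → cong (_* absWeight τ O) (e τ))

∣divDiff∣≤divDiffAbs : ∀ R g → ∣ divDiff R g ∣ ≤ divDiffAbs R g
∣divDiff∣≤divDiffAbs [] g = ≤-refl
∣divDiff∣≤divDiffAbs (a ∷ R) g = begin
  ∣ g a * nodeWeight a R + divDiff R g′ ∣
    ≤⟨ ∣p+q∣≤∣p∣+∣q∣ (g a * nodeWeight a R) (divDiff R g′) ⟩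
  ∣ g a * nodeWeight a R ∣ + ∣ divDiff R g′ ∣
    ≤⟨ +-monoʳ-≤ ∣ g a * nodeWeight a R ∣ (∣divDiff∣≤divDiffAbs R g′) ⟩
  ∣ g a * nodeWeight a R ∣ + divDiffAbs R g′
    ≡⟨ cong₂ _+_ (trans (∣p*q∣≡∣p∣*∣q∣ (g a) (nodeWeight a R)) (cong (∣ g a ∣ *_) (∣nodeWeight∣ a R))) (divDiffAbs-cong-∣∣ R ∣g′∣) ⟩
  ∣ g a ∣ * absWeight a R + divDiffAbs R (λ k → ∣ g k ∣ * recip ∣ ⟨ k ⟩ - ⟨ a ⟩ ∣)
    ≡⟨ sym (divDiffAbs-∷ a R g) ⟩
  divDiffAbs (a ∷ R) g ∎
  where
  open ≤-Reasoning
  g′ = λ k → g k * recip (⟨ k ⟩ - ⟨ a ⟩)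
  ∣g′∣ : ∀ k → ∣ g′ k ∣ ≡ ∣ ∣ g k ∣ * recip ∣ ⟨ k ⟩ - ⟨ a ⟩ ∣ ∣
  ∣g′∣ k = trans (trans (∣p*q∣≡∣p∣*∣q∣ (g k) _) (cong (∣ g k ∣ *_) (∣recip∣ (⟨ k ⟩ - ⟨ a ⟩))))
    (sym (∣p∣*recip∣q∣-nonNeg (g k) (⟨ k ⟩ - ⟨ a ⟩)))

divDiffAbs-mono : ∀ R {h h′ : ℕ → ℚ} → All (λ k → ∣ h k ∣ ≤ ∣ h′ k ∣) R → divDiffAbs R h ≤ divDiffAbs R h′
divDiffAbs-mono [] _ = ≤-refl
divDiffAbs-mono (a ∷ R) {h} {h′} (ha≤ ∷ h≤) = begin
  divDiffAbs (a ∷ R) h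
    ≡⟨ divDiffAbs-∷ a R h ⟩
  ∣ h a ∣ * absWeight a R + divDiffAbs R (λ k → ∣ h k ∣ * recip ∣ ⟨ k ⟩ - ⟨ a ⟩ ∣)
    ≤⟨ +-mono-≤ (*-monoʳ-≤-0≤ (absWeight a R) (absWeight-nonNeg a R) ha≤) (divDiffAbs-mono R (All.map step h≤)) ⟩
  ∣ h′ a ∣ * absWeight a R + divDiffAbs R (λ k → ∣ h′ k ∣ * recip ∣ ⟨ k ⟩ - ⟨ a ⟩ ∣)
    ≡⟨ sym (divDiffAbs-∷ a R h′) ⟩
  divDiffAbs (a ∷ R) h′ ∎
  where
  open ≤-Reasoning
  step : ∀ {k} → ∣ h k ∣ ≤ ∣ h′ k ∣ → ∣ ∣ h k ∣ * recip ∣ ⟨ k ⟩ - ⟨ a ⟩ ∣ ∣ ≤ ∣ ∣ h′ k ∣ * recip ∣ ⟨ k ⟩ - ⟨ a ⟩ ∣ ∣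
  step {k} hk≤ = subst₂ _≤_ (sym (∣p∣*recip∣q∣-nonNeg (h k) (⟨ k ⟩ - ⟨ a ⟩))) (sym (∣p∣*recip∣q∣-nonNeg (h′ k) (⟨ k ⟩ - ⟨ a ⟩)))
    (*-monoʳ-≤-0≤ _ (0≤recip∣∣ (⟨ k ⟩ - ⟨ a ⟩)) hk≤)

divDiffAbs-scale : ∀ R c h → divDiffAbs R (λ k → c * h k) ≡ ∣ c ∣ * divDiffAbs R h
divDiffAbs-scale R c h = trans (∑-cong (selections R) step) (∑-distribˡ (selections R) ∣ c ∣ _)
  where
  step : ∀ ((τ , O) : ℕ × List ℕ) → ∣ c * h τ ∣ * absWeight τ O ≡ ∣ c ∣ * (∣ h τ ∣ * absWeight τ O)
  step (τ , O) = trans (cong (_* absWeight τ O) (∣p*q∣≡∣p∣*∣q∣ c (h τ))) (*-assoc ∣ c ∣ ∣ h τ ∣ (absWeight τ O))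

-- Symmetrisation over a subcube

-- Points of the cube are read as subsets of the coordinates.
_∪_ : ∀ {n} → Cube n → Cube n → Cube n
_∪_ = zipWith _∨_

∅ : ∀ {n} → Cube n
∅ = replicate _ false

#ones : ∀ {n} → Cube n → ℕ
#ones [] = 0
#ones (true ∷ y) = suc (#ones y)
#ones (false ∷ y) = #ones y

_⊆_ : ∀ {n} → Cube n → Cube n → Set
[] ⊆ [] = ⊤
(true ∷ y) ⊆ (b ∷ S) = b ≡ true × y ⊆ S
(false ∷ y) ⊆ (_ ∷ S) = y ⊆ S

Disjoint : ∀ {n} → Cube n → Cube n → Set
Disjoint [] [] = ⊤
Disjoint (a ∷ x) (true ∷ S) = a ≡ false × Disjoint x S
Disjoint (a ∷ x) (false ∷ S) = Disjoint x S

x∪∅≡x : ∀ {n} (x : Cube n) → x ∪ ∅ ≡ x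
x∪∅≡x [] = refl
x∪∅≡x (true ∷ x) = cong (true ∷_) (x∪∅≡x x)
x∪∅≡x (false ∷ x) = cong (false ∷_) (x∪∅≡x x)

δ : ℕ → ℕ → ℚ
δ zero zero = 1ℚ
δ zero (suc _) = 0ℚ
δ (suc _) zero = 0ℚ
δ (suc a) (suc b) = δ a b

δ-cases : ∀ a b → (δ a b ≡ 1ℚ × a ≡ b) ⊎ δ a b ≡ 0ℚ
δ-cases zero zero = inj₁ (refl , refl)
δ-cases zero (suc b) = inj₂ refl
δ-cases (suc a) zero = inj₂ refl
δ-cases (suc a) (suc b) with δ-cases a b
... | inj₁ (δ≡1 , a≡b) = inj₁ (δ≡1 , cong suc a≡b)
... | inj₂ δ≡0 = inj₂ δ≡0

∑⊆ : ∀ {n} → Cube n → (Cube n → ℚ) → ℚ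
∑⊆ [] g = g []
∑⊆ (false ∷ S) g = ∑⊆ S (λ y → g (false ∷ y))
∑⊆ (true ∷ S) g = ∑⊆ S (λ y → g (false ∷ y)) + ∑⊆ S (λ y → g (true ∷ y))

∑⊆-cong : ∀ {n} (S : Cube n) {g h : Cube n → ℚ} → (∀ y → g y ≡ h y) → ∑⊆ S g ≡ ∑⊆ S h
∑⊆-cong [] g≗h = g≗h []
∑⊆-cong (false ∷ S) g≗h = ∑⊆-cong S (λ y → g≗h (false ∷ y))
∑⊆-cong (true ∷ S) g≗h = cong₂ _+_ (∑⊆-cong S (λ y → g≗h (false ∷ y))) (∑⊆-cong S (λ y → g≗h (true ∷ y)))

∑⊆-+ : ∀ {n} (S : Cube n) (g h : Cube n → ℚ) → ∑⊆ S (λ y → g y + h y) ≡ ∑⊆ S g + ∑⊆ S h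
∑⊆-+ [] g h = refl
∑⊆-+ (false ∷ S) g h = ∑⊆-+ S (λ y → g (false ∷ y)) (λ y → h (false ∷ y))
∑⊆-+ (true ∷ S) g h = trans (cong₂ _+_ (∑⊆-+ S g₀ h₀) (∑⊆-+ S g₁ h₁))
  (solve 4 (λ a b c d → (a :+ b) :+ (c :+ d) := (a :+ c) :+ (b :+ d)) refl (∑⊆ S g₀) (∑⊆ S h₀) (∑⊆ S g₁) (∑⊆ S h₁))
  where
  g₀ = λ y → g (false ∷ y)
  g₁ = λ y → g (true ∷ y)
  h₀ = λ y → h (false ∷ y)
  h₁ = λ y → h (true ∷ y)

∑⊆-distribˡ : ∀ {n} (S : Cube n) (c : ℚ) (g : Cube n → ℚ) → ∑⊆ S (λ y → c * g y) ≡ c * ∑⊆ S g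
∑⊆-distribˡ [] c g = refl
∑⊆-distribˡ (false ∷ S) c g = ∑⊆-distribˡ S c (λ y → g (false ∷ y))
∑⊆-distribˡ (true ∷ S) c g = trans (cong₂ _+_ (∑⊆-distribˡ S c (λ y → g (false ∷ y))) (∑⊆-distribˡ S c (λ y → g (true ∷ y))))
  (sym (*-distribˡ-+ c (∑⊆ S (λ y → g (false ∷ y))) (∑⊆ S (λ y → g (true ∷ y)))))

∑⊆-0 : ∀ {n} (S : Cube n) {g : Cube n → ℚ} → (∀ y → g y ≡ 0ℚ) → ∑⊆ S g ≡ 0ℚ
∑⊆-0 S {g} g≗0 = begin
  ∑⊆ S g                      ≡⟨ ∑⊆-cong S (λ y → trans (g≗0 y) (sym (*-zeroˡ 0ℚ))) ⟩
  ∑⊆ S (λ _ → 0ℚ * 0ℚ)        ≡⟨ ∑⊆-distribˡ S 0ℚ (λ _ → 0ℚ) ⟩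
  0ℚ * ∑⊆ S (λ _ → 0ℚ)        ≡⟨ *-zeroˡ (∑⊆ S (λ _ → 0ℚ)) ⟩
  0ℚ                          ∎
  where open ≡-Reasoning

∑⊆-δ₀ : ∀ {n} (S : Cube n) (g : Cube n → ℚ) → ∑⊆ S (λ y → δ (#ones y) 0 * g y) ≡ g ∅
∑⊆-δ₀ [] g = *-identityˡ _
∑⊆-δ₀ (false ∷ S) g = ∑⊆-δ₀ S (λ y → g (false ∷ y))
∑⊆-δ₀ (true ∷ S) g = trans (cong₂ _+_ (∑⊆-δ₀ S (λ y → g (false ∷ y))) (∑⊆-0 S (λ y → *-zeroˡ (g (true ∷ y)))))
  (+-identityʳ (g ∅))

∣∑⊆∣≤ : ∀ {n} (S : Cube n) (g h : Cube n → ℚ) → (∀ y → y ⊆ S → ∣ g y ∣ ≤ h y) → ∣ ∑⊆ S g ∣ ≤ ∑⊆ S h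
∣∑⊆∣≤ [] g h g≤h = g≤h [] tt
∣∑⊆∣≤ (false ∷ S) g h g≤h = ∣∑⊆∣≤ S _ _ (λ y y⊆S → g≤h (false ∷ y) y⊆S)
∣∑⊆∣≤ (true ∷ S) g h g≤h = ≤-trans (∣p+q∣≤∣p∣+∣q∣ (∑⊆ S (λ y → g (false ∷ y))) (∑⊆ S (λ y → g (true ∷ y))))
  (+-mono-≤ (∣∑⊆∣≤ S _ _ (λ y y⊆S → g≤h (false ∷ y) y⊆S)) (∣∑⊆∣≤ S _ _ (λ y y⊆S → g≤h (true ∷ y) (refl , y⊆S))))

monoOutside : ∀ {n} → Cube n → Cube n → Monomial n → ℚ
monoOutside [] [] [] = 1ℚ
monoOutside (true ∷ S) (_ ∷ x) (_ ∷ e) = monoOutside S x e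
monoOutside (false ∷ S) (a ∷ x) (j ∷ e) = (⟦ a ⟧ ^q j) * monoOutside S x e

#∩supp : ∀ {n} → Cube n → Monomial n → ℕ
#∩supp [] [] = 0
#∩supp (true ∷ S) (zero ∷ e) = #∩supp S e
#∩supp (true ∷ S) (suc _ ∷ e) = suc (#∩supp S e)
#∩supp (false ∷ S) (_ ∷ e) = #∩supp S e

#∖supp : ∀ {n} → Cube n → Monomial n → ℕ
#∖supp [] [] = 0
#∖supp (true ∷ S) (zero ∷ e) = suc (#∖supp S e)
#∖supp (true ∷ S) (suc _ ∷ e) = #∖supp S e
#∖supp (false ∷ S) (_ ∷ e) = #∖supp S e

#∩supp+#∖supp : ∀ {n} (S : Cube n) e → #∩supp S e ℕ.+ #∖supp S e ≡ #ones S
#∩supp+#∖supp [] [] = refl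
#∩supp+#∖supp (true ∷ S) (zero ∷ e) = trans (ℕₚ.+-suc (#∩supp S e) (#∖supp S e)) (cong suc (#∩supp+#∖supp S e))
#∩supp+#∖supp (true ∷ S) (suc _ ∷ e) = cong suc (#∩supp+#∖supp S e)
#∩supp+#∖supp (false ∷ S) (_ ∷ e) = #∩supp+#∖supp S e

#∩supp≤deg : ∀ {n} (S : Cube n) e → #∩supp S e ℕ.≤ sumℕ e
#∩supp≤deg [] [] = ℕ.z≤n
#∩supp≤deg (true ∷ S) (zero ∷ e) = #∩supp≤deg S e
#∩supp≤deg (true ∷ S) (suc j ∷ e) = ℕ.s≤s (ℕₚ.≤-trans (#∩supp≤deg S e) (ℕₚ.m≤n+m (sumℕ e) j))
#∩supp≤deg (false ∷ S) (j ∷ e) = ℕₚ.≤-trans (#∩supp≤deg S e) (ℕₚ.m≤n+m (sumℕ e) j)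

LayerSums : ∀ {n} → Cube n → (Cube n → ℚ) → ℚ → ℕ → ℕ → Set
LayerSums S F c t u = ∀ k → ∑⊆ S (λ y → δ (#ones y) k * F y) ≡ c * ⟨ supersets t u k ⟩

LayerSums-cong : ∀ {n} (S : Cube n) {F G : Cube n → ℚ} c t u → (∀ y → G y ≡ F y) → LayerSums S F c t u → LayerSums S G c t u
LayerSums-cong S c t u G≗F sums k = trans (∑⊆-cong S (λ y → cong (δ (#ones y) k *_) (G≗F y))) (sums k)

∑⊆-δ-suc : ∀ {n} (S : Cube n) F c t u → LayerSums S F c t u →
  ∀ k → ∑⊆ S (λ y → δ (suc (#ones y)) k * F y) ≡ c * ⟨ supersets (suc t) u k ⟩
∑⊆-δ-suc S F c t u sums zero = trans (∑⊆-0 S (λ y → *-zeroˡ (F y))) (sym (*-zeroʳ c))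
∑⊆-δ-suc S F c t u sums (suc k) = sums k

-- A k-subset of true ∷ S may or may not contain the new coordinate.
∑⊆-δ-free : ∀ {n} (S : Cube n) F c t u → LayerSums S F c t u →
  ∀ k → ∑⊆ S (λ y → δ (#ones y) k * F y) + ∑⊆ S (λ y → δ (suc (#ones y)) k * F y) ≡ c * ⟨ supersets t (suc u) k ⟩
∑⊆-δ-free S F c t u sums k = begin
  ∑⊆ S (λ y → δ (#ones y) k * F y) + ∑⊆ S (λ y → δ (suc (#ones y)) k * F y)
    ≡⟨ cong₂ _+_ (sums k) (∑⊆-δ-suc S F c t u sums k) ⟩
  c * ⟨ supersets t u k ⟩ + c * ⟨ supersets (suc t) u k ⟩
    ≡⟨ sym (*-distribˡ-+ c _ _) ⟩
  c * (⟨ supersets t u k ⟩ + ⟨ supersets (suc t) u k ⟩)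
    ≡⟨ cong (c *_) (sym (trans (cong ⟨_⟩ (supersets-pascal t u k)) (⟨⟩-homo-+ (supersets t u k) _))) ⟩
  c * ⟨ supersets t (suc u) k ⟩ ∎
  where open ≡-Reasoning

1^q : ∀ j → 1ℚ ^q j ≡ 1ℚ
1^q zero = refl
1^q (suc j) = trans (*-identityˡ (1ℚ ^q j)) (1^q j)

-- Summing a monomial over the k-subsets y of S counts the k-subsets containing S ∩ supp e.
∑⊆-monomial : ∀ {n} (S x : Cube n) e → Disjoint x S →
  LayerSums S (λ y → evalMono e (x ∪ y)) (monoOutside S x e) (#∩supp S e) (#∖supp S e)
∑⊆-monomial [] [] [] _ zero = refl
∑⊆-monomial [] [] [] _ (suc k) = refl
∑⊆-monomial (false ∷ S) (a ∷ x) (j ∷ e) x∩S≡∅ k = begin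
  ∑⊆ S (λ y → δ (#ones y) k * ((⟦ a ∨ false ⟧ ^q j) * evalMono e (x ∪ y)))
    ≡⟨ ∑⊆-cong S (λ y → trans (cong (λ b → δ (#ones y) k * ((⟦ b ⟧ ^q j) * evalMono e (x ∪ y))) (∨-identityʳ a))
         (solve 3 (λ d c v → d :* (c :* v) := c :* (d :* v)) refl (δ (#ones y) k) (⟦ a ⟧ ^q j) (evalMono e (x ∪ y)))) ⟩
  ∑⊆ S (λ y → (⟦ a ⟧ ^q j) * (δ (#ones y) k * evalMono e (x ∪ y)))
    ≡⟨ ∑⊆-distribˡ S (⟦ a ⟧ ^q j) _ ⟩
  (⟦ a ⟧ ^q j) * ∑⊆ S (λ y → δ (#ones y) k * evalMono e (x ∪ y))
    ≡⟨ cong ((⟦ a ⟧ ^q j) *_) (∑⊆-monomial S x e x∩S≡∅ k) ⟩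
  (⟦ a ⟧ ^q j) * (monoOutside S x e * ⟨ supersets (#∩supp S e) (#∖supp S e) k ⟩)
    ≡⟨ sym (*-assoc (⟦ a ⟧ ^q j) (monoOutside S x e) _) ⟩
  (⟦ a ⟧ ^q j) * monoOutside S x e * ⟨ supersets (#∩supp S e) (#∖supp S e) k ⟩ ∎
  where open ≡-Reasoning
∑⊆-monomial (true ∷ S) (false ∷ x) (zero ∷ e) (refl , x∩S≡∅) =
  ∑⊆-δ-free S (λ y → 1ℚ * evalMono e (x ∪ y)) c t u (LayerSums-cong S c t u (λ y → *-identityˡ _) (∑⊆-monomial S x e x∩S≡∅))
  where
  c = monoOutside S x e
  t = #∩supp S e
  u = #∖supp S e
∑⊆-monomial (true ∷ S) (false ∷ x) (suc j ∷ e) (refl , x∩S≡∅) k = begin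
  ∑⊆ S (λ y → δ (#ones y) k * (0ℚ * (0ℚ ^q j) * F y)) + ∑⊆ S (λ y → δ (suc (#ones y)) k * (1ℚ * (1ℚ ^q j) * F y))
    ≡⟨ cong₂ _+_ (∑⊆-0 S (λ y → solve 3 (λ d p v → d :* (con 0ℚ :* p :* v) := con 0ℚ) refl (δ (#ones y) k) (0ℚ ^q j) (F y)))
         (∑⊆-δ-suc S _ c t u (LayerSums-cong S c t u 1*1ʲ*v≡v (∑⊆-monomial S x e x∩S≡∅)) k) ⟩
  0ℚ + c * ⟨ supersets (suc t) u k ⟩
    ≡⟨ +-identityˡ _ ⟩
  c * ⟨ supersets (suc t) u k ⟩ ∎
  where
  open ≡-Reasoning
  F = λ y → evalMono e (x ∪ y)
  c = monoOutside S x e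
  t = #∩supp S e
  u = #∖supp S e
  1*1ʲ*v≡v : ∀ y → 1ℚ * (1ℚ ^q j) * F y ≡ F y
  1*1ʲ*v≡v y = trans (cong (_* F y) (trans (*-identityˡ _) (1^q j))) (*-identityˡ _)

∑⊆-δ : ∀ {n} (S : Cube n) k → ∑⊆ S (λ y → δ (#ones y) k) ≡ ⟨ #ones S C k ⟩
∑⊆-δ [] zero = refl
∑⊆-δ [] (suc k) = refl
∑⊆-δ (false ∷ S) k = ∑⊆-δ S k
∑⊆-δ (true ∷ S) zero = trans (cong₂ _+_ (∑⊆-δ S 0) (∑⊆-0 S (λ _ → refl))) (+-identityʳ _)
∑⊆-δ (true ∷ S) (suc k) = begin
  ∑⊆ S (λ y → δ (#ones y) (suc k)) + ∑⊆ S (λ y → δ (#ones y) k)   ≡⟨ cong₂ _+_ (∑⊆-δ S (suc k)) (∑⊆-δ S k) ⟩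
  ⟨ s C suc k ⟩ + ⟨ s C k ⟩                                         ≡⟨ sym (⟨⟩-homo-+ (s C suc k) (s C k)) ⟩
  ⟨ s C suc k ℕ.+ s C k ⟩                                           ≡⟨ cong ⟨_⟩ (trans (ℕₚ.+-comm (s C suc k) (s C k)) (sym (pascal s k))) ⟩
  ⟨ suc s C suc k ⟩                                                 ∎
  where
  open ≡-Reasoning
  s = #ones S

layerAvg : ∀ {n} → Cube n → Cube n → ℕ → (Cube n → ℚ) → ℚ
layerAvg S x k q = ∑⊆ S (λ y → δ (#ones y) k * q (x ∪ y)) * recip ⟨ #ones S C k ⟩

layerAvg-linear : ∀ {n} (S x : Cube n) k c (f r : Cube n → ℚ) →
  layerAvg S x k (λ z → c * f z + r z) ≡ c * layerAvg S x k f + layerAvg S x k r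
layerAvg-linear S x k c f r = begin
  ∑⊆ S (λ y → δ (#ones y) k * (c * f (x ∪ y) + r (x ∪ y))) * w
    ≡⟨ cong (_* w) (∑⊆-cong S (λ y → solve 4 (λ d c f r → d :* (c :* f :+ r) := c :* (d :* f) :+ d :* r) refl (δ (#ones y) k) c (f (x ∪ y)) (r (x ∪ y)))) ⟩
  ∑⊆ S (λ y → c * (δ (#ones y) k * f (x ∪ y)) + δ (#ones y) k * r (x ∪ y)) * w
    ≡⟨ cong (_* w) (trans (∑⊆-+ S _ _) (cong (_+ B) (∑⊆-distribˡ S c _))) ⟩
  (c * A + B) * w
    ≡⟨ solve 4 (λ c a b w → (c :* a :+ b) :* w := c :* (a :* w) :+ b :* w) refl c A B w ⟩
  c * (A * w) + B * w ∎
  where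
  open ≡-Reasoning
  w = recip ⟨ #ones S C k ⟩
  A = ∑⊆ S (λ y → δ (#ones y) k * f (x ∪ y))
  B = ∑⊆ S (λ y → δ (#ones y) k * r (x ∪ y))

layerAvg-0 : ∀ {n} (S x : Cube n) k → layerAvg S x k (λ _ → 0ℚ) ≡ 0ℚ
layerAvg-0 S x k = trans (cong (_* recip ⟨ #ones S C k ⟩) (∑⊆-0 S (λ y → *-zeroʳ (δ (#ones y) k)))) (*-zeroˡ (recip ⟨ #ones S C k ⟩))

layerAvg-at-0 : ∀ {n} (S x : Cube n) q → layerAvg S x 0 q ≡ q x
layerAvg-at-0 S x q = trans (cong (_* 1ℚ) (trans (∑⊆-δ₀ S (λ y → q (x ∪ y))) (cong q (x∪∅≡x x)))) (*-identityʳ (q x))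

layerAvg-monomial : ∀ {n} (S x : Cube n) e → Disjoint x S → ∀ k → k ℕ.≤ #ones S →
  layerAvg S x k (evalMono e) ≡ monoOutside S x e * recip ⟨ falling (#ones S) (#∩supp S e) ⟩ * fallingℚ ⟨ k ⟩ (#∩supp S e)
layerAvg-monomial S x e x∩S≡∅ k k≤s = begin
  ∑⊆ S (λ y → δ (#ones y) k * evalMono e (x ∪ y)) * recip ⟨ s C k ⟩
    ≡⟨ cong (_* recip ⟨ s C k ⟩) (∑⊆-monomial S x e x∩S≡∅ k) ⟩
  c * ⟨ supersets t u k ⟩ * recip ⟨ s C k ⟩
    ≡⟨ *-assoc c _ _ ⟩
  c * (⟨ supersets t u k ⟩ * recip ⟨ s C k ⟩)
    ≡⟨ cong (c *_) (a*b≡c*d⇒a/c≡d/b ⟨ supersets t u k ⟩ ⟨ falling s t ⟩ ⟨ s C k ⟩ (fallingℚ ⟨ k ⟩ t) counting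
         (⟨⟩-nonZero (falling-pos t≤s)) (⟨⟩-nonZero (nCk-pos k≤s))) ⟩
  c * (fallingℚ ⟨ k ⟩ t * recip ⟨ falling s t ⟩)
    ≡⟨ solve 3 (λ c h r → c :* (h :* r) := c :* r :* h) refl c (fallingℚ ⟨ k ⟩ t) (recip ⟨ falling s t ⟩) ⟩
  c * recip ⟨ falling s t ⟩ * fallingℚ ⟨ k ⟩ t ∎
  where
  open ≡-Reasoning
  s = #ones S
  t = #∩supp S e
  u = #∖supp S e
  c = monoOutside S x e
  t+u≡s : t ℕ.+ u ≡ s
  t+u≡s = #∩supp+#∖supp S e
  t≤s : t ℕ.≤ s
  t≤s = subst (t ℕ.≤_) t+u≡s (ℕₚ.m≤m+n t u)
  counting : ⟨ supersets t u k ⟩ * ⟨ falling s t ⟩ ≡ ⟨ s C k ⟩ * fallingℚ ⟨ k ⟩ t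
  counting = begin
    ⟨ supersets t u k ⟩ * ⟨ falling s t ⟩        ≡⟨ sym (⟨⟩-homo-* (supersets t u k) (falling s t)) ⟩
    ⟨ supersets t u k ℕ.* falling s t ⟩          ≡⟨ cong (λ z → ⟨ supersets t u k ℕ.* falling z t ⟩) (sym t+u≡s) ⟩
    ⟨ supersets t u k ℕ.* falling (t ℕ.+ u) t ⟩  ≡⟨ cong ⟨_⟩ (supersets-falling t u k) ⟩
    ⟨ ((t ℕ.+ u) C k) ℕ.* falling k t ⟩          ≡⟨ cong (λ z → ⟨ (z C k) ℕ.* falling k t ⟩) t+u≡s ⟩
    ⟨ (s C k) ℕ.* falling k t ⟩                  ≡⟨ ⟨⟩-homo-* (s C k) (falling k t) ⟩
    ⟨ s C k ⟩ * ⟨ falling k t ⟩                  ≡⟨ cong (⟨ s C k ⟩ *_) (⟨falling⟩ k t) ⟩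
    ⟨ s C k ⟩ * fallingℚ ⟨ k ⟩ t                 ∎

raiseTo : ∀ {t m g} → t ℕ.≤ m → Polynomial t g → Polynomial m g
raiseTo {m = zero} ℕ.z≤n P = P
raiseTo {t} {suc m} t≤1+m P with t ℕ.≟ suc m
... | yes refl = P
... | no t≢1+m = raise (raiseTo (ℕₚ.≤-pred (ℕₚ.≤∧≢⇒< t≤1+m t≢1+m)) P)

-- Minsky–Papert symmetrisation.
layerAvg-polynomial : ∀ {n} (S x : Cube n) → Disjoint x S → ∀ (p : Poly n) m → DegLe p m →
  Σ (ℕ → ℚ) λ g → Polynomial m g × (∀ k → k ℕ.≤ #ones S → layerAvg S x k (eval p) ≡ g k)
layerAvg-polynomial S x x∩S≡∅ [] m [] = (λ _ → 0ℚ) , raiseTo ℕ.z≤n (const 0ℚ) , λ k _ → layerAvg-0 S x k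
layerAvg-polynomial S x x∩S≡∅ ((c , e) ∷ p) m (deg-e ∷ deg-p) with layerAvg-polynomial S x x∩S≡∅ p m deg-p
... | g , P , avg≡g = (λ k → c * (a * fallingℚ ⟨ k ⟩ t) + g k)
                     , scale c (scale a (raiseTo (ℕₚ.≤-trans (#∩supp≤deg S e) deg-e) (fallingℚ-polynomial t))) ⊞ P
                     , λ k k≤s → trans (layerAvg-linear S x k c (evalMono e) (eval p))
                         (cong₂ (λ u v → c * u + v) (layerAvg-monomial S x e x∩S≡∅ k k≤s) (avg≡g k k≤s))
  where
  t = #∩supp S e
  a = monoOutside S x e * recip ⟨ falling (#ones S) t ⟩

layerAvg-bound : ∀ {n} (S x : Cube n) q ε → 0ℚ ≤ ε →
  (∀ y → y ⊆ S → 1 ℕ.≤ #ones y → ∣ q (x ∪ y) ∣ ≤ ε) → ∀ k → 1 ℕ.≤ k → k ℕ.≤ #ones S → ∣ layerAvg S x k q ∣ ≤ ε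
layerAvg-bound S x q ε 0≤ε q≤ε k 1≤k k≤s = begin
  ∣ Σq * w ∣        ≡⟨ ∣p*q∣≡∣p∣*∣q∣ Σq w ⟩
  ∣ Σq ∣ * ∣ w ∣    ≡⟨ cong (∣ Σq ∣ *_) (0≤p⇒∣p∣≡p 0≤w) ⟩
  ∣ Σq ∣ * w        ≤⟨ *-monoʳ-≤-0≤ w 0≤w ∣Σq∣≤ ⟩
  ε * N * w         ≡⟨ *-assoc ε N w ⟩
  ε * (N * w)       ≡⟨ cong (ε *_) (*-recipʳ N (⟨⟩-nonZero (nCk-pos k≤s))) ⟩
  ε * 1ℚ            ≡⟨ *-identityʳ ε ⟩
  ε                 ∎
  where
  open ≤-Reasoning
  Σq = ∑⊆ S (λ y → δ (#ones y) k * q (x ∪ y))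
  N = ⟨ #ones S C k ⟩
  w = recip N
  0≤w = recip-nonNeg (⟨⟩-nonNeg (#ones S C k))
  term : ∀ y → y ⊆ S → ∣ δ (#ones y) k * q (x ∪ y) ∣ ≤ ε * δ (#ones y) k
  term y y⊆S with δ-cases (#ones y) k
  ... | inj₁ (δ≡1 , #y≡k) rewrite δ≡1 = subst₂ _≤_ (cong ∣_∣ (sym (*-identityˡ _))) (sym (*-identityʳ ε))
                                           (q≤ε y y⊆S (subst (1 ℕ.≤_) (sym #y≡k) 1≤k))
  ... | inj₂ δ≡0 rewrite δ≡0 = subst₂ _≤_ (cong ∣_∣ (sym (*-zeroˡ (q (x ∪ y))))) (sym (*-zeroʳ ε)) ≤-refl
  ∣Σq∣≤ : ∣ Σq ∣ ≤ ε * N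
  ∣Σq∣≤ = ≤-trans (∣∑⊆∣≤ S _ (λ y → ε * δ (#ones y) k) term)
    (≤-reflexive (trans (∑⊆-distribˡ S ε _) (cong (ε *_) (∑⊆-δ S k))))

-- A polynomial of degree m is controlled at 0 by its values at m + 1 further nodes:
-- the divided difference over all m + 2 nodes vanishes.
polynomial-bound-at-0 : ∀ {m g} ε R → 0ℚ ≤ ε → Polynomial m g → Unique (0 ∷ R) → suc m ℕ.≤ length R →
  All (λ k → ∣ g k ∣ ≤ ε) R → ∣ g 0 ∣ * absWeight 0 R ≤ ε * divDiffAbs R (λ k → recip ⟨ k ⟩)
polynomial-bound-at-0 {m} {g} ε R 0≤ε P u m<∣R∣ g≤ε = begin
  ∣ g 0 ∣ * absWeight 0 R                      ≡⟨ cong (∣ g 0 ∣ *_) (sym (∣nodeWeight∣ 0 R)) ⟩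
  ∣ g 0 ∣ * ∣ nodeWeight 0 R ∣                 ≡⟨ sym (∣p*q∣≡∣p∣*∣q∣ (g 0) (nodeWeight 0 R)) ⟩
  ∣ g 0 * nodeWeight 0 R ∣                     ≡⟨ cong ∣_∣ head≡-tail ⟩
  ∣ - divDiff R G ∣                            ≡⟨ ∣-p∣≡∣p∣ (divDiff R G) ⟩
  ∣ divDiff R G ∣                              ≤⟨ ∣divDiff∣≤divDiffAbs R G ⟩
  divDiffAbs R G                               ≤⟨ divDiffAbs-mono R (All.map ∣G∣≤ g≤ε) ⟩
  divDiffAbs R (λ k → ε * recip ⟨ k ⟩)         ≡⟨ divDiffAbs-scale R ε (λ k → recip ⟨ k ⟩) ⟩
  ∣ ε ∣ * divDiffAbs R (λ k → recip ⟨ k ⟩)     ≡⟨ cong (_* divDiffAbs R (λ k → recip ⟨ k ⟩)) (0≤p⇒∣p∣≡p 0≤ε) ⟩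
  ε * divDiffAbs R (λ k → recip ⟨ k ⟩)         ∎
  where
  open ≤-Reasoning
  G = λ k → g k * recip (⟨ k ⟩ - 0ℚ)
  head≡-tail : g 0 * nodeWeight 0 R ≡ - divDiff R G
  head≡-tail = begin-equality
    g 0 * nodeWeight 0 R                                  ≡⟨ solve 2 (λ a b → a := (a :+ b) :- b) refl _ (divDiff R G) ⟩
    (g 0 * nodeWeight 0 R + divDiff R G) - divDiff R G    ≡⟨ cong (_- divDiff R G) (divDiff-polynomial P (0 ∷ R) u (ℕ.s≤s m<∣R∣)) ⟩
    0ℚ - divDiff R G                                      ≡⟨ solve 1 (λ a → con 0ℚ :- a := :- a) refl (divDiff R G) ⟩
    - divDiff R G                                         ∎
  ∣G∣≤ : ∀ {k} → ∣ g k ∣ ≤ ε → ∣ G k ∣ ≤ ∣ ε * recip ⟨ k ⟩ ∣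
  ∣G∣≤ {k} gk≤ε = begin
    ∣ g k * recip (⟨ k ⟩ - 0ℚ) ∣    ≡⟨ cong (λ z → ∣ g k * recip z ∣) (solve 1 (λ a → a :- con 0ℚ := a) refl ⟨ k ⟩) ⟩
    ∣ g k * recip ⟨ k ⟩ ∣           ≡⟨ ∣p*q∣≡∣p∣*∣q∣ (g k) (recip ⟨ k ⟩) ⟩
    ∣ g k ∣ * ∣ recip ⟨ k ⟩ ∣       ≤⟨ *-monoʳ-≤-0≤ _ (0≤∣p∣ (recip ⟨ k ⟩)) gk≤ε ⟩
    ε * ∣ recip ⟨ k ⟩ ∣             ≡⟨ cong (ε *_) (0≤p⇒∣p∣≡p 0≤1/k) ⟩
    ε * recip ⟨ k ⟩                 ≡⟨ sym (0≤p⇒∣p∣≡p (0≤p*q 0≤ε 0≤1/k)) ⟩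
    ∣ ε * recip ⟨ k ⟩ ∣             ∎
    where 0≤1/k = recip-nonNeg (⟨⟩-nonNeg k)

-- The layer averages of p form a univariate polynomial that is ≥ 1 at 0 and ≤ ε at every node of R,
-- contradicting polynomial-bound-at-0.
no-steep-polynomial : ∀ {n} ε R → 0ℚ ≤ ε → Unique (0 ∷ R) → ε * divDiffAbs R (λ k → recip ⟨ k ⟩) < absWeight 0 R →
  (S x : Cube n) (p : Poly n) (m : ℕ) → DegLe p m → suc m ℕ.≤ length R → All (λ k → 1 ℕ.≤ k × k ℕ.≤ #ones S) R →
  Disjoint x S → 1ℚ ≤ ∣ eval p x ∣ → (∀ y → y ⊆ S → 1 ℕ.≤ #ones y → ∣ eval p (x ∪ y) ∣ ≤ ε) → ⊥
no-steep-polynomial ε R 0≤ε u 0-dominates S x p m deg-p m<∣R∣ R⊆[1,s] x∩S≡∅ 1≤∣px∣ p≤ε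
  with layerAvg-polynomial S x x∩S≡∅ p m deg-p
... | g , P , avg≡g = <-irrefl refl (≤-<-trans absWeight≤ 0-dominates)
  where
  g≤ε : All (λ k → ∣ g k ∣ ≤ ε) R
  g≤ε = All.map (λ {k} (1≤k , k≤s) → subst (λ z → ∣ z ∣ ≤ ε) (avg≡g k k≤s) (layerAvg-bound S x (eval p) ε 0≤ε p≤ε k 1≤k k≤s)) R⊆[1,s]
  g0≡px : g 0 ≡ eval p x
  g0≡px = trans (sym (avg≡g 0 ℕ.z≤n)) (layerAvg-at-0 S x (eval p))
  absWeight≤ : absWeight 0 R ≤ ε * divDiffAbs R (λ k → recip ⟨ k ⟩)
  absWeight≤ = begin
    absWeight 0 R              ≡⟨ sym (*-identityˡ _) ⟩
    1ℚ * absWeight 0 R         ≤⟨ *-monoʳ-≤-0≤ _ (absWeight-nonNeg 0 R) (subst (λ z → 1ℚ ≤ ∣ z ∣) (sym g0≡px) 1≤∣px∣) ⟩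
    ∣ g 0 ∣ * absWeight 0 R    ≤⟨ polynomial-bound-at-0 ε R 0≤ε P u m<∣R∣ g≤ε ⟩
    ε * divDiffAbs R (λ k → recip ⟨ k ⟩) ∎
    where open ≤-Reasoning

-- The nodes 0, 1 and c j²

∣i²-j²∣ : ∀ i j → j ℕ.≤ i → ∣ ⟨ i ℕ.* i ⟩ - ⟨ j ℕ.* j ⟩ ∣ ≡ ⟨ i ℕ.∸ j ⟩ * ⟨ i ℕ.+ j ⟩
∣i²-j²∣ i j j≤i = trans (cong ∣_∣ i²-j²) (0≤p⇒∣p∣≡p (0≤p*q (⟨⟩-nonNeg (i ℕ.∸ j)) (⟨⟩-nonNeg (i ℕ.+ j))))
  where
  open ≡-Reasoning
  i²-j² : ⟨ i ℕ.* i ⟩ - ⟨ j ℕ.* j ⟩ ≡ ⟨ i ℕ.∸ j ⟩ * ⟨ i ℕ.+ j ⟩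
  i²-j² = begin
    ⟨ i ℕ.* i ⟩ - ⟨ j ℕ.* j ⟩        ≡⟨ cong₂ _-_ (⟨⟩-homo-* i i) (⟨⟩-homo-* j j) ⟩
    ⟨ i ⟩ * ⟨ i ⟩ - ⟨ j ⟩ * ⟨ j ⟩    ≡⟨ solve 2 (λ a b → a :* a :- b :* b := (a :- b) :* (a :+ b)) refl ⟨ i ⟩ ⟨ j ⟩ ⟩
    (⟨ i ⟩ - ⟨ j ⟩) * (⟨ i ⟩ + ⟨ j ⟩) ≡⟨ cong₂ _*_ (sym (⟨⟩-homo-∸ i j j≤i)) (sym (⟨⟩-homo-+ i j)) ⟩
    ⟨ i ℕ.∸ j ⟩ * ⟨ i ℕ.+ j ⟩        ∎

∣j²-i²∣ : ∀ i j → j ℕ.≤ i → ∣ ⟨ j ℕ.* j ⟩ - ⟨ i ℕ.* i ⟩ ∣ ≡ ⟨ i ℕ.∸ j ⟩ * ⟨ i ℕ.+ j ⟩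
∣j²-i²∣ i j j≤i = trans (cong ∣_∣ (solve 2 (λ a b → b :- a := :- (a :- b)) refl ⟨ i ℕ.* i ⟩ ⟨ j ℕ.* j ⟩))
  (trans (∣-p∣≡∣p∣ _) (∣i²-j²∣ i j j≤i))

-- For O = [1, m] ∖ {i} this is 2 (m!)² / ((m - i)! (m + i)!) (squareRatio-closed).
squareRatio : ℕ → List ℕ → ℚ
squareRatio i O = ∏ O (λ j → ⟨ j ℕ.* j ⟩ * recip ∣ ⟨ i ℕ.* i ⟩ - ⟨ j ℕ.* j ⟩ ∣)

squareRatio-below : ∀ i O → All (ℕ._< i) O →
  squareRatio i O * ⟨ ∏ℕ O (i ℕ.∸_) ℕ.* ∏ℕ O (i ℕ.+_) ⟩ ≡ ⟨ ∏ℕ O (λ j → j ℕ.* j) ⟩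
squareRatio-below i [] [] = refl
squareRatio-below i (j ∷ O) (j<i ∷ O<i) = begin
  ⟨ j ℕ.* j ⟩ * r * squareRatio i O * ⟨ (i ℕ.∸ j) ℕ.* Y ℕ.* ((i ℕ.+ j) ℕ.* X) ⟩
    ≡⟨ cong (⟨ j ℕ.* j ⟩ * r * squareRatio i O *_) (trans (⟨⟩-homo-* ((i ℕ.∸ j) ℕ.* Y) ((i ℕ.+ j) ℕ.* X))
         (cong₂ _*_ (⟨⟩-homo-* (i ℕ.∸ j) Y) (⟨⟩-homo-* (i ℕ.+ j) X))) ⟩
  ⟨ j ℕ.* j ⟩ * r * squareRatio i O * (⟨ i ℕ.∸ j ⟩ * ⟨ Y ⟩ * (⟨ i ℕ.+ j ⟩ * ⟨ X ⟩))
    ≡⟨ solve 7 (λ q r s a y b x → q :* r :* s :* (a :* y :* (b :* x)) := q :* (r :* (a :* b)) :* (s :* (y :* x))) refl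
         ⟨ j ℕ.* j ⟩ r (squareRatio i O) ⟨ i ℕ.∸ j ⟩ ⟨ Y ⟩ ⟨ i ℕ.+ j ⟩ ⟨ X ⟩ ⟩
  ⟨ j ℕ.* j ⟩ * (r * (⟨ i ℕ.∸ j ⟩ * ⟨ i ℕ.+ j ⟩)) * (squareRatio i O * (⟨ Y ⟩ * ⟨ X ⟩))
    ≡⟨ cong₂ (λ u v → ⟨ j ℕ.* j ⟩ * u * v) r*[i²-j²]≡1 (trans (cong (squareRatio i O *_) (sym (⟨⟩-homo-* Y X))) (squareRatio-below i O O<i)) ⟩
  ⟨ j ℕ.* j ⟩ * 1ℚ * ⟨ ∏ℕ O (λ j → j ℕ.* j) ⟩
    ≡⟨ trans (cong (_* ⟨ ∏ℕ O (λ j → j ℕ.* j) ⟩) (*-identityʳ ⟨ j ℕ.* j ⟩)) (sym (⟨⟩-homo-* (j ℕ.* j) (∏ℕ O (λ j → j ℕ.* j)))) ⟩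
  ⟨ j ℕ.* j ℕ.* ∏ℕ O (λ j → j ℕ.* j) ⟩ ∎
  where
  open ≡-Reasoning
  Y = ∏ℕ O (i ℕ.∸_)
  X = ∏ℕ O (i ℕ.+_)
  r = recip ∣ ⟨ i ℕ.* i ⟩ - ⟨ j ℕ.* j ⟩ ∣
  r*[i²-j²]≡1 : r * (⟨ i ℕ.∸ j ⟩ * ⟨ i ℕ.+ j ⟩) ≡ 1ℚ
  r*[i²-j²]≡1 = begin
    r * (⟨ i ℕ.∸ j ⟩ * ⟨ i ℕ.+ j ⟩)   ≡⟨ cong (λ z → recip z * (⟨ i ℕ.∸ j ⟩ * ⟨ i ℕ.+ j ⟩)) (∣i²-j²∣ i j (ℕₚ.<⇒≤ j<i)) ⟩
    recip (⟨ i ℕ.∸ j ⟩ * ⟨ i ℕ.+ j ⟩) * (⟨ i ℕ.∸ j ⟩ * ⟨ i ℕ.+ j ⟩)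
      ≡⟨ *-comm (recip (⟨ i ℕ.∸ j ⟩ * ⟨ i ℕ.+ j ⟩)) (⟨ i ℕ.∸ j ⟩ * ⟨ i ℕ.+ j ⟩) ⟩
    (⟨ i ℕ.∸ j ⟩ * ⟨ i ℕ.+ j ⟩) * recip (⟨ i ℕ.∸ j ⟩ * ⟨ i ℕ.+ j ⟩)
      ≡⟨ *-recipʳ (⟨ i ℕ.∸ j ⟩ * ⟨ i ℕ.+ j ⟩) (subst (_≢ 0ℚ) (⟨⟩-homo-* (i ℕ.∸ j) (i ℕ.+ j)) (⟨⟩-nonZero 0<[i∸j][i+j])) ⟩
    1ℚ ∎
    where
    0<[i∸j][i+j] : 0 ℕ.< (i ℕ.∸ j) ℕ.* (i ℕ.+ j)
    0<[i∸j][i+j] = 0<m*n (ℕₚ.m<n⇒0<n∸m j<i) (ℕₚ.≤-trans (ℕₚ.≤-trans (ℕ.s≤s ℕ.z≤n) j<i) (ℕₚ.m≤m+n i j))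

squareRatio-top : ∀ m → squareRatio (suc m) (downFrom1 m) * ⟨ (suc m ℕ.∸ suc m) ! ℕ.* (suc m ℕ.+ suc m) ! ⟩ ≡ ⟨ 2 ℕ.* (suc m ! ℕ.* suc m !) ⟩
squareRatio-top m = ⟨⟩-rescale (squareRatio M (downFrom1 m)) (Y ℕ.* X) Q ((M ℕ.∸ M) ! ℕ.* (M ℕ.+ M) !) (2 ℕ.* (M ! ℕ.* M !))
  (squareRatio-below M (downFrom1 m) (All.map (λ (_ , j≤m) → ℕ.s≤s j≤m) (downFrom1-bounds m))) 0<Y*X Q*fact≡
  where
  M = suc m
  Y = ∏ℕ (downFrom1 m) (M ℕ.∸_)
  X = ∏ℕ (downFrom1 m) (M ℕ.+_)
  Q = ∏ℕ (downFrom1 m) (λ j → j ℕ.* j)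
  Y≡m! : Y ≡ m !
  Y≡m! = trans (sym (ℕₚ.*-identityʳ Y)) (∏-shifted-down 0 m)
  X*M!≡[M+m]! : X ℕ.* M ! ≡ (M ℕ.+ m) !
  X*M!≡[M+m]! = ∏-shifted-up M m
  0<Y*X : 0 ℕ.< Y ℕ.* X
  0<Y*X = 0<m*n (subst (0 ℕ.<_) (sym Y≡m!) (ℕₚ.1≤n! m))
    (0<m*n⇒0<m X (subst (0 ℕ.<_) (sym X*M!≡[M+m]!) (ℕₚ.1≤n! (M ℕ.+ m))))
  Q*fact≡ : Q ℕ.* ((M ℕ.∸ M) ! ℕ.* (M ℕ.+ M) !) ≡ 2 ℕ.* (M ! ℕ.* M !) ℕ.* (Y ℕ.* X)
  Q*fact≡ = trans (cong (ℕ._* ((M ℕ.∸ M) ! ℕ.* (M ℕ.+ M) !)) (∏-squares m))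
    (trans (factorials-top m X X*M!≡[M+m]!) (cong (λ z → 2 ℕ.* (M ! ℕ.* M !) ℕ.* (z ℕ.* X)) (sym Y≡m!)))

squareRatio-step : ∀ m i O → i ℕ.≤ m → squareRatio i O * ⟨ (m ℕ.∸ i) ! ℕ.* (m ℕ.+ i) ! ⟩ ≡ ⟨ 2 ℕ.* (m ! ℕ.* m !) ⟩ →
  squareRatio i (suc m ∷ O) * ⟨ (suc m ℕ.∸ i) ! ℕ.* (suc m ℕ.+ i) ! ⟩ ≡ ⟨ 2 ℕ.* (suc m ! ℕ.* suc m !) ⟩
squareRatio-step m i O i≤m IH = ⟨⟩-rescale new (A ℕ.* B ℕ.* D) (M ℕ.* M ℕ.* Q) ((M ℕ.∸ i) ! ℕ.* (M ℕ.+ i) !) (2 ℕ.* (M ! ℕ.* M !))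
  new*ABD≡ (0<m*n (0<m*n 0<A 0<B) (0<m*n (ℕₚ.1≤n! (m ℕ.∸ i)) (ℕₚ.1≤n! (m ℕ.+ i)))) (factorials-step m i i≤m)
  where
  M = suc m
  A = M ℕ.∸ i
  B = M ℕ.+ i
  D = (m ℕ.∸ i) ! ℕ.* (m ℕ.+ i) !
  Q = 2 ℕ.* (m ! ℕ.* m !)
  new = squareRatio i (M ∷ O)
  0<A : 0 ℕ.< A
  0<A = ℕₚ.m<n⇒0<n∸m (ℕ.s≤s i≤m)
  0<B : 0 ℕ.< B
  0<B = ℕ.s≤s ℕ.z≤n
  AB≢0 : ⟨ A ⟩ * ⟨ B ⟩ ≢ 0ℚ
  AB≢0 = subst (_≢ 0ℚ) (⟨⟩-homo-* A B) (⟨⟩-nonZero (0<m*n 0<A 0<B))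
  new*ABD≡ : new * ⟨ A ℕ.* B ℕ.* D ⟩ ≡ ⟨ M ℕ.* M ℕ.* Q ⟩
  new*ABD≡ = begin
    ⟨ M ℕ.* M ⟩ * recip ∣ ⟨ i ℕ.* i ⟩ - ⟨ M ℕ.* M ⟩ ∣ * squareRatio i O * ⟨ A ℕ.* B ℕ.* D ⟩
      ≡⟨ cong₂ (λ u v → ⟨ M ℕ.* M ⟩ * recip u * squareRatio i O * v) (∣j²-i²∣ M i (ℕₚ.m≤n⇒m≤1+n i≤m))
           (trans (⟨⟩-homo-* (A ℕ.* B) D) (cong (_* ⟨ D ⟩) (⟨⟩-homo-* A B))) ⟩
    ⟨ M ℕ.* M ⟩ * recip (⟨ A ⟩ * ⟨ B ⟩) * squareRatio i O * (⟨ A ⟩ * ⟨ B ⟩ * ⟨ D ⟩)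
      ≡⟨ solve 5 (λ m r p ab d → m :* r :* p :* (ab :* d) := m :* (ab :* r) :* (p :* d)) refl
           ⟨ M ℕ.* M ⟩ (recip (⟨ A ⟩ * ⟨ B ⟩)) (squareRatio i O) (⟨ A ⟩ * ⟨ B ⟩) ⟨ D ⟩ ⟩
    ⟨ M ℕ.* M ⟩ * ((⟨ A ⟩ * ⟨ B ⟩) * recip (⟨ A ⟩ * ⟨ B ⟩)) * (squareRatio i O * ⟨ D ⟩)
      ≡⟨ cong₂ (λ u v → ⟨ M ℕ.* M ⟩ * u * v) (*-recipʳ (⟨ A ⟩ * ⟨ B ⟩) AB≢0) IH ⟩
    ⟨ M ℕ.* M ⟩ * 1ℚ * ⟨ Q ⟩
      ≡⟨ trans (cong (_* ⟨ Q ⟩) (*-identityʳ ⟨ M ℕ.* M ⟩)) (sym (⟨⟩-homo-* (M ℕ.* M) Q)) ⟩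
    ⟨ M ℕ.* M ℕ.* Q ⟩ ∎
    where open ≡-Reasoning

squareRatio-closed : ∀ m → All (λ (i , O) → i ℕ.≤ m × squareRatio i O * ⟨ (m ℕ.∸ i) ! ℕ.* (m ℕ.+ i) ! ⟩ ≡ ⟨ 2 ℕ.* (m ! ℕ.* m !) ⟩)
  (selections (downFrom1 m))
squareRatio-closed zero = []
squareRatio-closed (suc m) = (ℕₚ.≤-refl , squareRatio-top m)
  ∷ map⁺ (All.map (λ {(i , O)} (i≤m , closed) → ℕₚ.m≤n⇒m≤1+n i≤m , squareRatio-step m i O i≤m closed) (squareRatio-closed m))

squareRatio≤2 : ∀ m → All (λ (i , O) → squareRatio i O ≤ ⟨ 2 ⟩) (selections (downFrom1 m))
squareRatio≤2 m = All.map (λ {(i , O)} (i≤m , closed) → bound i O i≤m closed) (squareRatio-closed m)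
  where
  bound : ∀ i O → i ℕ.≤ m → squareRatio i O * ⟨ (m ℕ.∸ i) ! ℕ.* (m ℕ.+ i) ! ⟩ ≡ ⟨ 2 ℕ.* (m ! ℕ.* m !) ⟩ → squareRatio i O ≤ ⟨ 2 ⟩
  bound i O i≤m closed = *-cancelʳ-≤-pos ⟨ F ⟩ {{positive (⟨⟩-pos (0<m*n (ℕₚ.1≤n! (m ℕ.∸ i)) (ℕₚ.1≤n! (m ℕ.+ i))))}} (begin
    squareRatio i O * ⟨ F ⟩    ≡⟨ closed ⟩
    ⟨ 2 ℕ.* (m ! ℕ.* m !) ⟩   ≤⟨ ⟨⟩-mono-≤ (ℕₚ.*-monoʳ-≤ 2 (m!²≤[m∸i]![m+i]! m i i≤m)) ⟩
    ⟨ 2 ℕ.* F ⟩               ≡⟨ ⟨⟩-homo-* 2 F ⟩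
    ⟨ 2 ⟩ * ⟨ F ⟩             ∎)
    where
    open ≤-Reasoning
    F = (m ℕ.∸ i) ! ℕ.* (m ℕ.+ i) !

squareNodes : ℕ → ℕ → List ℕ
squareNodes c m = map (scaledSq c) (downFrom1 m)

α : ℕ → ℕ → ℚ
α c j = recip ∣ ⟨ scaledSq c j ⟩ - ⟨ 1 ⟩ ∣

K : ℕ → ℚ
K c = ⟨ 4 ⟩ * recip ⟨ c ⟩

α-nonNeg : ∀ c j → 0ℚ ≤ α c j
α-nonNeg c j = 0≤recip∣∣ (⟨ scaledSq c j ⟩ - ⟨ 1 ⟩)

K-nonNeg : ∀ c → 0ℚ ≤ K c
K-nonNeg c = 0≤p*q (⟨⟩-nonNeg 4) (recip-nonNeg (⟨⟩-nonNeg c))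

recip-⟨j⟩-⟨j+1⟩ : ∀ j → 1 ℕ.≤ j → recip ⟨ j ⟩ - recip ⟨ suc j ⟩ ≡ recip ⟨ j ℕ.* suc j ⟩
recip-⟨j⟩-⟨j+1⟩ j 1≤j = begin
  a - b                                      ≡⟨ solve 2 (λ a b → a :- b := a :* con 1ℚ :- b :* con 1ℚ) refl a b ⟩
  a * 1ℚ - b * 1ℚ                            ≡⟨ cong₂ (λ u v → a * u - b * v) (sym (*-recipʳ ⟨ suc j ⟩ (⟨⟩-nonZero {suc j} (ℕ.s≤s ℕ.z≤n))))
                                                  (sym (*-recipʳ ⟨ j ⟩ (⟨⟩-nonZero 1≤j))) ⟩
  a * ((1ℚ + ⟨ j ⟩) * b) - b * (⟨ j ⟩ * a)    ≡⟨ solve 3 (λ a x b → a :* ((con 1ℚ :+ x) :* b) :- b :* (x :* a) := a :* b) refl a ⟨ j ⟩ b ⟩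
  a * b                                      ≡⟨ sym (trans (cong recip (⟨⟩-homo-* j (suc j))) (recip-* ⟨ j ⟩ ⟨ suc j ⟩)) ⟩
  recip ⟨ j ℕ.* suc j ⟩                      ∎
  where
  open ≡-Reasoning
  a = recip ⟨ j ⟩
  b = recip ⟨ suc j ⟩

α≤K*telescoping : ∀ c j → 2 ℕ.≤ c → 1 ℕ.≤ j → α c j ≤ K c * (recip ⟨ j ⟩ - recip ⟨ suc j ⟩)
α≤K*telescoping c j 2≤c 1≤j = begin
  recip ∣ ⟨ s ⟩ - ⟨ 1 ⟩ ∣               ≡⟨ cong recip (trans (cong ∣_∣ (sym (⟨⟩-homo-∸ s 1 1≤s))) (0≤p⇒∣p∣≡p (⟨⟩-nonNeg (s ℕ.∸ 1)))) ⟩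
  recip ⟨ s ℕ.∸ 1 ⟩                     ≡⟨ sym (recip-cancelˡ ⟨ 4 ⟩ ⟨ s ℕ.∸ 1 ⟩ (⟨⟩-nonZero {4} (ℕ.s≤s ℕ.z≤n))) ⟩
  ⟨ 4 ⟩ * recip (⟨ 4 ⟩ * ⟨ s ℕ.∸ 1 ⟩)   ≤⟨ *-monoˡ-≤-0≤ ⟨ 4 ⟩ (⟨⟩-nonNeg 4) (recip-antimono-≤ (⟨⟩-pos 0<Y)
                                             (subst₂ _≤_ refl (⟨⟩-homo-* 4 (s ℕ.∸ 1)) (⟨⟩-mono-≤ (scaledSq-gap c j 2≤c 1≤j)))) ⟩
  ⟨ 4 ⟩ * recip ⟨ c ℕ.* (j ℕ.* suc j) ⟩ ≡⟨ cong (⟨ 4 ⟩ *_) (trans (cong recip (⟨⟩-homo-* c (j ℕ.* suc j))) (recip-* ⟨ c ⟩ _)) ⟩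
  ⟨ 4 ⟩ * (recip ⟨ c ⟩ * recip ⟨ j ℕ.* suc j ⟩) ≡⟨ sym (*-assoc ⟨ 4 ⟩ (recip ⟨ c ⟩) _) ⟩
  K c * recip ⟨ j ℕ.* suc j ⟩           ≡⟨ cong (K c *_) (sym (recip-⟨j⟩-⟨j+1⟩ j 1≤j)) ⟩
  K c * (recip ⟨ j ⟩ - recip ⟨ suc j ⟩) ∎
  where
  open ≤-Reasoning
  s = scaledSq c j
  1≤s = ℕₚ.≤-trans (ℕ.s≤s ℕ.z≤n) (scaledSq≥2 c j 2≤c 1≤j)
  0<Y : 0 ℕ.< c ℕ.* (j ℕ.* suc j)
  0<Y = 0<m*n (ℕₚ.≤-trans (ℕ.s≤s ℕ.z≤n) 2≤c) (0<m*n 1≤j (ℕ.s≤s ℕ.z≤n))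

∑α : ℕ → ℕ → ℚ
∑α c m = ∑ (downFrom1 m) (α c)

∏1+α : ℕ → ℕ → ℚ
∏1+α c m = ∏ (downFrom1 m) (λ j → 1ℚ + α c j)

∑α-telescoping : ∀ c → 2 ℕ.≤ c → ∀ m → ∑α c m ≤ K c * (1ℚ - recip ⟨ suc m ⟩)
∑α-telescoping c 2≤c zero = ≤-reflexive (sym (trans (cong (K c *_) (+-inverseʳ 1ℚ)) (*-zeroʳ (K c))))
∑α-telescoping c 2≤c (suc m) = begin
  α c (suc m) + ∑α c m
    ≤⟨ +-mono-≤ (α≤K*telescoping c (suc m) 2≤c (ℕ.s≤s ℕ.z≤n)) (∑α-telescoping c 2≤c m) ⟩
  K c * (recip ⟨ suc m ⟩ - recip ⟨ suc (suc m) ⟩) + K c * (1ℚ - recip ⟨ suc m ⟩)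
    ≡⟨ solve 3 (λ k u v → k :* (u :- v) :+ k :* (con 1ℚ :- u) := k :* (con 1ℚ :- v)) refl (K c) (recip ⟨ suc m ⟩) (recip ⟨ suc (suc m) ⟩) ⟩
  K c * (1ℚ - recip ⟨ suc (suc m) ⟩) ∎
  where open ≤-Reasoning

∑α≤K : ∀ c → 2 ℕ.≤ c → ∀ m → ∑α c m ≤ K c
∑α≤K c 2≤c m = ≤-trans (∑α-telescoping c 2≤c m) (begin
  K c * (1ℚ - z)     ≡⟨ solve 2 (λ k z → k :* (con 1ℚ :- z) := k :- k :* z) refl (K c) z ⟩
  K c - K c * z      ≤⟨ +-monoʳ-≤ (K c) (neg-antimono-≤ (0≤p*q (K-nonNeg c) (recip-nonNeg (⟨⟩-nonNeg (suc m))))) ⟩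
  K c - 0ℚ           ≡⟨ solve 1 (λ k → k :- con 0ℚ := k) refl (K c) ⟩
  K c                ∎)
  where
  open ≤-Reasoning
  z = recip ⟨ suc m ⟩

∏1+α≤ : ∀ c → 2 ℕ.≤ c → ⟨ 2 ⟩ * K c ≤ 1ℚ → ∀ m → ∏1+α c m ≤ 1ℚ + ⟨ 2 ⟩ * ∑α c m
∏1+α≤ c 2≤c 2K≤1 zero = ≤-reflexive (solve 1 (λ t → con 1ℚ := con 1ℚ :+ t :* con 0ℚ) refl ⟨ 2 ⟩)
∏1+α≤ c 2≤c 2K≤1 (suc m) = begin
  (1ℚ + a) * ∏1+α c m            ≤⟨ *-monoˡ-≤-0≤ (1ℚ + a) (0≤p+q 0≤1 (α-nonNeg c (suc m))) (∏1+α≤ c 2≤c 2K≤1 m) ⟩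
  (1ℚ + a) * (1ℚ + ⟨ 2 ⟩ * σ)    ≡⟨ solve 3 (λ a t s → (con 1ℚ :+ a) :* (con 1ℚ :+ t :* s) := con 1ℚ :+ t :* s :+ a :+ a :* (t :* s)) refl a ⟨ 2 ⟩ σ ⟩
  1ℚ + ⟨ 2 ⟩ * σ + a + a * (⟨ 2 ⟩ * σ)
    ≤⟨ +-monoʳ-≤ (1ℚ + ⟨ 2 ⟩ * σ + a) (*-monoˡ-≤-0≤ a (α-nonNeg c (suc m)) (≤-trans (*-monoˡ-≤-0≤ ⟨ 2 ⟩ (⟨⟩-nonNeg 2) (∑α≤K c 2≤c m)) 2K≤1)) ⟩
  1ℚ + ⟨ 2 ⟩ * σ + a + a * 1ℚ    ≡⟨ solve 2 (λ a s → con 1ℚ :+ (con 1ℚ :+ con 1ℚ) :* s :+ a :+ a :* con 1ℚ := con 1ℚ :+ (con 1ℚ :+ con 1ℚ) :* (a :+ s)) refl a σ ⟩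
  1ℚ + ⟨ 2 ⟩ * (a + σ)           ∎
  where
  open ≤-Reasoning
  a = α c (suc m)
  σ = ∑α c m

w₀ : ℕ → ℕ → ℚ
w₀ c j = recip ∣ ⟨ 0 ⟩ - ⟨ scaledSq c j ⟩ ∣

W₀ : ℕ → ℕ → ℚ
W₀ c m = absWeight 0 (squareNodes c m)

W₀≡∏w₀ : ∀ c m → W₀ c m ≡ ∏ (downFrom1 m) (w₀ c)
W₀≡∏w₀ c m = ∏-map (scaledSq c) (downFrom1 m) (λ u → recip ∣ ⟨ 0 ⟩ - ⟨ u ⟩ ∣)

∣0-⟨n⟩∣ : ∀ n → ∣ ⟨ 0 ⟩ - ⟨ n ⟩ ∣ ≡ ⟨ n ⟩
∣0-⟨n⟩∣ n = trans (cong ∣_∣ (solve 1 (λ x → con 0ℚ :- x := :- x) refl ⟨ n ⟩)) (trans (∣-p∣≡∣p∣ ⟨ n ⟩) (0≤p⇒∣p∣≡p (⟨⟩-nonNeg n)))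

w₀≡recip : ∀ c j → w₀ c j ≡ recip ⟨ scaledSq c j ⟩
w₀≡recip c j = cong recip (∣0-⟨n⟩∣ (scaledSq c j))

W₀-pos : ∀ c m → 2 ℕ.≤ c → 0ℚ < W₀ c m
W₀-pos c m 2≤c = subst (0ℚ <_) (sym (W₀≡∏w₀ c m)) (∏-pos (downFrom1 m)
  (All.map (λ {j} (1≤j , _) → subst (0ℚ <_) (sym (w₀≡recip c j)) (recip-pos (⟨⟩-pos (ℕₚ.≤-trans (ℕ.s≤s ℕ.z≤n) (scaledSq≥2 c j 2≤c 1≤j)))))
    (downFrom1-bounds m)))

recip∣1-scaledSq∣ : ∀ c j → 2 ℕ.≤ c → 1 ℕ.≤ j → recip ∣ ⟨ 1 ⟩ - ⟨ scaledSq c j ⟩ ∣ ≡ w₀ c j * (1ℚ + α c j)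
recip∣1-scaledSq∣ c j 2≤c 1≤j = begin
  recip ∣ ⟨ 1 ⟩ - ⟨ s ⟩ ∣      ≡⟨ cong recip (trans (∣p-q∣≡∣q-p∣ ⟨ 1 ⟩ ⟨ s ⟩) ∣s-1∣≡) ⟩
  recip Y                      ≡⟨ sym (*-identityˡ (recip Y)) ⟩
  1ℚ * recip Y                 ≡⟨ cong (_* recip Y) (sym (*-recipʳ X X≢0)) ⟩
  X * recip X * recip Y        ≡⟨ cong (λ z → z * recip X * recip Y) X≡Y+1 ⟩
  (Y + 1ℚ) * recip X * recip Y ≡⟨ solve 3 (λ y rx ry → (y :+ con 1ℚ) :* rx :* ry := rx :* (y :* ry :+ ry)) refl Y (recip X) (recip Y) ⟩
  recip X * (Y * recip Y + recip Y) ≡⟨ cong (λ z → recip X * (z + recip Y)) (*-recipʳ Y Y≢0) ⟩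
  recip X * (1ℚ + recip Y)     ≡⟨ cong₂ (λ u v → recip u * (1ℚ + recip v)) (sym (∣0-⟨n⟩∣ s)) (sym ∣s-1∣≡) ⟩
  w₀ c j * (1ℚ + α c j)        ∎
  where
  open ≡-Reasoning
  s = scaledSq c j
  2≤s = scaledSq≥2 c j 2≤c 1≤j
  1≤s = ℕₚ.≤-trans (ℕ.s≤s ℕ.z≤n) 2≤s
  X = ⟨ s ⟩
  Y = ⟨ s ℕ.∸ 1 ⟩
  X≢0 = ⟨⟩-nonZero 1≤s
  Y≢0 = ⟨⟩-nonZero (ℕₚ.∸-monoˡ-≤ 1 2≤s)
  ∣s-1∣≡ : ∣ ⟨ s ⟩ - ⟨ 1 ⟩ ∣ ≡ Y
  ∣s-1∣≡ = trans (cong ∣_∣ (sym (⟨⟩-homo-∸ s 1 1≤s))) (0≤p⇒∣p∣≡p (⟨⟩-nonNeg (s ℕ.∸ 1)))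
  X≡Y+1 : X ≡ Y + 1ℚ
  X≡Y+1 = trans (solve 2 (λ x o → x := (x :- o) :+ o) refl X ⟨ 1 ⟩) (cong (_+ ⟨ 1 ⟩) (sym (⟨⟩-homo-∸ s 1 1≤s)))
  ∣p-q∣≡∣q-p∣ : ∀ p q → ∣ p - q ∣ ≡ ∣ q - p ∣
  ∣p-q∣≡∣q-p∣ p q = trans (cong ∣_∣ (solve 2 (λ p q → p :- q := :- (q :- p)) refl p q)) (∣-p∣≡∣p∣ (q - p))

absWeight-at-1 : ∀ c m → 2 ℕ.≤ c → absWeight 1 (squareNodes c m) ≡ W₀ c m * ∏1+α c m
absWeight-at-1 c m 2≤c = begin
  absWeight 1 (squareNodes c m)                               ≡⟨ ∏-map (scaledSq c) (downFrom1 m) (λ u → recip ∣ ⟨ 1 ⟩ - ⟨ u ⟩ ∣) ⟩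
  ∏ (downFrom1 m) (λ j → recip ∣ ⟨ 1 ⟩ - ⟨ scaledSq c j ⟩ ∣)  ≡⟨ ∏-cong-local (All.map (λ {j} (1≤j , _) → recip∣1-scaledSq∣ c j 2≤c 1≤j) (downFrom1-bounds m)) ⟩
  ∏ (downFrom1 m) (λ j → w₀ c j * (1ℚ + α c j))               ≡⟨ ∏-* (downFrom1 m) (w₀ c) (λ j → 1ℚ + α c j) ⟩
  ∏ (downFrom1 m) (w₀ c) * ∏1+α c m                           ≡⟨ cong (_* ∏1+α c m) (sym (W₀≡∏w₀ c m)) ⟩
  W₀ c m * ∏1+α c m                                           ∎
  where open ≡-Reasoning

recip∣scaledSq-scaledSq∣ : ∀ c i j → 1 ℕ.≤ j →
  recip ∣ ⟨ scaledSq c i ⟩ - ⟨ scaledSq c j ⟩ ∣ ≡ w₀ c j * (⟨ j ℕ.* j ⟩ * recip ∣ ⟨ i ℕ.* i ⟩ - ⟨ j ℕ.* j ⟩ ∣)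
recip∣scaledSq-scaledSq∣ c i j 1≤j = begin
  recip ∣ ⟨ c ℕ.* (i ℕ.* i) ⟩ - ⟨ c ℕ.* (j ℕ.* j) ⟩ ∣
    ≡⟨ cong (λ z → recip ∣ z ∣) (trans (cong₂ _-_ (⟨⟩-homo-* c (i ℕ.* i)) (⟨⟩-homo-* c (j ℕ.* j)))
         (solve 3 (λ c a b → c :* a :- c :* b := c :* (a :- b)) refl ⟨ c ⟩ I² J²)) ⟩
  recip ∣ ⟨ c ⟩ * (I² - J²) ∣
    ≡⟨ cong recip (trans (∣p*q∣≡∣p∣*∣q∣ ⟨ c ⟩ (I² - J²)) (cong (_* ∣ I² - J² ∣) (0≤p⇒∣p∣≡p (⟨⟩-nonNeg c)))) ⟩
  recip (⟨ c ⟩ * ∣ I² - J² ∣)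
    ≡⟨ recip-* ⟨ c ⟩ ∣ I² - J² ∣ ⟩
  recip ⟨ c ⟩ * D
    ≡⟨ solve 2 (λ r d → r :* d := r :* con 1ℚ :* d) refl (recip ⟨ c ⟩) D ⟩
  recip ⟨ c ⟩ * 1ℚ * D
    ≡⟨ cong (λ z → recip ⟨ c ⟩ * z * D) (sym (*-recipʳ J² J²≢0)) ⟩
  recip ⟨ c ⟩ * (J² * recip J²) * D
    ≡⟨ solve 4 (λ rc j rj d → rc :* (j :* rj) :* d := rc :* rj :* (j :* d)) refl (recip ⟨ c ⟩) J² (recip J²) D ⟩
  recip ⟨ c ⟩ * recip J² * (J² * D)
    ≡⟨ cong (_* (J² * D)) (sym (trans (w₀≡recip c j) (trans (cong recip (⟨⟩-homo-* c (j ℕ.* j))) (recip-* ⟨ c ⟩ J²)))) ⟩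
  w₀ c j * (J² * D) ∎
  where
  open ≡-Reasoning
  I² = ⟨ i ℕ.* i ⟩
  J² = ⟨ j ℕ.* j ⟩
  D = recip ∣ I² - J² ∣
  J²≢0 = ⟨⟩-nonZero (ℕₚ.*-mono-≤ 1≤j 1≤j)

selectionTerm : ∀ c m i O → 1 ℕ.≤ i → All (1 ℕ.≤_) O → ∏ (downFrom1 m) (w₀ c) ≡ w₀ c i * ∏ O (w₀ c) →
  ∣ ∣ recip ⟨ scaledSq c i ⟩ ∣ * recip ∣ ⟨ scaledSq c i ⟩ - ⟨ 1 ⟩ ∣ ∣ * absWeight (scaledSq c i) (map (scaledSq c) O)
    ≡ W₀ c m * (α c i * squareRatio i O)
selectionTerm c m i O 1≤i 1≤O W₀-split = begin
  ∣ ∣ recip ⟨ X ⟩ ∣ * α c i ∣ * absWeight X (map (scaledSq c) O)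
    ≡⟨ cong₂ _*_ (trans (∣p∣*recip∣q∣-nonNeg (recip ⟨ X ⟩) (⟨ X ⟩ - ⟨ 1 ⟩)) (cong (_* α c i) (0≤p⇒∣p∣≡p (recip-nonNeg (⟨⟩-nonNeg X)))))
         (∏-map (scaledSq c) O (λ u → recip ∣ ⟨ X ⟩ - ⟨ u ⟩ ∣)) ⟩
  recip ⟨ X ⟩ * α c i * ∏ O (λ j → recip ∣ ⟨ X ⟩ - ⟨ scaledSq c j ⟩ ∣)
    ≡⟨ cong (recip ⟨ X ⟩ * α c i *_) (∏-cong-local (All.map (recip∣scaledSq-scaledSq∣ c i _) 1≤O)) ⟩
  recip ⟨ X ⟩ * α c i * ∏ O (λ j → w₀ c j * (⟨ j ℕ.* j ⟩ * recip ∣ ⟨ i ℕ.* i ⟩ - ⟨ j ℕ.* j ⟩ ∣))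
    ≡⟨ cong (recip ⟨ X ⟩ * α c i *_) (∏-* O (w₀ c) _) ⟩
  recip ⟨ X ⟩ * α c i * (∏ O (w₀ c) * squareRatio i O)
    ≡⟨ solve 4 (λ r a w s → r :* a :* (w :* s) := r :* w :* (a :* s)) refl (recip ⟨ X ⟩) (α c i) (∏ O (w₀ c)) (squareRatio i O) ⟩
  recip ⟨ X ⟩ * ∏ O (w₀ c) * (α c i * squareRatio i O)
    ≡⟨ cong (λ z → z * ∏ O (w₀ c) * (α c i * squareRatio i O)) (sym (w₀≡recip c i)) ⟩
  w₀ c i * ∏ O (w₀ c) * (α c i * squareRatio i O)
    ≡⟨ cong (_* (α c i * squareRatio i O)) (sym (trans (W₀≡∏w₀ c m) W₀-split)) ⟩
  W₀ c m * (α c i * squareRatio i O) ∎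
  where
  open ≡-Reasoning
  X = scaledSq c i

divDiffAbs-squareNodes : ∀ c m → 2 ℕ.≤ c →
  divDiffAbs (squareNodes c m) (λ k → ∣ recip ⟨ k ⟩ ∣ * recip ∣ ⟨ k ⟩ - ⟨ 1 ⟩ ∣) ≤ W₀ c m * (⟨ 2 ⟩ * ∑α c m)
divDiffAbs-squareNodes c m 2≤c = begin
  ∑ (selections (squareNodes c m)) F
    ≡⟨ cong (λ L → ∑ L F) (selections-map (scaledSq c) (downFrom1 m)) ⟩
  ∑ (map (λ (τ , O) → scaledSq c τ , map (scaledSq c) O) (selections (downFrom1 m))) F
    ≡⟨ ∑-map _ (selections (downFrom1 m)) F ⟩
  ∑ (selections (downFrom1 m)) (λ (i , O) → F (scaledSq c i , map (scaledSq c) O))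
    ≡⟨ ∑-cong-local (All.map (λ {(i , O)} (((1≤i , _) , bounds-O) , split) → selectionTerm c m i O 1≤i (All.map proj₁ bounds-O) split)
         (All.zip (All-selections (downFrom1-bounds m) , ∏-selection (w₀ c) (downFrom1 m)))) ⟩
  ∑ (selections (downFrom1 m)) (λ (i , O) → W₀ c m * (α c i * squareRatio i O))
    ≤⟨ ∑-mono-≤ (All.map (λ {(i , O)} sr≤2 → *-monoˡ-≤-0≤ (W₀ c m) 0≤W₀ (*-monoˡ-≤-0≤ (α c i) (α-nonNeg c i) sr≤2)) (squareRatio≤2 m)) ⟩
  ∑ (selections (downFrom1 m)) (λ (i , O) → W₀ c m * (α c i * ⟨ 2 ⟩))
    ≡⟨ ∑-distribˡ (selections (downFrom1 m)) (W₀ c m) _ ⟩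
  W₀ c m * ∑ (selections (downFrom1 m)) (λ (i , _) → α c i * ⟨ 2 ⟩)
    ≡⟨ cong (W₀ c m *_) (∑-selections (downFrom1 m) (λ j → α c j * ⟨ 2 ⟩)) ⟩
  W₀ c m * ∑ (downFrom1 m) (λ j → α c j * ⟨ 2 ⟩)
    ≡⟨ cong (W₀ c m *_) (trans (∑-cong (downFrom1 m) (λ j → *-comm (α c j) ⟨ 2 ⟩)) (∑-distribˡ (downFrom1 m) ⟨ 2 ⟩ (α c))) ⟩
  W₀ c m * (⟨ 2 ⟩ * ∑α c m) ∎
  where
  open ≤-Reasoning
  F = λ ((τ , O) : ℕ × List ℕ) → ∣ ∣ recip ⟨ τ ⟩ ∣ * recip ∣ ⟨ τ ⟩ - ⟨ 1 ⟩ ∣ ∣ * absWeight τ O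
  0≤W₀ = <⇒≤ (W₀-pos c m 2≤c)

Admissible : ℕ → ℚ → Set
Admissible c ε = ε * (1ℚ + ⟨ 4 ⟩ * K c) < 1ℚ

2K≤1 : ∀ c → 8 ℕ.≤ c → ⟨ 2 ⟩ * K c ≤ 1ℚ
2K≤1 c 8≤c = begin
  ⟨ 2 ⟩ * (⟨ 4 ⟩ * recip ⟨ c ⟩)   ≡⟨ trans (sym (*-assoc ⟨ 2 ⟩ ⟨ 4 ⟩ (recip ⟨ c ⟩))) (cong (_* recip ⟨ c ⟩) (sym (⟨⟩-homo-* 2 4))) ⟩
  ⟨ 8 ⟩ * recip ⟨ c ⟩             ≤⟨ *-monoʳ-≤-0≤ (recip ⟨ c ⟩) (recip-nonNeg (⟨⟩-nonNeg c)) (⟨⟩-mono-≤ 8≤c) ⟩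
  ⟨ c ⟩ * recip ⟨ c ⟩             ≡⟨ *-recipʳ ⟨ c ⟩ (⟨⟩-nonZero (ℕₚ.≤-trans (ℕ.s≤s ℕ.z≤n) 8≤c)) ⟩
  1ℚ                              ∎
  where open ≤-Reasoning

squareNodes-spread : ∀ c m ε → 8 ℕ.≤ c → 0ℚ ≤ ε → Admissible c ε →
  ε * divDiffAbs (1 ∷ squareNodes c m) (λ k → recip ⟨ k ⟩) < absWeight 0 (1 ∷ squareNodes c m)
squareNodes-spread c m ε 8≤c 0≤ε admissible = begin-strict
  ε * divDiffAbs (1 ∷ squareNodes c m) (λ k → recip ⟨ k ⟩)
    ≡⟨ cong (ε *_) (divDiffAbs-∷ 1 (squareNodes c m) (λ k → recip ⟨ k ⟩)) ⟩
  ε * (1ℚ * absWeight 1 (squareNodes c m) + divDiffAbs (squareNodes c m) (λ k → ∣ recip ⟨ k ⟩ ∣ * recip ∣ ⟨ k ⟩ - ⟨ 1 ⟩ ∣))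
    ≤⟨ *-monoˡ-≤-0≤ ε 0≤ε (+-mono-≤ (≤-reflexive (trans (*-identityˡ _) (absWeight-at-1 c m 2≤c))) (divDiffAbs-squareNodes c m 2≤c)) ⟩
  ε * (W * ∏1+α c m + W * (⟨ 2 ⟩ * σ))
    ≤⟨ *-monoˡ-≤-0≤ ε 0≤ε (+-monoˡ-≤ (W * (⟨ 2 ⟩ * σ)) (*-monoˡ-≤-0≤ W 0≤W (∏1+α≤ c 2≤c (2K≤1 c 8≤c) m))) ⟩
  ε * (W * (1ℚ + ⟨ 2 ⟩ * σ) + W * (⟨ 2 ⟩ * σ))
    ≡⟨ solve 4 (λ e w t s → e :* (w :* (con 1ℚ :+ t :* s) :+ w :* (t :* s)) := w :* (e :* (con 1ℚ :+ (t :+ t) :* s))) refl ε W ⟨ 2 ⟩ σ ⟩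
  W * (ε * (1ℚ + (⟨ 2 ⟩ + ⟨ 2 ⟩) * σ))
    ≡⟨ cong (λ z → W * (ε * (1ℚ + z * σ))) (sym (⟨⟩-homo-+ 2 2)) ⟩
  W * (ε * (1ℚ + ⟨ 4 ⟩ * σ))
    ≤⟨ *-monoˡ-≤-0≤ W 0≤W (*-monoˡ-≤-0≤ ε 0≤ε (+-monoʳ-≤ 1ℚ (*-monoˡ-≤-0≤ ⟨ 4 ⟩ (⟨⟩-nonNeg 4) (∑α≤K c 2≤c m)))) ⟩
  W * (ε * (1ℚ + ⟨ 4 ⟩ * K c))
    <⟨ *-monoʳ-<-pos W {{positive (W₀-pos c m 2≤c)}} admissible ⟩
  W * 1ℚ
    ≡⟨ trans (*-identityʳ W) (sym (*-identityˡ W)) ⟩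
  absWeight 0 (1 ∷ squareNodes c m) ∎
  where
  open ≤-Reasoning
  2≤c = ℕₚ.≤-trans (ℕ.s≤s (ℕ.s≤s ℕ.z≤n)) 8≤c
  W = W₀ c m
  σ = ∑α c m
  0≤W = <⇒≤ (W₀-pos c m 2≤c)

squareNodes-unique : ∀ c m → 2 ℕ.≤ c → Unique (0 ∷ 1 ∷ squareNodes c m)
squareNodes-unique c m 2≤c = (ℕₚ.<⇒≢ (ℕ.s≤s ℕ.z≤n) ∷ map⁺ (All.map (λ (1≤j , _) → ℕₚ.<⇒≢ (0<s 1≤j)) (downFrom1-bounds m)))
  ∷ map⁺ (All.map (λ (1≤j , _) → ℕₚ.<⇒≢ (scaledSq≥2 c _ 2≤c 1≤j)) (downFrom1-bounds m))
  ∷ decreasing m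
  where
  0<s : ∀ {j} → 1 ℕ.≤ j → 0 ℕ.< scaledSq c j
  0<s 1≤j = ℕₚ.≤-trans (ℕ.s≤s ℕ.z≤n) (scaledSq≥2 c _ 2≤c 1≤j)
  decreasing : ∀ m → Unique (squareNodes c m)
  decreasing zero = []
  decreasing (suc m) = map⁺ (All.map (λ (_ , j≤m) → ℕₚ.>⇒≢ (scaledSq-mono-< c (ℕₚ.≤-trans (ℕ.s≤s ℕ.z≤n) 2≤c) (ℕ.s≤s j≤m))) (downFrom1-bounds m))
    ∷ decreasing m

squareNodes-bounds : ∀ c m s → 2 ℕ.≤ c → scaledSq c m ℕ.< s → All (λ k → 1 ℕ.≤ k × k ℕ.≤ s) (1 ∷ squareNodes c m)
squareNodes-bounds c m s 2≤c cm²<s = (ℕₚ.≤-refl , ℕₚ.≤-trans (ℕ.s≤s ℕ.z≤n) cm²<s)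
  ∷ map⁺ (All.map (λ (1≤j , j≤m) → ℕₚ.≤-trans (ℕ.s≤s ℕ.z≤n) (scaledSq≥2 c _ 2≤c 1≤j) , ℕₚ.≤-trans (scaledSq-mono-≤ c j≤m) (ℕₚ.<⇒≤ cm²<s))
    (downFrom1-bounds m))

jumpSize-bound : ∀ {n} ε c → 0ℚ ≤ ε → 8 ℕ.≤ c → Admissible c ε →
  (S x : Cube n) (p : Poly n) (m : ℕ) → DegLe p m → Disjoint x S → 1ℚ ≤ ∣ eval p x ∣ →
  (∀ y → y ⊆ S → 1 ℕ.≤ #ones y → ∣ eval p (x ∪ y) ∣ ≤ ε) → #ones S ℕ.≤ scaledSq c m
jumpSize-bound ε c 0≤ε 8≤c admissible S x p m deg-p x∩S≡∅ 1≤∣px∣ p≤ε with #ones S ℕ.≤? scaledSq c m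
... | yes s≤cm² = s≤cm²
... | no s≰cm² = ⊥-elim (no-steep-polynomial ε (1 ∷ squareNodes c m) 0≤ε (squareNodes-unique c m 2≤c)
  (squareNodes-spread c m ε 8≤c 0≤ε admissible) S x p m deg-p (ℕₚ.≤-reflexive (sym length≡))
  (squareNodes-bounds c m (#ones S) 2≤c (ℕₚ.≰⇒> s≰cm²)) x∩S≡∅ 1≤∣px∣ p≤ε)
  where
  2≤c = ℕₚ.≤-trans (ℕ.s≤s (ℕ.s≤s ℕ.z≤n)) 8≤c
  length≡ : length (1 ∷ squareNodes c m) ≡ suc m
  length≡ = cong suc (trans (length-map (scaledSq c) (downFrom1 m)) (length-applyDownFrom suc m))

-- Polynomials under xor shifts

eval-++ : ∀ {n} (p q : Poly n) z → eval (p ++ q) z ≡ eval p z + eval q z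
eval-++ [] q z = sym (+-identityˡ _)
eval-++ ((c , e) ∷ p) q z = trans (cong (c * evalMono e z +_) (eval-++ p q z)) (sym (+-assoc (c * evalMono e z) (eval p z) (eval q z)))

DegLe-++ : ∀ {n} {p q : Poly n} {d} → DegLe p d → DegLe q d → DegLe (p ++ q) d
DegLe-++ [] deg-q = deg-q
DegLe-++ (e≤d ∷ deg-p) deg-q = e≤d ∷ DegLe-++ deg-p deg-q

DegLe-weaken : ∀ {n} {p : Poly n} {d d′} → d ℕ.≤ d′ → DegLe p d → DegLe p d′
DegLe-weaken d≤d′ = All.map (λ e≤d → ℕₚ.≤-trans e≤d d≤d′)

scalePoly : ∀ {n} → ℚ → Poly n → Poly n
scalePoly c = map (λ (d , e) → c * d , e)

eval-scalePoly : ∀ {n} c (p : Poly n) z → eval (scalePoly c p) z ≡ c * eval p z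
eval-scalePoly c [] z = sym (*-zeroʳ c)
eval-scalePoly c ((d , e) ∷ p) z = trans (cong (c * d * evalMono e z +_) (eval-scalePoly c p z))
  (solve 4 (λ c d m r → c :* d :* m :+ c :* r := c :* (d :* m :+ r)) refl c d (evalMono e z) (eval p z))

DegLe-scalePoly : ∀ {n} c {p : Poly n} {d} → DegLe p d → DegLe (scalePoly c p) d
DegLe-scalePoly c [] = []
DegLe-scalePoly c (e≤d ∷ deg-p) = e≤d ∷ DegLe-scalePoly c deg-p

incExp : ∀ {n} → Fin n → Monomial n → Monomial n
incExp zero (j ∷ e) = suc j ∷ e
incExp (suc i) (j ∷ e) = j ∷ incExp i e

evalMono-incExp : ∀ {n} (i : Fin n) e z → evalMono (incExp i e) z ≡ ⟦ lookup z i ⟧ * evalMono e z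
evalMono-incExp zero (j ∷ e) (b ∷ z) = *-assoc ⟦ b ⟧ (⟦ b ⟧ ^q j) (evalMono e z)
evalMono-incExp (suc i) (j ∷ e) (b ∷ z) = trans (cong ((⟦ b ⟧ ^q j) *_) (evalMono-incExp i e z))
  (solve 3 (λ a b c → a :* (b :* c) := b :* (a :* c)) refl (⟦ b ⟧ ^q j) ⟦ lookup z i ⟧ (evalMono e z))

sumℕ-incExp : ∀ {n} (i : Fin n) e → sumℕ (incExp i e) ≡ suc (sumℕ e)
sumℕ-incExp zero (j ∷ e) = refl
sumℕ-incExp (suc i) (j ∷ e) = trans (cong (j ℕ.+_) (sumℕ-incExp i e)) (ℕₚ.+-suc j (sumℕ e))

mulVar : ∀ {n} → Fin n → Poly n → Poly n
mulVar i = map (λ (c , e) → c , incExp i e)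

eval-mulVar : ∀ {n} i (p : Poly n) z → eval (mulVar i p) z ≡ ⟦ lookup z i ⟧ * eval p z
eval-mulVar i [] z = sym (*-zeroʳ ⟦ lookup z i ⟧)
eval-mulVar i ((d , e) ∷ p) z = trans (cong₂ (λ u v → d * u + v) (evalMono-incExp i e z) (eval-mulVar i p z))
  (solve 4 (λ d x m r → d :* (x :* m) :+ x :* r := x :* (d :* m :+ r)) refl d ⟦ lookup z i ⟧ (evalMono e z) (eval p z))

DegLe-mulVar : ∀ {n} i {p : Poly n} {d} → DegLe p d → DegLe (mulVar i p) (suc d)
DegLe-mulVar i [] = []
DegLe-mulVar i {(c , e) ∷ p} (e≤d ∷ deg-p) = subst (ℕ._≤ suc _) (sym (sumℕ-incExp i e)) (ℕ.s≤s e≤d) ∷ DegLe-mulVar i deg-p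

zeroExp : ∀ {n} → Monomial n
zeroExp = replicate _ 0

constPoly : ∀ {n} → ℚ → Poly n
constPoly c = (c , zeroExp) ∷ []

eval-constPoly : ∀ {n} c (z : Cube n) → eval (constPoly c) z ≡ c
eval-constPoly c z = trans (cong (λ u → c * u + 0ℚ) (evalMono-zeroExp z)) (trans (+-identityʳ _) (*-identityʳ c))
  where
  evalMono-zeroExp : ∀ {n} (z : Cube n) → evalMono zeroExp z ≡ 1ℚ
  evalMono-zeroExp [] = refl
  evalMono-zeroExp (b ∷ z) = trans (*-identityˡ _) (evalMono-zeroExp z)

DegLe-constPoly : ∀ {n} c d → DegLe (constPoly {n} c) d
DegLe-constPoly {n} c d = subst (ℕ._≤ d) (sym (sumℕ-zeroExp n)) ℕ.z≤n ∷ []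
  where
  sumℕ-zeroExp : ∀ n → sumℕ (zeroExp {n}) ≡ 0
  sumℕ-zeroExp zero = refl
  sumℕ-zeroExp (suc n) = sumℕ-zeroExp n

consVar : ∀ {n} → ℕ → Poly n → Poly (suc n)
consVar k = map (λ (c , e) → c , k ∷ e)

eval-consVar : ∀ {n} k (p : Poly n) v z → eval (consVar k p) (v ∷ z) ≡ (⟦ v ⟧ ^q k) * eval p z
eval-consVar k [] v z = sym (*-zeroʳ (⟦ v ⟧ ^q k))
eval-consVar k ((d , e) ∷ p) v z = trans (cong (d * ((⟦ v ⟧ ^q k) * evalMono e z) +_) (eval-consVar k p v z))
  (solve 4 (λ d x m r → d :* (x :* m) :+ x :* r := x :* (d :* m :+ r)) refl d (⟦ v ⟧ ^q k) (evalMono e z) (eval p z))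

DegLe-consVar : ∀ {n} k {p : Poly n} {d} → DegLe p d → DegLe (consVar k p) (k ℕ.+ d)
DegLe-consVar k [] = []
DegLe-consVar k (e≤d ∷ deg-p) = ℕₚ.+-monoʳ-≤ k e≤d ∷ DegLe-consVar k deg-p

-- Substituting 1 - xᵢ for xᵢ wherever bᵢ = true; on {0,1} a positive power of 1 - x is 1 - x.
xorMono : ∀ {n} → Monomial n → Cube n → Poly n
xorMono [] [] = constPoly 1ℚ
xorMono (j ∷ e) (false ∷ b) = consVar j (xorMono e b)
xorMono (zero ∷ e) (true ∷ b) = consVar 0 (xorMono e b)
xorMono (suc _ ∷ e) (true ∷ b) = consVar 0 (xorMono e b) ++ scalePoly (- 1ℚ) (consVar 1 (xorMono e b))

eval-xorMono : ∀ {n} (e : Monomial n) b z → eval (xorMono e b) z ≡ evalMono e (z ⊕ b)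
eval-xorMono [] [] [] = eval-constPoly 1ℚ []
eval-xorMono (j ∷ e) (false ∷ b) (v ∷ z) = trans (eval-consVar j (xorMono e b) v z)
  (cong₂ (λ u w → (⟦ u ⟧ ^q j) * w) (xorB-false v) (eval-xorMono e b z))
  where
  xorB-false : ∀ v → v ≡ xorB v false
  xorB-false true = refl
  xorB-false false = refl
eval-xorMono (zero ∷ e) (true ∷ b) (v ∷ z) = trans (eval-consVar 0 (xorMono e b) v z) (cong (1ℚ *_) (eval-xorMono e b z))
eval-xorMono (suc j ∷ e) (true ∷ b) (v ∷ z) = begin
  eval (consVar 0 P ++ scalePoly (- 1ℚ) (consVar 1 P)) (v ∷ z)
    ≡⟨ eval-++ (consVar 0 P) _ (v ∷ z) ⟩
  eval (consVar 0 P) (v ∷ z) + eval (scalePoly (- 1ℚ) (consVar 1 P)) (v ∷ z)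
    ≡⟨ cong₂ _+_ (eval-consVar 0 P v z) (trans (eval-scalePoly (- 1ℚ) (consVar 1 P) (v ∷ z)) (cong (- 1ℚ *_) (eval-consVar 1 P v z))) ⟩
  1ℚ * eval P z + - 1ℚ * ((⟦ v ⟧ ^q 1) * eval P z)
    ≡⟨ solve 3 (λ m x r → con 1ℚ :* r :+ m :* (x :* r) := (con 1ℚ :+ m :* x) :* r) refl (- 1ℚ) (⟦ v ⟧ ^q 1) (eval P z) ⟩
  (1ℚ + - 1ℚ * (⟦ v ⟧ ^q 1)) * eval P z
    ≡⟨ cong₂ _*_ (sym (flip-power v)) (eval-xorMono e b z) ⟩
  (⟦ xorB v true ⟧ ^q suc j) * evalMono e (z ⊕ b) ∎
  where
  open ≡-Reasoning
  P = xorMono e b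
  flip-power : ∀ v → ⟦ xorB v true ⟧ ^q suc j ≡ 1ℚ + - 1ℚ * (⟦ v ⟧ ^q 1)
  flip-power true = *-zeroˡ (0ℚ ^q j)
  flip-power false = trans (*-identityˡ (1ℚ ^q j)) (1^q j)

DegLe-xorMono : ∀ {n} (e : Monomial n) b → DegLe (xorMono e b) (sumℕ e)
DegLe-xorMono [] [] = DegLe-constPoly 1ℚ 0
DegLe-xorMono (j ∷ e) (false ∷ b) = DegLe-consVar j (DegLe-xorMono e b)
DegLe-xorMono (zero ∷ e) (true ∷ b) = DegLe-consVar 0 (DegLe-xorMono e b)
DegLe-xorMono (suc j ∷ e) (true ∷ b) = DegLe-++ (DegLe-weaken (ℕₚ.m≤n+m (sumℕ e) (suc j)) (DegLe-consVar 0 (DegLe-xorMono e b)))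
  (DegLe-scalePoly (- 1ℚ) (DegLe-weaken (ℕ.s≤s (ℕₚ.m≤n+m (sumℕ e) j)) (DegLe-consVar 1 (DegLe-xorMono e b))))

xorPoly : ∀ {n} → Poly n → Cube n → Poly n
xorPoly [] b = []
xorPoly ((c , e) ∷ p) b = scalePoly c (xorMono e b) ++ xorPoly p b

eval-xorPoly : ∀ {n} (p : Poly n) b z → eval (xorPoly p b) z ≡ eval p (z ⊕ b)
eval-xorPoly [] b z = refl
eval-xorPoly ((c , e) ∷ p) b z = trans (eval-++ (scalePoly c (xorMono e b)) (xorPoly p b) z)
  (cong₂ _+_ (trans (eval-scalePoly c (xorMono e b) z) (cong (c *_) (eval-xorMono e b z))) (eval-xorPoly p b z))

DegLe-xorPoly : ∀ {n} {p : Poly n} {d} b → DegLe p d → DegLe (xorPoly p b) d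
DegLe-xorPoly b [] = []
DegLe-xorPoly {p = (c , e) ∷ p} b (e≤d ∷ deg-p) =
  DegLe-++ (DegLe-scalePoly c (DegLe-weaken e≤d (DegLe-xorMono e b))) (DegLe-xorPoly b deg-p)

-- Certificate complexity bounds the degree

_∈?_ : ∀ {n} (i : Fin n) (I : List (Fin n)) → Dec (i ∈ I)
i ∈? I = DecMembership._∈?_ Finₚ._≟_ i I

ExactDegLe : ∀ {n} → BoolFn n → ℕ → Set
ExactDegLe {n} g d = Σ (Poly n) λ p → DegLe p d × (∀ z → eval p z ≡ ⟦ g z ⟧)

ExactDegLe-cong : ∀ {n} {g h : BoolFn n} {d} → (∀ z → g z ≡ h z) → ExactDegLe g d → ExactDegLe h d
ExactDegLe-cong g≗h (p , deg-p , p≡g) = p , deg-p , λ z → trans (p≡g z) (cong ⟦_⟧ (g≗h z))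

ExactDegLe-weaken : ∀ {n} {g : BoolFn n} {d d′} → d ℕ.≤ d′ → ExactDegLe g d → ExactDegLe g d′
ExactDegLe-weaken d≤d′ (p , deg-p , p≡g) = p , DegLe-weaken d≤d′ deg-p , p≡g

ExactDegLe-const : ∀ {n} (g : BoolFn n) b d → (∀ z → g z ≡ b) → ExactDegLe g d
ExactDegLe-const g b d g≡b = constPoly ⟦ b ⟧ , DegLe-constPoly ⟦ b ⟧ d ,
  λ z → trans (eval-constPoly ⟦ b ⟧ z) (cong ⟦_⟧ (sym (g≡b z)))

-- Shannon expansion g = g₀ + xᵢ (g₁ - g₀) in the variable i.
ExactDegLe-split : ∀ {n} (i : Fin n) (g : BoolFn n) d →
  ExactDegLe (λ y → g (y [ i ]≔ false)) d → ExactDegLe (λ y → g (y [ i ]≔ true)) d → ExactDegLe g (suc d)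
ExactDegLe-split i g d (p₀ , deg-p₀ , p₀≡g₀) (p₁ , deg-p₁ , p₁≡g₁) = p , deg-p , p≡g
  where
  p = p₀ ++ mulVar i (p₁ ++ scalePoly (- 1ℚ) p₀)
  deg-p = DegLe-++ (DegLe-weaken (ℕₚ.n≤1+n d) deg-p₀) (DegLe-mulVar i (DegLe-++ deg-p₁ (DegLe-scalePoly (- 1ℚ) deg-p₀)))
  eval-p : ∀ z → eval p z ≡ eval p₀ z + ⟦ lookup z i ⟧ * (eval p₁ z + - 1ℚ * eval p₀ z)
  eval-p z = trans (eval-++ p₀ (mulVar i (p₁ ++ scalePoly (- 1ℚ) p₀)) z) (cong (eval p₀ z +_) (trans (eval-mulVar i (p₁ ++ scalePoly (- 1ℚ) p₀) z)
    (cong (⟦ lookup z i ⟧ *_) (trans (eval-++ p₁ (scalePoly (- 1ℚ) p₀) z) (cong (eval p₁ z +_) (eval-scalePoly (- 1ℚ) p₀ z))))))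
  at : ∀ z b → lookup z i ≡ b → g (z [ i ]≔ b) ≡ g z
  at z b zᵢ≡b = cong g (trans (cong (z [ i ]≔_) (sym zᵢ≡b)) ([]≔-lookup z i))
  p≡g : ∀ z → eval p z ≡ ⟦ g z ⟧
  p≡g z with lookup z i in zᵢ≡b
  ... | false = begin
    eval p z                                ≡⟨ eval-p z ⟩
    eval p₀ z + ⟦ lookup z i ⟧ * r          ≡⟨ cong (λ v → eval p₀ z + ⟦ v ⟧ * r) zᵢ≡b ⟩
    eval p₀ z + 0ℚ * r                      ≡⟨ solve 2 (λ a b → a :+ con 0ℚ :* b := a) refl (eval p₀ z) r ⟩
    eval p₀ z                               ≡⟨ p₀≡g₀ z ⟩
    ⟦ g (z [ i ]≔ false) ⟧                  ≡⟨ cong ⟦_⟧ (at z false zᵢ≡b) ⟩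
    ⟦ g z ⟧                                 ∎
    where
    open ≡-Reasoning
    r = eval p₁ z + - 1ℚ * eval p₀ z
  ... | true = begin
    eval p z                                ≡⟨ eval-p z ⟩
    eval p₀ z + ⟦ lookup z i ⟧ * r          ≡⟨ cong (λ v → eval p₀ z + ⟦ v ⟧ * r) zᵢ≡b ⟩
    eval p₀ z + 1ℚ * r                      ≡⟨ solve 2 (λ a b → a :+ con 1ℚ :* (b :+ (:- con 1ℚ) :* a) := b) refl (eval p₀ z) (eval p₁ z) ⟩
    eval p₁ z                               ≡⟨ p₁≡g₁ z ⟩
    ⟦ g (z [ i ]≔ true) ⟧                   ≡⟨ cong ⟦_⟧ (at z true zᵢ≡b) ⟩
    ⟦ g z ⟧                                 ∎
    where
    open ≡-Reasoning
    r = eval p₁ z + - 1ℚ * eval p₀ z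

overwrite : ∀ {n} → List (Fin n) → Cube n → Cube n → Cube n
overwrite [] z y = y
overwrite (i ∷ I) z y = overwrite I z y [ i ]≔ lookup z i

lookup-overwrite-∈ : ∀ {n} (I : List (Fin n)) z y {j} → j ∈ I → lookup (overwrite I z y) j ≡ lookup z j
lookup-overwrite-∈ (i ∷ I) z y {j} j∈i∷I with j Finₚ.≟ i | j∈i∷I
... | yes refl | _ = lookup∘update j (overwrite I z y) (lookup z j)
... | no j≢i | here j≡i = ⊥-elim (j≢i j≡i)
... | no j≢i | there j∈I = trans (lookup∘update′ j≢i (overwrite I z y) _) (lookup-overwrite-∈ I z y j∈I)

lookup-overwrite-∉ : ∀ {n} (I : List (Fin n)) z y {j} → j ∉ I → lookup (overwrite I z y) j ≡ lookup y j
lookup-overwrite-∉ [] z y _ = refl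
lookup-overwrite-∉ (i ∷ I) z y {j} j∉i∷I with j Finₚ.≟ i
... | yes j≡i = ⊥-elim (j∉i∷I (here j≡i))
... | no j≢i = trans (lookup∘update′ j≢i (overwrite I z y) _) (lookup-overwrite-∉ I z y (λ j∈I → j∉i∷I (there j∈I)))

lookup-ext : ∀ {A : Set} {n} (u v : Vec A n) → (∀ i → lookup u i ≡ lookup v i) → u ≡ v
lookup-ext u v u≗v = trans (sym (tabulate∘lookup u)) (trans (tabulate-cong u≗v) (tabulate∘lookup v))

overwrite-∷ : ∀ {n} (I : List (Fin n)) i z b y →
  overwrite I (z [ i ]≔ b) y [ i ]≔ lookup (z [ i ]≔ b) i ≡ overwrite I z y [ i ]≔ b
overwrite-∷ I i z b y = lookup-ext _ _ pointwise
  where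
  z′ = z [ i ]≔ b
  pointwise : ∀ j → lookup (overwrite I z′ y [ i ]≔ lookup z′ i) j ≡ lookup (overwrite I z y [ i ]≔ b) j
  pointwise j with j Finₚ.≟ i
  ... | yes refl = trans (lookup∘update j (overwrite I z′ y) _) (trans (lookup∘update j z b) (sym (lookup∘update j (overwrite I z y) b)))
  ... | no j≢i = trans (lookup∘update′ j≢i (overwrite I z′ y) _) (trans away (sym (lookup∘update′ j≢i (overwrite I z y) b)))
    where
    away : lookup (overwrite I z′ y) j ≡ lookup (overwrite I z y) j
    away with j ∈? I
    ... | yes j∈I = trans (lookup-overwrite-∈ I z′ y j∈I) (trans (lookup∘update′ j≢i z b) (sym (lookup-overwrite-∈ I z y j∈I)))
    ... | no j∉I = trans (lookup-overwrite-∉ I z′ y j∉I) (sym (lookup-overwrite-∉ I z y j∉I))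

ExactDegLe-query : ∀ {n} (I : List (Fin n)) (g : BoolFn n) d →
  (∀ z → ExactDegLe (λ y → g (overwrite I z y)) d) → ExactDegLe g (length I ℕ.+ d)
ExactDegLe-query [] g d restrictions = restrictions (replicate _ false)
ExactDegLe-query (i ∷ I) g d restrictions = ExactDegLe-split i g (length I ℕ.+ d) (fix false) (fix true)
  where
  fix : ∀ b → ExactDegLe (λ y → g (y [ i ]≔ b)) (length I ℕ.+ d)
  fix b = ExactDegLe-query I (λ y → g (y [ i ]≔ b)) d
    (λ z → ExactDegLe-cong (λ y → cong g (overwrite-∷ I i z b y)) (restrictions (z [ i ]≔ b)))

AgreeOn : ∀ {n} → List (Fin n) → Cube n → Cube n → Set
AgreeOn I x z = All (λ i → lookup z i ≡ lookup x i) I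

Certificate : ∀ {n} → BoolFn n → Cube n → List (Fin n) → Set
Certificate {n} g x I = ∀ (z : Cube n) → AgreeOn I x z → g z ≡ g x

C₁≤ : ∀ {n} → BoolFn n → ℕ → Set
C₁≤ {n} g a = ∀ (x : Cube n) → g x ≡ true → Σ (List (Fin n)) λ I → length I ℕ.≤ a × Certificate g x I

C₀≤ : ∀ {n} → BoolFn n → ℕ → Set
C₀≤ {n} g b = ∀ (x : Cube n) → g x ≡ false → Σ (List (Fin n)) λ I → length I ℕ.≤ b × Certificate g x I

overwrite-agrees : ∀ {n} (I : List (Fin n)) z y → AgreeOn I z (overwrite I z y)
overwrite-agrees I z y = All.tabulate (lookup-overwrite-∈ I z y)

_∖_ : ∀ {n} → List (Fin n) → List (Fin n) → List (Fin n)
J ∖ I = filter (λ j → ¬? (j ∈? I)) J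

AgreeOn-overwrite-∖ : ∀ {n} (I J : List (Fin n)) z y w → AgreeOn (J ∖ I) y w → AgreeOn J (overwrite I z y) (overwrite I z w)
AgreeOn-overwrite-∖ I J z y w w≈y = All.tabulate pointwise
  where
  pointwise : ∀ {j} → j ∈ J → lookup (overwrite I z w) j ≡ lookup (overwrite I z y) j
  pointwise {j} j∈J with j ∈? I
  ... | yes j∈I = trans (lookup-overwrite-∈ I z w j∈I) (sym (lookup-overwrite-∈ I z y j∈I))
  ... | no j∉I = trans (lookup-overwrite-∉ I z w j∉I)
    (trans (All.lookup w≈y (∈-filter⁺ (λ j → ¬? (j ∈? I)) j∈J j∉I)) (sym (lookup-overwrite-∉ I z y j∉I)))

AgreeOn-overwrite : ∀ {n} (I J : List (Fin n)) z y w → AgreeOn J y w → AgreeOn J (overwrite I z y) (overwrite I z w)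
AgreeOn-overwrite I J z y w w≈y = AgreeOn-overwrite-∖ I J z y w (filter⁺ (λ j → ¬? (j ∈? I)) w≈y)

∖-disjoint-or-shorter : ∀ {n} (I J : List (Fin n)) → All (_∉ I) J ⊎ length (J ∖ I) ℕ.< length J
∖-disjoint-or-shorter I J with all? (λ j → ¬? (j ∈? I)) J
... | yes J∩I≡∅ = inj₁ J∩I≡∅
... | no J∩I≢∅ = inj₂ (filter-notAll (λ j → ¬? (j ∈? I)) J (¬All⇒Any¬ (λ j → ¬? (j ∈? I)) J J∩I≢∅))

true≢false : true ≢ false
true≢false ()

true-point? : ∀ {n} (g : BoolFn n) → (Σ (Cube n) λ x → g x ≡ true) ⊎ (∀ x → g x ≡ false)
true-point? {zero} g with g [] in g[]≡b
... | true = inj₁ ([] , g[]≡b)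
... | false = inj₂ (λ { [] → g[]≡b })
true-point? {suc n} g with true-point? (λ y → g (false ∷ y)) | true-point? (λ y → g (true ∷ y))
... | inj₁ (y , gy≡1) | _ = inj₁ (false ∷ y , gy≡1)
... | inj₂ _ | inj₁ (y , gy≡1) = inj₁ (true ∷ y , gy≡1)
... | inj₂ g₀≡0 | inj₂ g₁≡0 = inj₂ (λ { (false ∷ y) → g₀≡0 y ; (true ∷ y) → g₁≡0 y })

C₁≤-restrict : ∀ {n} {g : BoolFn n} {a} I z → C₁≤ g a → C₁≤ (λ y → g (overwrite I z y)) a
C₁≤-restrict {g = g} I z c₁ y gy≡1 with c₁ (overwrite I z y) gy≡1
... | J , ∣J∣≤a , cert = J , ∣J∣≤a , λ w w≈y → cert (overwrite I z w) (AgreeOn-overwrite I J z y w w≈y)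

-- Every 0-certificate meets the 1-certificate I, so fixing I shortens all 0-certificates.
C₀≤-restrict : ∀ {n} {g : BoolFn n} {b} x I → g x ≡ true → Certificate g x I → ∀ z →
  C₀≤ g (suc b) → C₀≤ (λ y → g (overwrite I z y)) b
C₀≤-restrict {g = g} x I gx≡1 certI z c₀ y gy≡0 with c₀ (overwrite I z y) gy≡0
... | J , ∣J∣≤1+b , certJ with ∖-disjoint-or-shorter I J
...   | inj₂ ∣J∖I∣<∣J∣ = J ∖ I , ℕₚ.≤-pred (ℕₚ.≤-trans ∣J∖I∣<∣J∣ ∣J∣≤1+b) ,
          λ w w≈y → certJ (overwrite I z w) (AgreeOn-overwrite-∖ I J z y w w≈y)
...   | inj₁ J∩I≡∅ = ⊥-elim (true≢false (trans (sym gx≡1) (trans (sym (certI u u≈x)) (trans (certJ u u≈y′) gy≡0))))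
  where
  y′ = overwrite I z y
  u = overwrite J y′ x
  u≈x : AgreeOn I x u
  u≈x = All.tabulate (λ {i} i∈I → lookup-overwrite-∉ J y′ x (λ i∈J → All.lookup J∩I≡∅ i∈J i∈I))
  u≈y′ : AgreeOn J y′ u
  u≈y′ = overwrite-agrees J y′ x

exactDeg≤C₀*C₁ : ∀ {n} b (g : BoolFn n) a → C₁≤ g a → C₀≤ g b → ExactDegLe g (b ℕ.* a)
exactDeg≤C₀*C₁ b g a c₁ c₀ with true-point? g
... | inj₂ g≡0 = ExactDegLe-const g false _ g≡0
exactDeg≤C₀*C₁ zero g a c₁ c₀ | inj₁ (x , gx≡1) = ExactDegLe-const g true 0 g≡1
  where
  g≡1 : ∀ z → g z ≡ true
  g≡1 z with g z in gz≡b
  ... | true = refl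
  ... | false with c₀ z gz≡b
  ...   | [] , _ , cert = ⊥-elim (true≢false (trans (sym gx≡1) (trans (cert x []) gz≡b)))
exactDeg≤C₀*C₁ (suc b) g a c₁ c₀ | inj₁ (x , gx≡1) with c₁ x gx≡1
... | I , ∣I∣≤a , certI = ExactDegLe-weaken {g = g} (ℕₚ.+-monoˡ-≤ (b ℕ.* a) ∣I∣≤a) (ExactDegLe-query I g (b ℕ.* a)
  (λ z → exactDeg≤C₀*C₁ b (λ y → g (overwrite I z y)) a (C₁≤-restrict I z c₁) (C₀≤-restrict x I gx≡1 certI z c₀)))

-- Monotone and unate functions

NDegLe-xor : ∀ {n} {ε} {f h : BoolFn n} b {m} → (∀ y → h y ≡ f (y ⊕ b)) → NDegLe ε f m → NDegLe ε h m
NDegLe-xor {ε = ε} b h≗f∘⊕b (p , deg-p , sep) = xorPoly p b , DegLe-xorPoly b deg-p , λ y →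
  (λ hy≡0 → subst (λ u → ∣ u ∣ ≤ ε) (sym (eval-xorPoly p b y)) (proj₁ (sep (y ⊕ b)) (trans (sym (h≗f∘⊕b y)) hy≡0))) ,
  (λ hy≡1 → subst (λ u → 1ℚ ≤ ∣ u ∣) (sym (eval-xorPoly p b y)) (proj₂ (sep (y ⊕ b)) (trans (sym (h≗f∘⊕b y)) hy≡1)))

switch-bound : ∀ {n} ε c → 0ℚ ≤ ε → 8 ℕ.≤ c → Admissible c ε → (f : BoolFn n) (m : ℕ) → NDegLe ε f m →
  (S x : Cube n) → Disjoint x S → f x ≡ true → (∀ y → y ⊆ S → 1 ℕ.≤ #ones y → f (x ∪ y) ≡ false) → #ones S ℕ.≤ scaledSq c m
switch-bound ε c 0≤ε 8≤c admissible f m (p , deg-p , sep) S x x∩S≡∅ fx≡1 f≡0 =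
  jumpSize-bound ε c 0≤ε 8≤c admissible S x p m deg-p x∩S≡∅ (proj₂ (sep x) fx≡1)
    (λ y y⊆S y≢∅ → proj₁ (sep (x ∪ y)) (f≡0 y y⊆S y≢∅))

lookup-≼ : ∀ {n} (x y : Cube n) → (∀ i → lookup x i ≤B lookup y i) → x ≼ y
lookup-≼ [] [] _ = []≼
lookup-≼ (a ∷ x) (b ∷ y) x≤y = x≤y zero ∷≼ lookup-≼ x y (λ i → x≤y (suc i))

b≤Btrue : ∀ b → b ≤B true
b≤Btrue false = f≤b
b≤Btrue true = t≤t

true≤B⇒true : ∀ {b} → true ≤B b → b ≡ true
true≤B⇒true t≤t = refl

≤Bfalse⇒false : ∀ {b} → b ≤B false → b ≡ false
≤Bfalse⇒false f≤b = refl

#zeros : ∀ {n} → Cube n → ℕ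
#zeros [] = 0
#zeros (true ∷ y) = #zeros y
#zeros (false ∷ y) = suc (#zeros y)

#ones-clear : ∀ {n} (x : Cube n) i → lookup x i ≡ true → suc (#ones (x [ i ]≔ false)) ≡ #ones x
#ones-clear (true ∷ x) zero _ = refl
#ones-clear (true ∷ x) (suc i) xᵢ≡1 = cong suc (#ones-clear x i xᵢ≡1)
#ones-clear (false ∷ x) (suc i) xᵢ≡1 = #ones-clear x i xᵢ≡1

#zeros-set : ∀ {n} (x : Cube n) i → lookup x i ≡ false → suc (#zeros (x [ i ]≔ true)) ≡ #zeros x
#zeros-set (false ∷ x) zero _ = refl
#zeros-set (true ∷ x) (suc i) xᵢ≡0 = #zeros-set x i xᵢ≡0
#zeros-set (false ∷ x) (suc i) xᵢ≡0 = cong suc (#zeros-set x i xᵢ≡0)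

∁ : ∀ {n} → Cube n → Cube n
∁ = Vec.map not

#ones-complement : ∀ {n} (y : Cube n) → #ones (∁ y) ≡ #zeros y
#ones-complement [] = refl
#ones-complement (true ∷ y) = #ones-complement y
#ones-complement (false ∷ y) = cong suc (#ones-complement y)

lookup-update : ∀ {n} (x : Cube n) i j b → (lookup (x [ i ]≔ b) j ≡ b × j ≡ i) ⊎ lookup (x [ i ]≔ b) j ≡ lookup x j
lookup-update x i j b with j Finₚ.≟ i
... | yes refl = inj₁ (lookup∘update j x b , refl)
... | no j≢i = inj₂ (lookup∘update′ j≢i x b)

lookup-∪ : ∀ {n} (x y : Cube n) i → lookup (x ∪ y) i ≡ lookup x i ∨ lookup y i
lookup-∪ x y i = lookup-zipWith _∨_ i x y

Minimal1Below : ∀ {n} → BoolFn n → Cube n → Cube n → Set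
Minimal1Below h x y = (∀ i → lookup y i ≡ true → lookup x i ≡ true) × h y ≡ true × (∀ i → lookup y i ≡ true → h (y [ i ]≔ false) ≡ false)

Maximal0Above : ∀ {n} → BoolFn n → Cube n → Cube n → Set
Maximal0Above h x y = (∀ i → lookup y i ≡ false → lookup x i ≡ false) × h y ≡ false × (∀ i → lookup y i ≡ false → h (y [ i ]≔ true) ≡ true)

minimal1-below : ∀ {n} (h : BoolFn n) k (x : Cube n) → #ones x ℕ.< k → h x ≡ true → Σ (Cube n) (Minimal1Below h x)
minimal1-below h (suc k) x #x<1+k hx≡1 with Finₚ.any? (λ i → (lookup x i Data.Bool.≟ true) ×-dec (h (x [ i ]≔ false) Data.Bool.≟ true))
... | no none = x , (λ _ xᵢ≡1 → xᵢ≡1) , hx≡1 , (λ i xᵢ≡1 → ¬-not (λ h≡1 → none (i , xᵢ≡1 , h≡1)))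
... | yes (i , xᵢ≡1 , h≡1) with minimal1-below h k (x [ i ]≔ false) (ℕₚ.≤-trans (ℕₚ.≤-reflexive (#ones-clear x i xᵢ≡1)) (ℕₚ.≤-pred #x<1+k)) h≡1
...   | y , y≤x′ , hy≡1 , minimal = y , (λ j yⱼ≡1 → y≤x j (y≤x′ j yⱼ≡1)) , hy≡1 , minimal
  where
  y≤x : ∀ j → lookup (x [ i ]≔ false) j ≡ true → lookup x j ≡ true
  y≤x j x′ⱼ≡1 with lookup-update x i j false
  ... | inj₁ (x′ⱼ≡0 , _) = ⊥-elim (true≢false (trans (sym x′ⱼ≡1) x′ⱼ≡0))
  ... | inj₂ x′ⱼ≡xⱼ = trans (sym x′ⱼ≡xⱼ) x′ⱼ≡1

maximal0-above : ∀ {n} (h : BoolFn n) k (x : Cube n) → #zeros x ℕ.< k → h x ≡ false → Σ (Cube n) (Maximal0Above h x)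
maximal0-above h (suc k) x #x<1+k hx≡0 with Finₚ.any? (λ i → (lookup x i Data.Bool.≟ false) ×-dec (h (x [ i ]≔ true) Data.Bool.≟ false))
... | no none = x , (λ _ xᵢ≡0 → xᵢ≡0) , hx≡0 , (λ i xᵢ≡0 → ¬-not (λ h≡0 → none (i , xᵢ≡0 , h≡0)))
... | yes (i , xᵢ≡0 , h≡0) with maximal0-above h k (x [ i ]≔ true) (ℕₚ.≤-trans (ℕₚ.≤-reflexive (#zeros-set x i xᵢ≡0)) (ℕₚ.≤-pred #x<1+k)) h≡0
...   | y , x′≤y , hy≡0 , maximal = y , (λ j yⱼ≡0 → x≤y j (x′≤y j yⱼ≡0)) , hy≡0 , maximal
  where
  x≤y : ∀ j → lookup (x [ i ]≔ true) j ≡ false → lookup x j ≡ false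
  x≤y j x′ⱼ≡0 with lookup-update x i j true
  ... | inj₁ (x′ⱼ≡1 , _) = ⊥-elim (true≢false (trans (sym x′ⱼ≡1) x′ⱼ≡0))
  ... | inj₂ x′ⱼ≡xⱼ = trans (sym x′ⱼ≡xⱼ) x′ⱼ≡0

positions : ∀ {n} → Bool → Cube n → List (Fin n)
positions b [] = []
positions b (v ∷ y) with v Data.Bool.≟ b
... | yes _ = zero ∷ map suc (positions b y)
... | no _ = map suc (positions b y)

length-positions-true : ∀ {n} (y : Cube n) → length (positions true y) ≡ #ones y
length-positions-true [] = refl
length-positions-true (true ∷ y) = cong suc (trans (length-map suc (positions true y)) (length-positions-true y))
length-positions-true (false ∷ y) = trans (length-map suc (positions true y)) (length-positions-true y)

length-positions-false : ∀ {n} (y : Cube n) → length (positions false y) ≡ #zeros y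
length-positions-false [] = refl
length-positions-false (false ∷ y) = cong suc (trans (length-map suc (positions false y)) (length-positions-false y))
length-positions-false (true ∷ y) = trans (length-map suc (positions false y)) (length-positions-false y)

∈-positions : ∀ {n} b (y : Cube n) i → lookup y i ≡ b → i ∈ positions b y
∈-positions b (v ∷ y) zero v≡b with v Data.Bool.≟ b
... | yes _ = here refl
... | no v≢b = ⊥-elim (v≢b v≡b)
∈-positions b (v ∷ y) (suc i) yᵢ≡b with v Data.Bool.≟ b
... | yes _ = there (Anyₚ.map⁺ (Any.map (cong suc) (∈-positions b y i yᵢ≡b)))
... | no _ = Anyₚ.map⁺ (Any.map (cong suc) (∈-positions b y i yᵢ≡b))

minimal1-certificate : ∀ {n} (h : BoolFn n) → NonDecreasing h → ∀ x y → h x ≡ true → Minimal1Below h x y →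
  Certificate h x (positions true y)
minimal1-certificate h mono x y hx≡1 (y≤x , hy≡1 , _) z z≈x = trans (true≤B⇒true (subst (_≤B h z) hy≡1 (mono y z (lookup-≼ y z y≤z)))) (sym hx≡1)
  where
  y≤z : ∀ i → lookup y i ≤B lookup z i
  y≤z i with lookup y i in yᵢ≡b
  ... | false = f≤b
  ... | true = subst (true ≤B_) (sym (trans (All.lookup z≈x (∈-positions true y i yᵢ≡b)) (y≤x i yᵢ≡b))) t≤t

maximal0-certificate : ∀ {n} (h : BoolFn n) → NonDecreasing h → ∀ x y → h x ≡ false → Maximal0Above h x y →
  Certificate h x (positions false y)
maximal0-certificate h mono x y hx≡0 (x≤y , hy≡0 , _) z z≈x = trans (≤Bfalse⇒false (subst (h z ≤B_) hy≡0 (mono z y (lookup-≼ z y z≤y)))) (sym hx≡0)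
  where
  z≤y : ∀ i → lookup z i ≤B lookup y i
  z≤y i with lookup y i in yᵢ≡b
  ... | true = b≤Btrue (lookup z i)
  ... | false = subst (_≤B false) (sym (trans (All.lookup z≈x (∈-positions false y i yᵢ≡b)) (x≤y i yᵢ≡b))) f≤b

Disjoint-complement : ∀ {n} (y : Cube n) → Disjoint y (∁ y)
Disjoint-complement [] = _
Disjoint-complement (true ∷ y) = Disjoint-complement y
Disjoint-complement (false ∷ y) = refl , Disjoint-complement y

Disjoint-complement′ : ∀ {n} (y : Cube n) → Disjoint (∁ y) y
Disjoint-complement′ [] = _
Disjoint-complement′ (true ∷ y) = refl , Disjoint-complement′ y
Disjoint-complement′ (false ∷ y) = Disjoint-complement′ y

nonempty-⊆-witness : ∀ {n} (w S : Cube n) → w ⊆ S → 1 ℕ.≤ #ones w → Σ (Fin n) λ i → lookup w i ≡ true × lookup S i ≡ true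
nonempty-⊆-witness (true ∷ w) (s ∷ S) (s≡1 , _) _ = zero , refl , s≡1
nonempty-⊆-witness (false ∷ w) (s ∷ S) w⊆S w≢∅ with nonempty-⊆-witness w S w⊆S w≢∅
... | i , wᵢ≡1 , Sᵢ≡1 = suc i , wᵢ≡1 , Sᵢ≡1

ones : ∀ {n} → Cube n
ones = replicate _ true

lookup-⊕ones : ∀ {n} (x : Cube n) i → lookup (x ⊕ ones) i ≡ not (lookup x i)
lookup-⊕ones x i = trans (lookup-zipWith xorB i x ones) (trans (cong (xorB (lookup x i)) (lookup-replicate i true)) (xor-true (lookup x i)))
  where
  xor-true : ∀ b → xorB b true ≡ not b
  xor-true true = refl
  xor-true false = refl

complement-⊕ones : ∀ {n} (y : Cube n) → ∁ y ⊕ ones ≡ y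
complement-⊕ones y = lookup-ext _ _ (λ i → trans (lookup-⊕ones (∁ y) i) (trans (cong not (lookup-map i not y)) (not-involutive (lookup y i))))

maximal0-size : ∀ {n} ε c → 0ℚ ≤ ε → 8 ℕ.≤ c → Admissible c ε → (h : BoolFn n) → NonDecreasing h → ∀ m →
  NDegLe ε (compl h) m → ∀ y → h y ≡ false → (∀ i → lookup y i ≡ false → h (y [ i ]≔ true) ≡ true) → #zeros y ℕ.≤ scaledSq c m
maximal0-size ε c 0≤ε 8≤c admissible h mono m ndeg y hy≡0 maximal =
  subst (ℕ._≤ scaledSq c m) (#ones-complement y)
    (switch-bound ε c 0≤ε 8≤c admissible (compl h) m ndeg (∁ y) y (Disjoint-complement y) (cong not hy≡0) raised)
  where
  raised : ∀ w → w ⊆ ∁ y → 1 ℕ.≤ #ones w → not (h (y ∪ w)) ≡ false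
  raised w w⊆∁y w≢∅ with nonempty-⊆-witness w (∁ y) w⊆∁y w≢∅
  ... | i , wᵢ≡1 , ∁yᵢ≡1 = cong not (true≤B⇒true (subst (_≤B h (y ∪ w)) (maximal i yᵢ≡0) (mono _ _ (lookup-≼ _ _ y[i]≤y∪w))))
    where
    yᵢ≡0 : lookup y i ≡ false
    yᵢ≡0 = trans (sym (not-involutive (lookup y i))) (cong not (trans (sym (lookup-map i not y)) ∁yᵢ≡1))
    y[i]≤y∪w : ∀ j → lookup (y [ i ]≔ true) j ≤B lookup (y ∪ w) j
    y[i]≤y∪w j with lookup-update y i j true
    ... | inj₁ (y′ⱼ≡1 , refl) = subst₂ _≤B_ (sym y′ⱼ≡1) (sym (trans (lookup-∪ y w j) (trans (cong (lookup y j ∨_) wᵢ≡1) (∨-zeroʳ (lookup y j))))) t≤t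
    ... | inj₂ y′ⱼ≡yⱼ = subst₂ _≤B_ (sym y′ⱼ≡yⱼ) (sym (lookup-∪ y w j)) (≤B-∨ (lookup y j) (lookup w j))
      where
      ≤B-∨ : ∀ a b → a ≤B (a ∨ b)
      ≤B-∨ false b = f≤b
      ≤B-∨ true b = t≤t

minimal1-size : ∀ {n} ε c → 0ℚ ≤ ε → 8 ℕ.≤ c → Admissible c ε → (h : BoolFn n) → NonDecreasing h → ∀ m →
  NDegLe ε h m → ∀ y → h y ≡ true → (∀ i → lookup y i ≡ true → h (y [ i ]≔ false) ≡ false) → #ones y ℕ.≤ scaledSq c m
minimal1-size ε c 0≤ε 8≤c admissible h mono m ndeg y hy≡1 minimal =
  switch-bound ε c 0≤ε 8≤c admissible (λ z → h (z ⊕ ones)) m (NDegLe-xor ones (λ _ → refl) ndeg) y (∁ y)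
    (Disjoint-complement′ y) (trans (cong h (complement-⊕ones y)) hy≡1) lowered
  where
  lowered : ∀ w → w ⊆ y → 1 ℕ.≤ #ones w → h ((∁ y ∪ w) ⊕ ones) ≡ false
  lowered w w⊆y w≢∅ with nonempty-⊆-witness w y w⊆y w≢∅
  ... | i , wᵢ≡1 , yᵢ≡1 = ≤Bfalse⇒false (subst (h v ≤B_) (minimal i yᵢ≡1) (mono _ _ (lookup-≼ _ _ v≤y[i])))
    where
    v = (∁ y ∪ w) ⊕ ones
    lookup-v : ∀ j → lookup v j ≡ not (not (lookup y j) ∨ lookup w j)
    lookup-v j = trans (lookup-⊕ones (∁ y ∪ w) j) (cong not (trans (lookup-∪ (∁ y) w j) (cong (_∨ lookup w j) (lookup-map j not y))))
    v≤y[i] : ∀ j → lookup v j ≤B lookup (y [ i ]≔ false) j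
    v≤y[i] j with lookup-update y i j false
    ... | inj₁ (y′ⱼ≡0 , refl) = subst₂ _≤B_ (sym (trans (lookup-v j) (cong (λ u → not (not (lookup y j) ∨ u)) wᵢ≡1))) (sym y′ⱼ≡0)
                                  (subst (_≤B false) (cong not (sym (∨-zeroʳ (not (lookup y j))))) f≤b)
    ... | inj₂ y′ⱼ≡yⱼ = subst₂ _≤B_ (sym (lookup-v j)) (sym y′ⱼ≡yⱼ) (≤B-and-not (lookup y j) (lookup w j))
      where
      ≤B-and-not : ∀ a b → not (not a ∨ b) ≤B a
      ≤B-and-not false b = f≤b
      ≤B-and-not true false = t≤t
      ≤B-and-not true true = f≤b

⟨⟩-toℚᵘ : ∀ N → toℚᵘ ⟨ N ⟩ ℚᵘ.≃ ℚᵘ.mkℚᵘ (ℤ.+ N) 0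
⟨⟩-toℚᵘ zero = ℚᵘₚ.≃-refl
⟨⟩-toℚᵘ (suc N) = ℚᵘₚ.≃-trans (toℚᵘ-homo-+ 1ℚ ⟨ N ⟩) (ℚᵘₚ.≃-trans (ℚᵘₚ.+-congʳ (toℚᵘ 1ℚ) (⟨⟩-toℚᵘ N)) (ℚᵘ.*≡* cross))
  where
  cross : (ℤ.+ 1 ℤ.* ℤ.+ 1 ℤ.+ ℤ.+ N ℤ.* ℤ.+ 1) ℤ.* ℤ.+ 1 ≡ ℤ.+ suc N ℤ.* (ℤ.+ 1 ℤ.* ℤ.+ 1)
  cross = trans (ℤₚ.*-identityʳ _) (trans (cong (λ w → ℤ.+ 1 ℤ.+ w) (ℤₚ.*-identityʳ (ℤ.+ N))) (sym (ℤₚ.*-identityʳ (ℤ.+ suc N))))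

archimedean : ∀ p → Σ ℕ λ N → p < ⟨ N ⟩
archimedean p@(mkℚ n d _) = suc ℤ.∣ n ∣ , toℚᵘ-cancel-< (ℚᵘₚ.<-respʳ-≃ (ℚᵘₚ.≃-sym (⟨⟩-toℚᵘ (suc ℤ.∣ n ∣))) (ℚᵘ.*<* n<[1+∣n∣]d))
  where
  n<[1+∣n∣]d : n ℤ.* ℤ.+ 1 ℤ.< ℤ.+ suc ℤ.∣ n ∣ ℤ.* ℤ.+ suc d
  n<[1+∣n∣]d = ℤₚ.≤-<-trans (ℤₚ.≤-reflexive (ℤₚ.*-identityʳ n)) (ℤₚ.≤-<-trans (i≤∣i∣ n)
    (ℤₚ.<-≤-trans (ℤ.+<+ (ℕₚ.n<1+n _)) (ℤ.+≤+ (ℕₚ.m≤m*n (suc ℤ.∣ n ∣) (suc d)))))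
    where
    i≤∣i∣ : ∀ i → i ℤ.≤ ℤ.+ ℤ.∣ i ∣
    i≤∣i∣ (ℤ.+ k) = ℤₚ.≤-refl
    i≤∣i∣ ℤ.-[1+ k ] = ℤ.-≤+

admissible-scale : ∀ ε → 0ℚ < ε → ε < 1ℚ → Σ ℕ λ c → 8 ℕ.≤ c × Admissible c ε
admissible-scale ε 0<ε ε<1 with archimedean (recip (1ℚ - ε))
... | N , η⁻¹<N = c , ℕₚ.m≤n+m 8 (16 ℕ.* N) , admissible
  where
  c = 16 ℕ.* N ℕ.+ 8
  η = 1ℚ - ε
  0<η : 0ℚ < η
  0<η = subst (_< η) (+-inverseʳ ε) (+-monoˡ-< (- ε) ε<1)
  0<N : 0 ℕ.< N
  0<N = ℕₚ.n≢0⇒n>0 (λ N≡0 → <-asym (recip-pos 0<η) (subst (λ k → recip η < ⟨ k ⟩) N≡0 η⁻¹<N))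
  N⁻¹<η : recip ⟨ N ⟩ < η
  N⁻¹<η = subst (recip ⟨ N ⟩ <_) (recip-involutive η) (recip-antimono-< (recip-pos 0<η) η⁻¹<N)
  16K≤N⁻¹ : ⟨ 4 ⟩ * K c ≤ recip ⟨ N ⟩
  16K≤N⁻¹ = begin
    ⟨ 4 ⟩ * (⟨ 4 ⟩ * recip ⟨ c ⟩)       ≡⟨ trans (sym (*-assoc ⟨ 4 ⟩ ⟨ 4 ⟩ (recip ⟨ c ⟩))) (cong (_* recip ⟨ c ⟩) (sym (⟨⟩-homo-* 4 4))) ⟩
    ⟨ 16 ⟩ * recip ⟨ c ⟩                ≤⟨ *-monoˡ-≤-0≤ ⟨ 16 ⟩ (⟨⟩-nonNeg 16) (recip-antimono-≤ (⟨⟩-pos (0<m*n {16} (ℕ.s≤s ℕ.z≤n) 0<N))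
                                             (⟨⟩-mono-≤ (ℕₚ.m≤m+n (16 ℕ.* N) 8))) ⟩
    ⟨ 16 ⟩ * recip ⟨ 16 ℕ.* N ⟩         ≡⟨ cong (λ z → ⟨ 16 ⟩ * recip z) (⟨⟩-homo-* 16 N) ⟩
    ⟨ 16 ⟩ * recip (⟨ 16 ⟩ * ⟨ N ⟩)     ≡⟨ recip-cancelˡ ⟨ 16 ⟩ ⟨ N ⟩ (⟨⟩-nonZero {16} (ℕ.s≤s ℕ.z≤n)) ⟩
    recip ⟨ N ⟩                         ∎
    where open ≤-Reasoning
  admissible : ε * (1ℚ + ⟨ 4 ⟩ * K c) < 1ℚ
  admissible = begin-strict
    ε * (1ℚ + X)     ≡⟨ solve 2 (λ e x → e :* (con 1ℚ :+ x) := e :+ e :* x) refl ε X ⟩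
    ε + ε * X        ≤⟨ +-monoʳ-≤ ε (subst (ε * X ≤_) (*-identityˡ X) (*-monoʳ-≤-0≤ X 0≤X (<⇒≤ ε<1))) ⟩
    ε + X            ≤⟨ +-monoʳ-≤ ε 16K≤N⁻¹ ⟩
    ε + recip ⟨ N ⟩  <⟨ +-monoʳ-< ε N⁻¹<η ⟩
    ε + η            ≡⟨ solve 1 (λ e → e :+ (con 1ℚ :- e) := con 1ℚ) refl ε ⟩
    1ℚ               ∎
    where
    open ≤-Reasoning
    X = ⟨ 4 ⟩ * K c
    0≤X = 0≤p*q (⟨⟩-nonNeg 4) (K-nonNeg c)

ExactDegLe⇒ApproxDegLe : ∀ {n} (h : BoolFn n) d → ExactDegLe h d → ApproxDegLe h d
ExactDegLe⇒ApproxDegLe h d (p , deg-p , p≡h) = p , deg-p , λ x →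
  subst (_≤ ℤ.+ 1 / 3) (sym (trans (cong (λ u → ∣ ⟦ h x ⟧ - u ∣) (p≡h x)) (cong ∣_∣ (+-inverseʳ ⟦ h x ⟧)))) (<⇒≤ (positive⁻¹ _))

monotone-exactDeg : ∀ {n} ε c → 0ℚ ≤ ε → 8 ℕ.≤ c → Admissible c ε → (h : BoolFn n) → NonDecreasing h → ∀ m →
  MDegLe ε h m → ExactDegLe h (scaledSq c m ℕ.* scaledSq c m)
monotone-exactDeg ε c 0≤ε 8≤c admissible h mono m (ndeg-h , ndeg-h̄) = exactDeg≤C₀*C₁ B h B C₁≤B C₀≤B
  where
  B = scaledSq c m
  C₁≤B : C₁≤ h B
  C₁≤B x hx≡1 with minimal1-below h (suc (#ones x)) x ℕₚ.≤-refl hx≡1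
  ... | y , min@(_ , hy≡1 , minimal) = positions true y ,
    subst (ℕ._≤ B) (sym (length-positions-true y)) (minimal1-size ε c 0≤ε 8≤c admissible h mono m ndeg-h y hy≡1 minimal) ,
    minimal1-certificate h mono x y hx≡1 min
  C₀≤B : C₀≤ h B
  C₀≤B x hx≡0 with maximal0-above h (suc (#zeros x)) x ℕₚ.≤-refl hx≡0
  ... | y , max@(_ , hy≡0 , maximal) = positions false y ,
    subst (ℕ._≤ B) (sym (length-positions-false y)) (maximal0-size ε c 0≤ε 8≤c admissible h mono m ndeg-h̄ y hy≡0 maximal) ,
    maximal0-certificate h mono x y hx≡0 max

⊕-involutive : ∀ {n} (x b : Cube n) → (x ⊕ b) ⊕ b ≡ x
⊕-involutive [] [] = refl
⊕-involutive (a ∷ x) (c ∷ b) = cong₂ _∷_ (xorB-involutive a c) (⊕-involutive x b)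
  where
  xorB-involutive : ∀ a c → xorB (xorB a c) c ≡ a
  xorB-involutive true true = refl
  xorB-involutive true false = refl
  xorB-involutive false true = refl
  xorB-involutive false false = refl

⊕-flip : ∀ {n} (x a : Cube n) → (x ⊕ (a ⊕ ones)) ⊕ ones ≡ x ⊕ a
⊕-flip [] [] = refl
⊕-flip (u ∷ x) (v ∷ a) = cong₂ _∷_ (xorB-flip u v) (⊕-flip x a)
  where
  xorB-flip : ∀ u v → xorB (xorB u (xorB v true)) true ≡ xorB u v
  xorB-flip true true = refl
  xorB-flip true false = refl
  xorB-flip false true = refl
  xorB-flip false false = refl

≼-flip : ∀ {n} {x y : Cube n} → x ≼ y → (y ⊕ ones) ≼ (x ⊕ ones)
≼-flip []≼ = []≼
≼-flip (a≤b ∷≼ x≼y) = not-antitone a≤b ∷≼ ≼-flip x≼y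
  where
  not-antitone : ∀ {a b} → a ≤B b → xorB b true ≤B xorB a true
  not-antitone {b = false} f≤b = t≤t
  not-antitone {b = true} f≤b = f≤b
  not-antitone t≤t = f≤b

unate⇒nonDecreasing : ∀ {n} (f : BoolFn n) → Unate f →
  Σ (BoolFn n) λ h → Σ (Cube n) λ b → NonDecreasing h × (∀ x → f x ≡ h (x ⊕ b))
unate⇒nonDecreasing f (a , g , inj₁ nd , f≡g) = g , a , nd , f≡g
unate⇒nonDecreasing f (a , g , inj₂ ni , f≡g) = (λ y → g (y ⊕ ones)) , a ⊕ ones ,
  (λ x y x≼y → ni (y ⊕ ones) (x ⊕ ones) (≼-flip x≼y)) , (λ x → trans (f≡g x) (cong g (sym (⊕-flip x a))))

ApproxDegLe-xor : ∀ {n} (f h : BoolFn n) b d → (∀ x → f x ≡ h (x ⊕ b)) → ApproxDegLe h d → ApproxDegLe f d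
ApproxDegLe-xor f h b d f≗h∘⊕b (p , deg-p , approx) = xorPoly p b , DegLe-xorPoly b deg-p , λ x →
  subst (_≤ ℤ.+ 1 / 3) (sym (cong₂ (λ s t → ∣ ⟦ s ⟧ - t ∣) (f≗h∘⊕b x) (eval-xorPoly p b x))) (approx (x ⊕ b))

unate-approxDeg : ∀ {n} ε c → 0ℚ ≤ ε → 8 ℕ.≤ c → Admissible c ε → (f : BoolFn n) → Unate f → ∀ m →
  MDegLe ε f m → ApproxDegLe f (scaledSq c m ℕ.* scaledSq c m)
unate-approxDeg ε c 0≤ε 8≤c admissible f unate m (ndeg-f , ndeg-f̄) with unate⇒nonDecreasing f unate
... | h , b , mono , f≡h∘⊕b = ApproxDegLe-xor f h b _ f≡h∘⊕b (ExactDegLe⇒ApproxDegLe h _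
  (monotone-exactDeg ε c 0≤ε 8≤c admissible h mono m (NDegLe-xor b h≡f∘⊕b ndeg-f , NDegLe-xor b (λ y → cong not (h≡f∘⊕b y)) ndeg-f̄)))
  where
  h≡f∘⊕b : ∀ y → h y ≡ f (y ⊕ b)
  h≡f∘⊕b y = trans (cong h (sym (⊕-involutive y b))) (sym (f≡h∘⊕b (y ⊕ b)))

lemma7 : (ε : ℚ) → 0ℚ < ε → ε < 1ℚ →
    Σ ℕ λ C → ∀ n (f : BoolFn n) → Unate f →
      ∀ m → MDegLe ε f m → ApproxDegLe f (C ℕ.* m ℕ.^ 4)
lemma7 ε 0<ε ε<1 =
  let (c , 8≤c , admissible) = admissible-scale ε 0<ε ε<1
  in c ℕ.* c , λ n f unate m mdeg →
       subst (ApproxDegLe f) (scaledSq² c m) (unate-approxDeg ε c (<⇒≤ 0<ε) 8≤c admissible f unate m mdeg)
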